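{- Let $n\ge 1$ and let $x,k,l,m$ be nonnegative integers with $k\le n$. Deleting the $k$ entries of a 321-hex permutation $w\in\mathcal{H}_n(x,k,l,m)$ that are counted by $k$ (these are $w_{n-k+1},\dots,w_n$) and standardizing the remaining entries to a permutation of $\{1,\dots,n-k\}$ gives a bijection $\mathcal{H}_n(x,k,l,m)\to\mathcal{H}_{n-k}(x-k,0,0,0)$. Consequently $h_n(x,k,l,m)=h_{n-k}(x-k,0,0,0)$.
   Context: A permutation $w\in S_n$ (one-line notation $[w_1,\dots,w_n]$) contains $v\in S_k$ if some subsequence $w_{i_1},\dots,w_{i_k}$ ($i_1<\dots<i_k$) has the same relative order as $v_1,\dots,v_k$; otherwise it avoids $v$. A 321-hex permutation is one avoiding $[321]$, $[46718235]$, $[46781235]$, $[56718234]$, $[56781234]$; $\mathcal{H}_n$ is the set of such permutations in $S_n$. For $w\in\mathcal{H}_n$ let $\mathcal{B}_1(w)$ be the set of right-to-left minima of $w$ (entries $w_i$ with $w_i<w_j$ for all $j>i$; this includes $w_n$), and $\mathcal{B}_2(w)$ the remaining entries. Let $K<L<M$ be the three largest entries of $\mathcal{B}_2(w)$, each set to $0$ if it does not exist. If $M\neq 0$ and $M=w_{i}$, the active region consists of the positions $i+1,\dots,n$ and $x=n-i$; if $\mathcal{B}_2(w)=\emptyset$ the whole of $w$ is the active region and $x=n$. Let $k$ (resp. $l$, $m$) be the number of entries in the active region larger than $K$ (resp. $L$, $M$). The label of $w$ is $(x,k,l,m)$ (so $x\ge k\ge l\ge m$). $\mathcal{H}_n(x,k,l,m)$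 is the set of $w\in\mathcal{H}_n$ with label $(x,k,l,m)$ and $h_n(x,k,l,m)$ its cardinality, except that by convention $\mathcal{H}_n(0,0,0,0)$ denotes the set of $w\in\mathcal{H}_n$ with $w_n=n$ (and $h_n(0,0,0,0)$ its size; for $n=0$ this is the set containing the empty permutation). -}

module Defs where

open import Data.Bool using (Bool; true; false; _∧_; not; if_then_else_; _xor_; T)
open import Data.Nat using (ℕ; zero; suc; _∸_; _⊔_; _≡ᵇ_; _<ᵇ_)
open import Data.List using (List; []; _∷_; map; concatMap; length; filterᵇ; zipWith; upTo; take)
open import Data.Bool.ListAction using (any; and)
open import Data.Product using (_×_; _,_)
open import Data.List.Relation.Binary.Permutation.Propositional using (_↭_)

-- Permutations in one-line notation are lists of natural numbers.
-- w ∈ S_n  iff  w is a rearrangement of [1, 2, …, n].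
IsPerm : ℕ → List ℕ → Set
IsPerm n w = w ↭ map suc (upTo n)

subseqs : List ℕ → List (List ℕ)
subseqs []      = [] ∷ []
subseqs (a ∷ w) = map (a ∷_) (subseqs w) Data.List.++ subseqs w

-- s and v have the same length and the same relative order:
-- for all i < j,  s_i < s_j  ⇔  v_i < v_j
sameOrder : List ℕ → List ℕ → Bool
sameOrder []      []      = true
sameOrder []      (_ ∷ _) = false
sameOrder (_ ∷ _) []      = false
sameOrder (a ∷ s) (b ∷ v) =
  and (zipWith (λ a' b' → not ((a <ᵇ a') xor (b <ᵇ b'))) s v) ∧ sameOrder s v

contains : List ℕ → List ℕ → Bool
contains w v = any (λ s → sameOrder s v) (subseqs w)

avoids : List ℕ → List ℕ → Bool
avoids w v = not (contains w v)

hex : List ℕ → Bool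
hex w = avoids w (3 ∷ 2 ∷ 1 ∷ [])
      ∧ avoids w (4 ∷ 6 ∷ 7 ∷ 1 ∷ 8 ∷ 2 ∷ 3 ∷ 5 ∷ [])
      ∧ avoids w (4 ∷ 6 ∷ 7 ∷ 8 ∷ 1 ∷ 2 ∷ 3 ∷ 5 ∷ [])
      ∧ avoids w (5 ∷ 6 ∷ 7 ∷ 1 ∷ 8 ∷ 2 ∷ 3 ∷ 4 ∷ [])
      ∧ avoids w (5 ∷ 6 ∷ 7 ∷ 8 ∷ 1 ∷ 2 ∷ 3 ∷ 4 ∷ [])

-- B₂(w): entries that are NOT right-to-left minima, i.e. that have a
-- smaller entry somewhere to their right (listed in order of position).
B₂ : List ℕ → List ℕ
B₂ []      = []
B₂ (a ∷ r) = if any (_<ᵇ a) r then a ∷ B₂ r else B₂ r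

maxBelow : ℕ → List ℕ → ℕ
maxBelow bound []       = 0
maxBelow bound (a ∷ xs) = if a <ᵇ bound then a ⊔ maxBelow bound xs else maxBelow bound xs

maxList : List ℕ → ℕ
maxList []       = 0
maxList (a ∷ xs) = a ⊔ maxList xs

-- K < L < M: the three largest entries of B₂(w), 0 if they do not exist
M-of : List ℕ → ℕ
M-of w = maxList (B₂ w)

L-of : List ℕ → ℕ
L-of w = maxBelow (M-of w) (B₂ w)

K-of : List ℕ → ℕ
K-of w = maxBelow (L-of w) (B₂ w)

after : ℕ → List ℕ → List ℕ
after a []      = []
after a (b ∷ r) = if b ≡ᵇ a then r else after a r

-- active region: positions after M if M ≠ 0; all of w if B₂(w) = ∅ (M = 0)
active : List ℕ → List ℕ
active w = if M-of w ≡ᵇ 0 then w else after (M-of w) w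

countᵇ : (ℕ → Bool) → List ℕ → ℕ
countᵇ p xs = length (filterᵇ p xs)

label : List ℕ → ℕ × ℕ × ℕ × ℕ
label w = length (active w)
        , countᵇ (K-of w <ᵇ_) (active w)
        , countᵇ (L-of w <ᵇ_) (active w)
        , countᵇ (M-of w <ᵇ_) (active w)

countedByK : List ℕ → List ℕ
countedByK w = filterᵇ (K-of w <ᵇ_) (active w)

-- last entry equals n (the empty list counts as "ending with 0",
-- giving H₀(0,0,0,0) = {empty permutation})
lastIs : ℕ → List ℕ → Bool
lastIs n []          = n ≡ᵇ 0
lastIs n (a ∷ [])    = a ≡ᵇ n
lastIs n (a ∷ b ∷ r) = lastIs n (b ∷ r)

isZeroLabel : ℕ → ℕ → ℕ → ℕ → Bool
isZeroLabel x k l m = (x ≡ᵇ 0) ∧ (k ≡ᵇ 0) ∧ (l ≡ᵇ 0) ∧ (m ≡ᵇ 0)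

labelIs : ℕ → ℕ → ℕ → ℕ → List ℕ → Bool
labelIs x k l m w with label w
... | (x' , k' , l' , m') = (x' ≡ᵇ x) ∧ (k' ≡ᵇ k) ∧ (l' ≡ᵇ l) ∧ (m' ≡ᵇ m)

inHᵇ : ℕ → ℕ → ℕ → ℕ → ℕ → List ℕ → Bool
inHᵇ n x k l m w =
  hex w ∧ (if isZeroLabel x k l m then lastIs n w else labelIs x k l m w)

InH : ℕ → ℕ → ℕ → ℕ → ℕ → List ℕ → Set
InH n x k l m w = IsPerm n w × T (inHᵇ n x k l m w)

insertEverywhere : ℕ → List ℕ → List (List ℕ)
insertEverywhere a []      = (a ∷ []) ∷ []
insertEverywhere a (b ∷ r) = (a ∷ b ∷ r) ∷ map (b ∷_) (insertEverywhere a r)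

perms : ℕ → List (List ℕ)
perms zero    = [] ∷ []
perms (suc n) = concatMap (insertEverywhere (suc n)) (perms n)

h : ℕ → ℕ → ℕ → ℕ → ℕ → ℕ
h n x k l m = length (filterᵇ (inHᵇ n x k l m) (perms n))

standardize : List ℕ → List ℕ
standardize w = map (λ a → suc (countᵇ (_<ᵇ a) w)) w

delStd : ℕ → List ℕ → List ℕ
delStd k w = standardize (take (length w ∸ k) w)

{-# OPTIONS --safe #-}
-- Write N = n - k.  If the label of w is not (0, 0, 0, 0), then w = preM ++ A where preM ends
-- with M and the active region A is increasing (w avoids 321).  Counting the entries above
-- K, L, M in preM and in A shows that M = n - m, L = n - l - 1 and that the k entries of A
-- above K are exactly the top block: the values above N - 2 other than L and M, sitting at
-- the end of w.  Deleting them and standardizing is undone by an explicit strictly monotone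
-- relabelling (N - 1 ↦ L, N ↦ M) followed by appending the top block, so deletion is
-- injective.  Conversely the inflation of any u ∈ H_N(x - k, 0, 0, 0) is again 321-hex
-- (a pattern entry in the top block is exceeded by at most the two entries L and M, too few
-- for the long patterns) and has label (x, k, l, m).
module Submission where

open import Defs
open import Data.Bool using (Bool; true; false; _∧_; _∨_; not; if_then_else_; T; _xor_)
open import Data.Bool.Properties using (∧-zeroʳ)
open import Data.Bool.ListAction using (any; and)
open import Data.Nat using (ℕ; zero; suc; _+_; _∸_; _⊔_; _≤_; _<_; z≤n; s≤s; z<s; _≡ᵇ_; _<ᵇ_)
open import Data.Nat.Properties
open import Data.List using (List; []; _∷_; _++_; map; length; filterᵇ; take; drop; upTo; applyUpTo; [_]; zipWith)
import Data.List.Properties as LP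
open import Data.List.Membership.Propositional using (_∈_; _∉_)
import Data.List.Membership.Propositional.Properties as MP
open import Data.List.Membership.Propositional.Properties.WithK using (unique∧set⇒bag)
open import Data.List.Membership.DecPropositional _≟_ using (_∈?_)
open import Data.List.Relation.Unary.Any using (here; there)
open import Data.List.Relation.Unary.All using (All; []; _∷_; lookup; tabulate)
import Data.List.Relation.Unary.All.Properties as AllP
import Data.List.Relation.Unary.AllPairs as AllPairs
open AllPairs using (AllPairs; []; _∷_)
import Data.List.Relation.Unary.AllPairs.Properties as APP
open import Data.List.Relation.Unary.Unique.Propositional using (Unique)
import Data.List.Relation.Unary.Unique.Propositional.Properties as UP
import Data.List.Relation.Binary.Permutation.Propositional as Perm
open Perm using (_↭_; ↭-refl; ↭-sym; ↭-trans; ↭-reflexive; prep; swap)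
import Data.List.Relation.Binary.Permutation.Propositional.Properties as PP
open import Data.List.Relation.Binary.Disjoint.Propositional using (Disjoint)
open import Data.List.Relation.Binary.BagAndSetEquality using (∼bag⇒↭)
open import Data.Product using (∃; _×_; _,_; proj₁; proj₂)
open import Data.Sum using (_⊎_; inj₁; inj₂; [_,_]′)
open import Data.Empty using (⊥; ⊥-elim)
open import Data.Unit using (tt)
open import Function using (_∘_)
open import Function.Bundles using (mk⇔)
open import Relation.Nullary using (¬_; yes; no)
open import Relation.Nullary.Decidable using (T?)
open import Relation.Binary.Definitions using (tri<; tri≈; tri>)
open import Relation.Binary.PropositionalEquality hiding ([_])

<ᵇ-true : ∀ {a b} → a < b → (a <ᵇ b) ≡ true
<ᵇ-true {a} {b} p with a <ᵇ b | <⇒<ᵇ p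
... | true | _ = refl

<ᵇ-true⁻ : ∀ {a b} → (a <ᵇ b) ≡ true → a < b
<ᵇ-true⁻ {a} {b} e = <ᵇ⇒< a b (subst T (sym e) tt)

<ᵇ-false : ∀ {a b} → b ≤ a → (a <ᵇ b) ≡ false
<ᵇ-false {a} {b} p with a <ᵇ b in eq
... | false = refl
... | true = ⊥-elim (<⇒≱ (<ᵇ-true⁻ eq) p)

<ᵇ-false⁻ : ∀ {a b} → (a <ᵇ b) ≡ false → b ≤ a
<ᵇ-false⁻ {a} {b} e = ≮⇒≥ (λ lt → true≢false (trans (sym (<ᵇ-true lt)) e))
  where
  true≢false : true ≢ false
  true≢false ()

≡ᵇ-true⁻ : ∀ {a b} → (a ≡ᵇ b) ≡ true → a ≡ b
≡ᵇ-true⁻ {a} {b} e = ≡ᵇ⇒≡ a b (subst T (sym e) tt)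

≡ᵇ-true : ∀ {a b} → a ≡ b → (a ≡ᵇ b) ≡ true
≡ᵇ-true {a} {b} p with a ≡ᵇ b | ≡⇒≡ᵇ a b p
... | true | _ = refl

≡ᵇ-false : ∀ {a b} → a ≢ b → (a ≡ᵇ b) ≡ false
≡ᵇ-false {a} {b} p with a ≡ᵇ b in eq
... | false = refl
... | true = ⊥-elim (p (≡ᵇ-true⁻ eq))

true≢false : true ≢ false
true≢false ()

not-true⁻ : ∀ {b} → not b ≡ true → b ≡ false
not-true⁻ {false} _ = refl

∧-trueˡ : ∀ {a b} → (a ∧ b) ≡ true → a ≡ true
∧-trueˡ {true} e = refl

∧-trueʳ : ∀ {a b} → (a ∧ b) ≡ true → b ≡ true
∧-trueʳ {true} e = e

∨-trueʳ : ∀ {a b} → b ≡ true → (a ∨ b) ≡ true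
∨-trueʳ {true} e = refl
∨-trueʳ {false} e = e

true-or-false : ∀ (b : Bool) → b ≡ true ⊎ b ≡ false
true-or-false true = inj₁ refl
true-or-false false = inj₂ refl

T⇒≡true : ∀ {b} → T b → b ≡ true
T⇒≡true {true} _ = refl

≡true⇒T : ∀ {b} → b ≡ true → T b
≡true⇒T refl = tt

filterᵇ-accept : ∀ (p : ℕ → Bool) {x} xs → p x ≡ true → filterᵇ p (x ∷ xs) ≡ x ∷ filterᵇ p xs
filterᵇ-accept p {x} xs e with p x
... | true = refl

filterᵇ-reject : ∀ (p : ℕ → Bool) {x} xs → p x ≡ false → filterᵇ p (x ∷ xs) ≡ filterᵇ p xs
filterᵇ-reject p {x} xs e with p x
... | false = refl

filterᵇ-all : ∀ (p : ℕ → Bool) xs → (∀ v → v ∈ xs → p v ≡ true) → filterᵇ p xs ≡ xs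
filterᵇ-all p xs h = LP.filter-all (T? ∘ p) (tabulate (λ m → ≡true⇒T (h _ m)))

filterᵇ-none : ∀ (p : ℕ → Bool) xs → (∀ v → v ∈ xs → p v ≡ false) → filterᵇ p xs ≡ []
filterᵇ-none p xs h = LP.filter-none (T? ∘ p) (tabulate (λ m t → true≢false (trans (sym (T⇒≡true t)) (h _ m))))

∈-filterᵇ⁺ : ∀ {A : Set} (p : A → Bool) {v} xs → v ∈ xs → p v ≡ true → v ∈ filterᵇ p xs
∈-filterᵇ⁺ p xs m e = MP.∈-filter⁺ (T? ∘ p) m (≡true⇒T e)

∈-filterᵇ⁻ : ∀ {A : Set} (p : A → Bool) {v} xs → v ∈ filterᵇ p xs → v ∈ xs × p v ≡ true
∈-filterᵇ⁻ p xs m with MP.∈-filter⁻ (T? ∘ p) {xs = xs} m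
... | (m′ , t) = m′ , T⇒≡true t

countᵇ-++ : ∀ (p : ℕ → Bool) xs ys → countᵇ p (xs ++ ys) ≡ countᵇ p xs + countᵇ p ys
countᵇ-++ p xs ys rewrite LP.filter-++ (T? ∘ p) xs ys = LP.length-++ (filterᵇ p xs)

countᵇ-accept : ∀ (p : ℕ → Bool) {x} xs → p x ≡ true → countᵇ p (x ∷ xs) ≡ suc (countᵇ p xs)
countᵇ-accept p xs e rewrite filterᵇ-accept p xs e = refl

countᵇ-reject : ∀ (p : ℕ → Bool) {x} xs → p x ≡ false → countᵇ p (x ∷ xs) ≡ countᵇ p xs
countᵇ-reject p xs e rewrite filterᵇ-reject p xs e = refl

countᵇ-resp-↭ : ∀ (p : ℕ → Bool) {xs ys} → xs ↭ ys → countᵇ p xs ≡ countᵇ p ys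
countᵇ-resp-↭ p r = PP.↭-length (PP.filter-↭ (T? ∘ p) r)

countᵇ≤length : ∀ (p : ℕ → Bool) xs → countᵇ p xs ≤ length xs
countᵇ≤length p xs = LP.length-filter (T? ∘ p) xs

countᵇ-∷-≤ : ∀ (p : ℕ → Bool) x xs → countᵇ p xs ≤ countᵇ p (x ∷ xs)
countᵇ-∷-≤ p x xs with p x
... | true = n≤1+n _
... | false = ≤-refl

countᵇ-mono : ∀ (p q : ℕ → Bool) xs → (∀ v → v ∈ xs → p v ≡ true → q v ≡ true) → countᵇ p xs ≤ countᵇ q xs
countᵇ-mono p q [] h = z≤n
countᵇ-mono p q (x ∷ xs) h with p x in ep | q x in eq
... | true | true = s≤s (countᵇ-mono p q xs (λ v m → h v (there m)))
... | true | false = ⊥-elim (true≢false (trans (sym (h x (here refl) ep)) eq))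
... | false | true = m≤n⇒m≤1+n (countᵇ-mono p q xs (λ v m → h v (there m)))
... | false | false = countᵇ-mono p q xs (λ v m → h v (there m))

countᵇ-none : ∀ (p : ℕ → Bool) xs → (∀ v → v ∈ xs → p v ≡ false) → countᵇ p xs ≡ 0
countᵇ-none p xs h = cong length (filterᵇ-none p xs h)

countᵇ-all : ∀ (p : ℕ → Bool) xs → (∀ v → v ∈ xs → p v ≡ true) → countᵇ p xs ≡ length xs
countᵇ-all p xs h = cong length (filterᵇ-all p xs h)

countᵇ≥1 : ∀ (p : ℕ → Bool) {v} xs → v ∈ xs → p v ≡ true → 1 ≤ countᵇ p xs
countᵇ≥1 p (x ∷ xs) (here refl) e rewrite countᵇ-accept p {x} xs e = s≤s z≤n
countᵇ≥1 p (x ∷ xs) (there m) e = ≤-trans (countᵇ≥1 p xs m e) (countᵇ-∷-≤ p x xs)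

countᵇ≥2 : ∀ (p : ℕ → Bool) {u v} xs → u ∈ xs → v ∈ xs → u ≢ v → p u ≡ true → p v ≡ true → 2 ≤ countᵇ p xs
countᵇ≥2 p (x ∷ xs) (here refl) (here refl) ne _ _ = ⊥-elim (ne refl)
countᵇ≥2 p (x ∷ xs) (here refl) (there mv) ne eu ev rewrite countᵇ-accept p {x} xs eu = s≤s (countᵇ≥1 p xs mv ev)
countᵇ≥2 p (x ∷ xs) (there mu) (here refl) ne eu ev rewrite countᵇ-accept p {x} xs ev = s≤s (countᵇ≥1 p xs mu eu)
countᵇ≥2 p (x ∷ xs) (there mu) (there mv) ne eu ev = ≤-trans (countᵇ≥2 p xs mu mv ne eu ev) (countᵇ-∷-≤ p x xs)

countᵇ-none⁻ : ∀ (p : ℕ → Bool) xs → countᵇ p xs ≡ 0 → ∀ v → v ∈ xs → p v ≡ false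
countᵇ-none⁻ p xs e v m with true-or-false (p v)
... | inj₂ f = f
... | inj₁ t = ⊥-elim (<-irrefl (sym e) (countᵇ≥1 p xs m t))

countᵇ-all⁻ : ∀ (p : ℕ → Bool) xs → countᵇ p xs ≡ length xs → ∀ v → v ∈ xs → p v ≡ true
countᵇ-all⁻ p xs e v m = proj₂ (∈-filterᵇ⁻ p xs (subst (v ∈_) (sym (LP.filter-complete (T? ∘ p) e)) m))

countᵇ<length⁻ : ∀ (p : ℕ → Bool) xs → countᵇ p xs < length xs → ∃ λ v → v ∈ xs × p v ≡ false
countᵇ<length⁻ p [] ()
countᵇ<length⁻ p (x ∷ xs) lt with true-or-false (p x)
... | inj₁ ep = let (v , m , e) = countᵇ<length⁻ p xs (≤-pred (subst (_< length (x ∷ xs)) (countᵇ-accept p xs ep) lt)) in v , there m , e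
... | inj₂ ep = x , here refl , ep

countᵇ≤1 : ∀ (p : ℕ → Bool) M xs → Unique xs → (∀ a → a ∈ xs → p a ≡ true → a ≡ M) → countᵇ p xs ≤ 1
countᵇ≤1 p M [] u h = z≤n
countᵇ≤1 p M (x ∷ xs) (ax ∷ u) h with true-or-false (p x)
... | inj₁ e rewrite countᵇ-accept p {x} xs e = s≤s (≤-reflexive (countᵇ-none p xs onlyOne))
  where
  onlyOne : ∀ a → a ∈ xs → p a ≡ false
  onlyOne a m with true-or-false (p a)
  ... | inj₂ e′ = e′
  ... | inj₁ e′ = ⊥-elim (lookup ax m (trans (h x (here refl) e) (sym (h a (there m) e′))))
... | inj₂ e rewrite countᵇ-reject p {x} xs e = countᵇ≤1 p M xs u (λ a m → h a (there m))

countᵇ≤2 : ∀ (p : ℕ → Bool) L M xs → Unique xs → (∀ a → a ∈ xs → p a ≡ true → a ≡ L ⊎ a ≡ M) → countᵇ p xs ≤ 2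
countᵇ≤2 p L M [] u h = z≤n
countᵇ≤2 p L M (x ∷ xs) (ax ∷ u) h with true-or-false (p x)
... | inj₂ e rewrite countᵇ-reject p {x} xs e = countᵇ≤2 p L M xs u (λ a m → h a (there m))
... | inj₁ e rewrite countᵇ-accept p {x} xs e with h x (here refl) e
...   | inj₁ refl = s≤s (countᵇ≤1 p M xs u (λ a m ea → [ (λ z → ⊥-elim (lookup ax m (sym z))) , (λ z → z) ]′ (h a (there m) ea)))
...   | inj₂ refl = s≤s (countᵇ≤1 p L xs u (λ a m ea → [ (λ z → z) , (λ z → ⊥-elim (lookup ax m (sym z))) ]′ (h a (there m) ea)))

countᵇ-map : ∀ (p : ℕ → Bool) (f : ℕ → ℕ) xs → countᵇ p (map f xs) ≡ countᵇ (p ∘ f) xs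
countᵇ-map p f [] = refl
countᵇ-map p f (x ∷ xs) with p (f x)
... | true = cong suc (countᵇ-map p f xs)
... | false = countᵇ-map p f xs

partition-↭ : ∀ (p : ℕ → Bool) xs → xs ↭ filterᵇ (not ∘ p) xs ++ filterᵇ p xs
partition-↭ p [] = ↭-refl
partition-↭ p (x ∷ xs) with p x
... | true = ↭-trans (prep x (partition-↭ p xs)) (↭-sym (PP.shift x (filterᵇ (not ∘ p) xs) (filterᵇ p xs)))
... | false = prep x (partition-↭ p xs)

interval : ℕ → ℕ → List ℕ
interval a zero = []
interval a (suc c) = a ∷ interval (suc a) c

interval-suc : ∀ a c → interval a (suc c) ≡ interval a c ++ [ a + c ]
interval-suc a zero = cong [_] (sym (+-identityʳ a))
interval-suc a (suc c) = cong (a ∷_) (trans (interval-suc (suc a) c) (cong (λ z → interval (suc a) c ++ [ z ]) (sym (+-suc a c))))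

map-suc-upTo : ∀ n → map suc (upTo n) ≡ interval 1 n
map-suc-upTo n = trans (LP.map-applyUpTo (λ i → i) suc n) (shifted suc 1 n (λ _ → refl))
  where
  shifted : ∀ (f : ℕ → ℕ) a n → (∀ i → f i ≡ a + i) → applyUpTo f n ≡ interval a n
  shifted f a zero h = refl
  shifted f a (suc n) h = cong₂ _∷_ (trans (h 0) (+-identityʳ a)) (shifted (f ∘ suc) (suc a) n (λ i → trans (h (suc i)) (+-suc a i)))

length-interval : ∀ a c → length (interval a c) ≡ c
length-interval a zero = refl
length-interval a (suc c) = cong suc (length-interval (suc a) c)

∈-interval⁻ : ∀ {a c v} → v ∈ interval a c → a ≤ v × v < a + c
∈-interval⁻ {a} {suc c} (here refl) = ≤-refl , m<m+n a z<s
∈-interval⁻ {a} {suc c} {v} (there m) = let (p , q) = ∈-interval⁻ {suc a} {c} m in <⇒≤ p , subst (v <_) (sym (+-suc a c)) q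

∈-interval⁺ : ∀ {a c v} → a ≤ v → v < a + c → v ∈ interval a c
∈-interval⁺ {a} {zero} {v} p q = ⊥-elim (<⇒≱ q (subst (_≤ v) (sym (+-identityʳ a)) p))
∈-interval⁺ {a} {suc c} {v} p q with a ≟ v
... | yes refl = here refl
... | no ne = there (∈-interval⁺ (≤∧≢⇒< p ne) (subst (v <_) (+-suc a c) q))

Increasing : List ℕ → Set
Increasing = AllPairs _<_

interval-increasing : ∀ a c → Increasing (interval a c)
interval-increasing a zero = []
interval-increasing a (suc c) = tabulate (λ m → proj₁ (∈-interval⁻ {suc a} {c} m)) ∷ interval-increasing (suc a) c

increasing-filterᵇ : ∀ (p : ℕ → Bool) {xs} → Increasing xs → Increasing (filterᵇ p xs)
increasing-filterᵇ p = APP.filter⁺ (T? ∘ p)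

∈-tail : ∀ {v y : ℕ} {ys} → v ∈ y ∷ ys → v ≢ y → v ∈ ys
∈-tail (here refl) ne = ⊥-elim (ne refl)
∈-tail (there m) ne = m

head≤ : ∀ {x v xs} → All (x <_) xs → v ∈ x ∷ xs → x ≤ v
head≤ ax (here refl) = ≤-refl
head≤ ax (there m) = <⇒≤ (lookup ax m)

increasing-⊆⇒length≤ : ∀ xs ys → Increasing xs → Increasing ys → (∀ v → v ∈ xs → v ∈ ys) → length xs ≤ length ys
increasing-⊆⇒length≤ [] ys ix iy h = z≤n
increasing-⊆⇒length≤ (x ∷ xs) [] ix iy h with h x (here refl)
... | ()
increasing-⊆⇒length≤ (x ∷ xs) (y ∷ ys) (ax ∷ ix) (ay ∷ iy) h with h x (here refl)
... | here refl = s≤s (increasing-⊆⇒length≤ xs ys ix iy (λ v m → ∈-tail (h v (there m)) (λ e → <-irrefl (sym e) (lookup ax m))))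
... | there mx = m≤n⇒m≤1+n (increasing-⊆⇒length≤ (x ∷ xs) ys (ax ∷ ix) iy
        (λ v m → ∈-tail (h v m) (λ e → <-irrefl (sym e) (<-≤-trans (lookup ay mx) (head≤ ax m)))))

increasing-⊆⇒≡ : ∀ xs ys → Increasing xs → Increasing ys → (∀ v → v ∈ xs → v ∈ ys) → length ys ≤ length xs → xs ≡ ys
increasing-⊆⇒≡ [] [] ix iy h le = refl
increasing-⊆⇒≡ [] (y ∷ ys) ix iy h ()
increasing-⊆⇒≡ (x ∷ xs) [] ix iy h le with h x (here refl)
... | ()
increasing-⊆⇒≡ (x ∷ xs) (y ∷ ys) (ax ∷ ix) (ay ∷ iy) h le with h x (here refl)
... | here refl = cong (x ∷_) (increasing-⊆⇒≡ xs ys ix iy (λ v m → ∈-tail (h v (there m)) (λ e → <-irrefl (sym e) (lookup ax m)))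
      (≤-pred le))
... | there mx = ⊥-elim (<-irrefl refl (≤-trans le (increasing-⊆⇒length≤ (x ∷ xs) ys (ax ∷ ix) iy
        (λ v m → ∈-tail (h v m) (λ e → <-irrefl (sym e) (<-≤-trans (lookup ay mx) (head≤ ax m)))))))

increasing-≐⇒≡ : ∀ xs ys → Increasing xs → Increasing ys → (∀ v → v ∈ xs → v ∈ ys) → (∀ v → v ∈ ys → v ∈ xs) → xs ≡ ys
increasing-≐⇒≡ xs ys ix iy h1 h2 = increasing-⊆⇒≡ xs ys ix iy h1 (increasing-⊆⇒length≤ ys xs iy ix h2)

increasing⇒unique : ∀ {xs} → Increasing xs → Unique xs
increasing⇒unique = AllPairs.map (λ lt e → <-irrefl e lt)

unique-resp-↭ : ∀ {xs ys : List ℕ} → xs ↭ ys → Unique xs → Unique ys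
unique-resp-↭ Perm.refl u = u
unique-resp-↭ (prep x r) (a ∷ u) = PP.All-resp-↭ r a ∷ unique-resp-↭ r u
unique-resp-↭ (swap x y r) ((x≢y ∷ ax) ∷ (ay ∷ u)) = ((λ e → x≢y (sym e)) ∷ PP.All-resp-↭ r ay) ∷ (PP.All-resp-↭ r ax ∷ unique-resp-↭ r u)
unique-resp-↭ (Perm.trans r s) u = unique-resp-↭ s (unique-resp-↭ r u)

unique-++ˡ : ∀ (xs : List ℕ) {ys} → Unique (xs ++ ys) → Unique xs
unique-++ˡ [] u = []
unique-++ˡ (x ∷ xs) (a ∷ u) = tabulate (λ m → lookup a (MP.∈-++⁺ˡ m)) ∷ unique-++ˡ xs u

unique-++ʳ : ∀ (xs : List ℕ) {ys} → Unique (xs ++ ys) → Unique ys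
unique-++ʳ [] u = u
unique-++ʳ (x ∷ xs) (a ∷ u) = unique-++ʳ xs u

unique-++-disjoint : ∀ (xs : List ℕ) {ys v} → Unique (xs ++ ys) → v ∈ xs → v ∈ ys → ⊥
unique-++-disjoint (x ∷ xs) (a ∷ u) (here refl) m2 = lookup a (MP.∈-++⁺ʳ xs m2) refl
unique-++-disjoint (x ∷ xs) (a ∷ u) (there m1) m2 = unique-++-disjoint xs u m1 m2

countᵇ-cong : ∀ (p q : ℕ → Bool) → (∀ v → p v ≡ q v) → ∀ xs → countᵇ p xs ≡ countᵇ q xs
countᵇ-cong p q h [] = refl
countᵇ-cong p q h (x ∷ xs) with p x | q x | h x
... | true | .true | refl = cong suc (countᵇ-cong p q h xs)
... | false | .false | refl = countᵇ-cong p q h xs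

any-map : ∀ {A B : Set} (p : B → Bool) (g : A → B) xs → any p (map g xs) ≡ any (p ∘ g) xs
any-map p g [] = refl
any-map p g (x ∷ xs) = cong (p (g x) ∨_) (any-map p g xs)

any-cong : ∀ {A : Set} (p q : A → Bool) xs → (∀ x → p x ≡ q x) → any p xs ≡ any q xs
any-cong p q [] h = refl
any-cong p q (x ∷ xs) h = cong₂ _∨_ (h x) (any-cong p q xs h)

-- Relabelling by a strictly monotone map

StrictlyMonotone : (ℕ → ℕ) → Set
StrictlyMonotone f = ∀ a b → (a <ᵇ b) ≡ (f a <ᵇ f b)

<-step⇒< : ∀ (f : ℕ → ℕ) → (∀ v → f v < f (suc v)) → ∀ {a b} → a < b → f a < f b
<-step⇒< f st {a} {suc b} lt with m≤n⇒m<n∨m≡n (≤-pred lt)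
... | inj₁ lt′ = <-trans (<-step⇒< f st lt′) (st b)
... | inj₂ refl = st a

<-step⇒strictlyMonotone : ∀ (f : ℕ → ℕ) → (∀ v → f v < f (suc v)) → StrictlyMonotone f
<-step⇒strictlyMonotone f st a b with <-cmp a b
... | tri< lt _ _ = trans (<ᵇ-true lt) (sym (<ᵇ-true (<-step⇒< f st lt)))
... | tri≈ _ refl _ = trans (<ᵇ-false {a} {a} ≤-refl) (sym (<ᵇ-false {f a} {f a} ≤-refl))
... | tri> _ _ gt = trans (<ᵇ-false (<⇒≤ gt)) (sym (<ᵇ-false (<⇒≤ (<-step⇒< f st gt))))

module _ (f : ℕ → ℕ) (mono : StrictlyMonotone f) where

  monotone-< : ∀ {a b} → a < b → f a < f b
  monotone-< {a} {b} p = <ᵇ-true⁻ (trans (sym (mono a b)) (<ᵇ-true p))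

  monotone-≤ : ∀ {a b} → a ≤ b → f a ≤ f b
  monotone-≤ {a} {b} p with m≤n⇒m<n∨m≡n p
  ... | inj₁ lt = <⇒≤ (monotone-< lt)
  ... | inj₂ refl = ≤-refl

  monotone-≡ᵇ : ∀ a b → (a ≡ᵇ b) ≡ (f a ≡ᵇ f b)
  monotone-≡ᵇ a b with <-cmp a b
  ... | tri< lt _ _ = trans (≡ᵇ-false (<⇒≢ lt)) (sym (≡ᵇ-false (<⇒≢ (monotone-< lt))))
  ... | tri≈ _ refl _ = trans (≡ᵇ-true {a} {a} refl) (sym (≡ᵇ-true {f a} {f a} refl))
  ... | tri> _ _ gt = trans (≡ᵇ-false (λ e → <⇒≢ gt (sym e))) (sym (≡ᵇ-false (λ e → <⇒≢ (monotone-< gt) (sym e))))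

  monotone-injective : ∀ {a b} → f a ≡ f b → a ≡ b
  monotone-injective {a} {b} e = ≡ᵇ-true⁻ (trans (monotone-≡ᵇ a b) (≡ᵇ-true e))

  any-<ᵇ-map : ∀ a r → any (_<ᵇ f a) (map f r) ≡ any (_<ᵇ a) r
  any-<ᵇ-map a r = trans (any-map (_<ᵇ f a) f r) (any-cong _ _ r (λ x → sym (mono x a)))

  B₂-map : ∀ w → B₂ (map f w) ≡ map f (B₂ w)
  B₂-map [] = refl
  B₂-map (a ∷ r) rewrite any-<ᵇ-map a r with any (_<ᵇ a) r
  ... | true = cong (f a ∷_) (B₂-map r)
  ... | false = B₂-map r

  ⊔-map : ∀ a b → f (a ⊔ b) ≡ f a ⊔ f b
  ⊔-map a b with ≤-total a b
  ... | inj₁ p = trans (cong f (m≤n⇒m⊔n≡n p)) (sym (m≤n⇒m⊔n≡n (monotone-≤ p)))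
  ... | inj₂ p = trans (cong f (m≥n⇒m⊔n≡m p)) (sym (m≥n⇒m⊔n≡m (monotone-≤ p)))

  countᵇ->-map : ∀ t xs → countᵇ (f t <ᵇ_) (map f xs) ≡ countᵇ (t <ᵇ_) xs
  countᵇ->-map t xs = trans (countᵇ-map (f t <ᵇ_) f xs) (countᵇ-cong _ _ (λ x → sym (mono t x)) xs)

  countᵇ-<-map : ∀ a xs → countᵇ (_<ᵇ f a) (map f xs) ≡ countᵇ (_<ᵇ a) xs
  countᵇ-<-map a xs = trans (countᵇ-map (_<ᵇ f a) f xs) (countᵇ-cong _ _ (λ x → sym (mono x a)) xs)

  standardize-map : ∀ w → standardize (map f w) ≡ standardize w
  standardize-map w = trans (sym (LP.map-∘ w)) (LP.map-cong (λ a → cong suc (countᵇ-<-map a w)) w)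

  module _ (f0 : f 0 ≡ 0) where
    maxList-map : ∀ xs → maxList (map f xs) ≡ f (maxList xs)
    maxList-map [] = sym f0
    maxList-map (a ∷ xs) = trans (cong (f a ⊔_) (maxList-map xs)) (sym (⊔-map a (maxList xs)))

    maxBelow-map : ∀ b xs → maxBelow (f b) (map f xs) ≡ f (maxBelow b xs)
    maxBelow-map b [] = sym f0
    maxBelow-map b (a ∷ xs) rewrite sym (mono a b) with a <ᵇ b
    ... | true = trans (cong (f a ⊔_) (maxBelow-map b xs)) (sym (⊔-map a (maxBelow b xs)))
    ... | false = maxBelow-map b xs

    M-map : ∀ w → M-of (map f w) ≡ f (M-of w)
    M-map w = trans (cong maxList (B₂-map w)) (maxList-map (B₂ w))

    L-map : ∀ w → L-of (map f w) ≡ f (L-of w)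
    L-map w = trans (cong₂ maxBelow (M-map w) (B₂-map w)) (maxBelow-map (M-of w) (B₂ w))

    K-map : ∀ w → K-of (map f w) ≡ f (K-of w)
    K-map w = trans (cong₂ maxBelow (L-map w) (B₂-map w)) (maxBelow-map (L-of w) (B₂ w))

    after-map : ∀ a w → after (f a) (map f w) ≡ map f (after a w)
    after-map a [] = refl
    after-map a (b ∷ r) rewrite sym (monotone-≡ᵇ b a) with b ≡ᵇ a
    ... | true = refl
    ... | false = after-map a r

    active-map : ∀ w → active (map f w) ≡ map f (active w)
    active-map w rewrite M-map w | sym f0 | sym (monotone-≡ᵇ (M-of w) 0) | f0 with M-of w ≡ᵇ 0
    ... | true = refl
    ... | false = after-map (M-of w) w

    label-map : ∀ w → label (map f w) ≡ label w
    label-map w rewrite active-map w | K-map w | L-map w | M-map w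
      | LP.length-map f (active w) | countᵇ->-map (K-of w) (active w) | countᵇ->-map (L-of w) (active w) | countᵇ->-map (M-of w) (active w) = refl

  subseqs-map : ∀ w → subseqs (map f w) ≡ map (map f) (subseqs w)
  subseqs-map [] = refl
  subseqs-map (a ∷ w) = trans (cong₂ _++_ (trans (cong (map (f a ∷_)) (subseqs-map w))
      (trans (sym (LP.map-∘ {g = f a ∷_} {f = map f} (subseqs w))) (LP.map-∘ {g = map f} {f = a ∷_} (subseqs w))))
      (subseqs-map w)) (sym (LP.map-++ (map f) (map (a ∷_) (subseqs w)) (subseqs w)))

  sameOrder-map : ∀ s v → sameOrder (map f s) v ≡ sameOrder s v
  sameOrder-map [] [] = refl
  sameOrder-map [] (_ ∷ _) = refl
  sameOrder-map (_ ∷ _) [] = refl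
  sameOrder-map (a ∷ s) (b ∷ v) = cong₂ _∧_ (zipWith-map s v) (sameOrder-map s v)
    where
    zipWith-map : ∀ s v → and (zipWith (λ a′ b′ → not ((f a <ᵇ a′) xor (b <ᵇ b′))) (map f s) v)
                        ≡ and (zipWith (λ a′ b′ → not ((a <ᵇ a′) xor (b <ᵇ b′))) s v)
    zipWith-map [] v = refl
    zipWith-map (x ∷ s) [] = refl
    zipWith-map (x ∷ s) (y ∷ v) = cong₂ _∧_ (cong (λ z → not (z xor (b <ᵇ y))) (sym (mono a x))) (zipWith-map s v)

  contains-map : ∀ w v → contains (map f w) v ≡ contains w v
  contains-map w v rewrite subseqs-map w =
    trans (any-map (λ s → sameOrder s v) (map f) (subseqs w)) (any-cong _ _ (subseqs w) (λ s → sameOrder-map s v))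

  hex-map : ∀ w → hex (map f w) ≡ hex w
  hex-map w rewrite contains-map w (3 ∷ 2 ∷ 1 ∷ [])
    | contains-map w (4 ∷ 6 ∷ 7 ∷ 1 ∷ 8 ∷ 2 ∷ 3 ∷ 5 ∷ [])
    | contains-map w (4 ∷ 6 ∷ 7 ∷ 8 ∷ 1 ∷ 2 ∷ 3 ∷ 5 ∷ [])
    | contains-map w (5 ∷ 6 ∷ 7 ∷ 1 ∷ 8 ∷ 2 ∷ 3 ∷ 4 ∷ [])
    | contains-map w (5 ∷ 6 ∷ 7 ∷ 8 ∷ 1 ∷ 2 ∷ 3 ∷ 4 ∷ []) = refl

module Permutation {n : ℕ} {w : List ℕ} (r : w ↭ interval 1 n) where
  unique : Unique w
  unique = unique-resp-↭ (↭-sym r) (increasing⇒unique (interval-increasing 1 n))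

  bounded : ∀ {v} → v ∈ w → 1 ≤ v × v ≤ n
  bounded m = let (a , b) = ∈-interval⁻ {1} {n} (PP.∈-resp-↭ r m) in a , ≤-pred b

  bounded⇒∈ : ∀ {v} → 1 ≤ v → v ≤ n → v ∈ w
  bounded⇒∈ a b = PP.∈-resp-↭ (↭-sym r) (∈-interval⁺ {1} {n} a (s≤s b))

  length≡ : length w ≡ n
  length≡ = trans (PP.↭-length r) (length-interval 1 n)

countᵇ->-interval : ∀ t n → countᵇ (t <ᵇ_) (interval 1 n) ≡ n ∸ t
countᵇ->-interval t zero = sym (0∸n≡0 t)
countᵇ->-interval t (suc n) = begin
  countᵇ (t <ᵇ_) (interval 1 (suc n))                            ≡⟨ cong (countᵇ (t <ᵇ_)) (interval-suc 1 n) ⟩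
  countᵇ (t <ᵇ_) (interval 1 n ++ [ suc n ])                     ≡⟨ countᵇ-++ (t <ᵇ_) (interval 1 n) [ suc n ] ⟩
  countᵇ (t <ᵇ_) (interval 1 n) + countᵇ (t <ᵇ_) [ suc n ]      ≡⟨ cong (_+ countᵇ (t <ᵇ_) [ suc n ]) (countᵇ->-interval t n) ⟩
  n ∸ t + countᵇ (t <ᵇ_) [ suc n ]                               ≡⟨ lastEntry (true-or-false (t <ᵇ suc n)) ⟩
  suc n ∸ t                                                      ∎
  where
  open ≡-Reasoning
  lastEntry : (t <ᵇ suc n) ≡ true ⊎ (t <ᵇ suc n) ≡ false → n ∸ t + countᵇ (t <ᵇ_) [ suc n ] ≡ suc n ∸ t
  lastEntry (inj₁ e) rewrite countᵇ-accept (t <ᵇ_) {suc n} [] e = trans (+-comm (n ∸ t) 1) (sym (+-∸-assoc 1 (≤-pred (<ᵇ-true⁻ {t} {suc n} e))))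
  lastEntry (inj₂ e) rewrite countᵇ-reject (t <ᵇ_) {suc n} [] e =
    let q = <ᵇ-false⁻ {t} {suc n} e in trans (+-identityʳ _) (trans (m≤n⇒m∸n≡0 (≤-trans (n≤1+n n) q)) (sym (m≤n⇒m∸n≡0 q)))

countᵇ-<-interval : ∀ a n → a ≤ suc n → countᵇ (_<ᵇ a) (interval 1 n) ≡ a ∸ 1
countᵇ-<-interval zero zero le = refl
countᵇ-<-interval (suc zero) zero le = refl
countᵇ-<-interval (suc (suc _)) zero (s≤s ())
countᵇ-<-interval a (suc n) le = trans (cong (countᵇ (_<ᵇ a)) (interval-suc 1 n)) (trans (countᵇ-++ (_<ᵇ a) (interval 1 n) [ suc n ])
      (lastEntry (m≤n⇒m<n∨m≡n le)))
  where
  allBelow : countᵇ (_<ᵇ suc (suc n)) (interval 1 n) ≡ n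
  allBelow = trans (countᵇ-all _ (interval 1 n) (λ v m → <ᵇ-true (≤-trans (proj₂ (∈-interval⁻ {1} {n} m))
        (n≤1+n (suc n))))) (length-interval 1 n)
  lastEntry : a < suc (suc n) ⊎ a ≡ suc (suc n) → countᵇ (_<ᵇ a) (interval 1 n) + countᵇ (_<ᵇ a) [ suc n ] ≡ a ∸ 1
  lastEntry (inj₂ refl) rewrite allBelow | countᵇ-accept (_<ᵇ suc (suc n)) {suc n} [] (<ᵇ-true {suc n} {suc (suc n)} (n<1+n (suc n))) = +-comm n 1
  lastEntry (inj₁ lt) rewrite countᵇ-<-interval a n (≤-pred lt) | countᵇ-reject (_<ᵇ a) {suc n} [] (<ᵇ-false {suc n} {a} (≤-pred lt)) = +-identityʳ _

standardize-permutation : ∀ {n w} → w ↭ interval 1 n → standardize w ≡ w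
standardize-permutation {n} {w} r = LP.map-id-local (tabulate rank≡)
  where
  rank≡ : ∀ {v} → v ∈ w → suc (countᵇ (_<ᵇ v) w) ≡ v
  rank≡ m with Permutation.bounded r m
  ... | (s≤s {_} {b} _ , le) = cong suc (trans (countᵇ-resp-↭ (_<ᵇ suc b) r) (countᵇ-<-interval (suc b) n (m≤n⇒m≤1+n le)))

-- With N = n - k, it sends 1 … N-2 to themselves, N-1 to A and N to B
-- (in the application A and B are the entries L and M of the inflated permutation), and
-- shifts everything above N by k so that it is strictly monotone on all of ℕ.  The k values
-- it misses in [1, n] are exactly the values above N-2 other than A and B (isTop).

shiftTop : ℕ → ℕ → ℕ → ℕ → ℕ → ℕ
shiftTop N k A B zero = zero
shiftTop N k A B (suc v) = if suc (suc v) <ᵇ N then suc v else if suc (suc v) ≡ᵇ N then A else if suc v ≡ᵇ N then B else suc v + k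

isTop : ℕ → ℕ → ℕ → ℕ → Bool
isTop N A B v = (N ∸ 2 <ᵇ v) ∧ (not (v ≡ᵇ A) ∧ not (v ≡ᵇ B))

0-1-or-≥2 : ∀ N → N ≡ 0 ⊎ (N ≡ 1 ⊎ ∃ λ N′ → suc (suc N′) ≡ N)
0-1-or-≥2 zero = inj₁ refl
0-1-or-≥2 (suc zero) = inj₂ (inj₁ refl)
0-1-or-≥2 (suc (suc N′)) = inj₂ (inj₂ (N′ , refl))

module ShiftTop (N k A B : ℕ) where
  g : ℕ → ℕ
  g = shiftTop N k A B

  below : ∀ v → suc (suc v) < N → g (suc v) ≡ suc v
  below v p rewrite <ᵇ-true p = refl

  at-pred : ∀ v → suc (suc v) ≡ N → g (suc v) ≡ A
  at-pred v e rewrite <ᵇ-false {suc (suc v)} {N} (≤-reflexive (sym e)) | ≡ᵇ-true e = refl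

  at-N : ∀ v → suc v ≡ N → g (suc v) ≡ B
  at-N v e rewrite <ᵇ-false {suc (suc v)} {N} (≤-trans (≤-reflexive (sym e)) (n≤1+n _))
    | ≡ᵇ-false {suc (suc v)} {N} (λ e′ → <-irrefl (trans e (sym e′)) (n<1+n _)) | ≡ᵇ-true e = refl

  above : ∀ v → N < suc v → g (suc v) ≡ suc v + k
  above v p rewrite <ᵇ-false {suc (suc v)} {N} (<⇒≤ (≤-trans p (n≤1+n _)))
    | ≡ᵇ-false {suc (suc v)} {N} (λ e → <-irrefl refl (≤-trans (subst (_< suc v) (sym e) p) (n≤1+n _)))
    | ≡ᵇ-false {suc v} {N} (λ e → <-irrefl (sym e) p) = refl

  module Monotone (A-large : 2 ≤ N → suc (N ∸ 2) ≤ A) (A<B : 2 ≤ N → A < B)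
                  (B-bounded : 1 ≤ N → 1 ≤ B × B ≤ N + k) where

    step : ∀ v → g v < g (suc v)
    step zero with <-cmp 2 N
    ... | tri< lt _ _ rewrite below 0 lt = z<s
    ... | tri≈ _ e _ rewrite at-pred 0 e = subst (λ z → suc (z ∸ 2) ≤ A) (sym e) (A-large (≤-reflexive e))
    ... | tri> _ _ gt with 0-1-or-≥2 N
    ...   | inj₁ e rewrite above 0 (subst (_< 1) (sym e) z<s) = z<s
    ...   | inj₂ (inj₁ e) rewrite at-N 0 (sym e) = proj₁ (B-bounded (≤-reflexive (sym e)))
    ...   | inj₂ (inj₂ (_ , e)) = ⊥-elim (<-irrefl refl (<-≤-trans gt (subst (2 ≤_) e (s≤s (s≤s z≤n)))))
    step (suc u) with <-cmp (suc (suc (suc u))) N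
    ... | tri< lt _ _ rewrite below u (<-trans (n<1+n _) lt) | below (suc u) lt = n<1+n _
    ... | tri≈ _ e _ rewrite below u (subst (suc (suc u) <_) e (n<1+n _)) | at-pred (suc u) e =
          subst (λ z → suc (z ∸ 2) ≤ A) (sym e) (A-large (subst (2 ≤_) e (s≤s (s≤s z≤n))))
    ... | tri> _ _ gt with <-cmp (suc (suc u)) N
    ...   | tri≈ _ e _ rewrite at-pred u e | at-N (suc u) e = A<B (subst (2 ≤_) e (s≤s (s≤s z≤n)))
    ...   | tri< lt _ _ = ⊥-elim (<-irrefl refl (<-≤-trans gt lt))
    ...   | tri> _ _ gt₂ rewrite above (suc u) gt₂ with <-cmp (suc u) N
    ...     | tri< lt _ _ = ⊥-elim (<-irrefl refl (<-≤-trans gt₂ lt))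
    ...     | tri≈ _ e _ rewrite at-N u e = s≤s (subst (λ z → B ≤ z + k) (sym e) (proj₂ (B-bounded (subst (1 ≤_) e (s≤s z≤n)))))
    ...     | tri> _ _ gt₃ rewrite above u gt₃ = n<1+n _

    mono : StrictlyMonotone g
    mono = <-step⇒strictlyMonotone g step

    module Partition (n : ℕ) (N+k≡n : N + k ≡ n) (A-vanishes : N ≤ 1 → A ≡ 0) (B-vanishes : N ≡ 0 → B ≡ 0) where
      Top : List ℕ
      Top = filterᵇ (isTop N A B) (interval 1 n)

      isTop-false⁻ : ∀ v → isTop N A B v ≡ false → (N ∸ 2 <ᵇ v) ≡ false ⊎ (v ≡ A ⊎ v ≡ B)
      isTop-false⁻ v e with N ∸ 2 <ᵇ v | v ≡ᵇ A in ea | v ≡ᵇ B in eb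
      ... | false | _ | _ = inj₁ refl
      ... | true | true | _ = inj₂ (inj₁ (≡ᵇ-true⁻ ea))
      ... | true | false | true = inj₂ (inj₂ (≡ᵇ-true⁻ eb))
      ... | true | false | false = ⊥-elim (true≢false e)

      N≤n : N ≤ n
      N≤n = subst (N ≤_) N+k≡n (m≤m+n N k)

      B≤n : 1 ≤ N → B ≤ n
      B≤n q = subst (B ≤_) N+k≡n (proj₂ (B-bounded q))

      image⇒notTop : ∀ v → v ∈ map g (interval 1 N) → v ∈ interval 1 n × isTop N A B v ≡ false
      image⇒notTop v m with MP.∈-map⁻ g m
      ... | (j , mj , refl) with ∈-interval⁻ {1} {N} mj
      ...   | (s≤s {_} {j′} _ , jN) with <-cmp (suc (suc j′)) N
      ...     | tri< lt _ _ rewrite below j′ lt =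
                 ∈-interval⁺ (s≤s z≤n) (s≤s (≤-trans (≤-pred jN) N≤n)) ,
                 cong (_∧ (not (suc j′ ≡ᵇ A) ∧ not (suc j′ ≡ᵇ B))) (<ᵇ-false {N ∸ 2} {suc j′} (∸-monoˡ-≤ 2 lt))
      ...     | tri≈ _ e _ rewrite at-pred j′ e =
                 let N≥2 = subst (2 ≤_) e (s≤s (s≤s z≤n)) in
                 ∈-interval⁺ (≤-trans (s≤s z≤n) (A-large N≥2)) (s≤s (≤-trans (<⇒≤ (A<B N≥2)) (B≤n (subst (1 ≤_) e (s≤s z≤n))))) ,
                 trans (cong (λ z → (N ∸ 2 <ᵇ A) ∧ (not z ∧ not (A ≡ᵇ B))) (≡ᵇ-true {A} {A} refl)) (∧-zeroʳ _)
      ...     | tri> _ _ gt with m≤n⇒m<n∨m≡n (≤-pred jN)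
      ...       | inj₁ lt = ⊥-elim (<-irrefl refl (<-≤-trans gt lt))
      ...       | inj₂ e rewrite at-N j′ e =
                   ∈-interval⁺ (proj₁ (B-bounded (subst (1 ≤_) e (s≤s z≤n)))) (s≤s (B≤n (subst (1 ≤_) e (s≤s z≤n)))) ,
                   trans (cong (λ z → (N ∸ 2 <ᵇ B) ∧ (not (B ≡ᵇ A) ∧ not z)) (≡ᵇ-true {B} {B} refl)) (trans (cong ((N ∸ 2 <ᵇ B) ∧_)
                         (∧-zeroʳ _)) (∧-zeroʳ _))

      notTop⇒image : ∀ v → v ∈ interval 1 n → isTop N A B v ≡ false → v ∈ map g (interval 1 N)
      notTop⇒image v m e with ∈-interval⁻ {1} {n} m | isTop-false⁻ v e
      ... | (s≤s {_} {v′} _ , _) | inj₁ f =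
            let lt = lemma N (<ᵇ-false⁻ {N ∸ 2} {suc v′} f) in
            subst (_∈ map g (interval 1 N)) (below v′ lt) (MP.∈-map⁺ g (∈-interval⁺ (s≤s z≤n) (s≤s (<⇒≤ (<-trans (n<1+n _) lt)))))
        where
        lemma : ∀ N → suc v′ ≤ N ∸ 2 → suc (suc v′) < N
        lemma (suc (suc N′)) q = s≤s (s≤s q)
      ... | (s≤s {_} {v′} _ , _) | inj₂ (inj₁ refl) with 0-1-or-≥2 N
      ...   | inj₁ eN = ⊥-elim (1+n≢0 (A-vanishes (subst (_≤ 1) (sym eN) z≤n)))
      ...   | inj₂ (inj₁ eN) = ⊥-elim (1+n≢0 (A-vanishes (≤-reflexive eN)))
      ...   | inj₂ (inj₂ (N′ , eN)) = subst (_∈ map g (interval 1 N)) (at-pred N′ eN) (MP.∈-map⁺ g (∈-interval⁺ (s≤s z≤n)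
            (subst (suc N′ <_) (cong suc eN) (s≤s (n≤1+n _)))))
      notTop⇒image v m e | (s≤s {_} {v′} _ , _) | inj₂ (inj₂ refl) with 0-1-or-≥2 N
      ...   | inj₁ eN = ⊥-elim (1+n≢0 (B-vanishes eN))
      ...   | inj₂ (inj₁ eN) = subst (_∈ map g (interval 1 N)) (at-N 0 (sym eN)) (MP.∈-map⁺ g (∈-interval⁺ (s≤s z≤n)
            (s≤s (≤-reflexive (sym eN)))))
      ...   | inj₂ (inj₂ (N′ , eN)) = subst (_∈ map g (interval 1 N)) (at-N (suc N′) eN) (MP.∈-map⁺ g (∈-interval⁺ (s≤s z≤n)
            (s≤s (≤-reflexive eN))))

      image≡notTop : map g (interval 1 N) ≡ filterᵇ (not ∘ isTop N A B) (interval 1 n)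
      image≡notTop = increasing-≐⇒≡ _ _ image-increasing (increasing-filterᵇ (not ∘ isTop N A B) (interval-increasing 1 n))
        (λ v m → let (a , b) = image⇒notTop v m in ∈-filterᵇ⁺ (not ∘ isTop N A B) (interval 1 n) a (cong not b))
        (λ v m → let (a , b) = ∈-filterᵇ⁻ (not ∘ isTop N A B) (interval 1 n) m in notTop⇒image v a (not-true⁻ b))
        where
        image-increasing : Increasing (map g (interval 1 N))
        image-increasing = APP.map⁺ (AllPairs.map (<-step⇒< g step) (interval-increasing 1 N))

      interval-partition : interval 1 n ↭ map g (interval 1 N) ++ Top
      interval-partition = subst (λ z → interval 1 n ↭ z ++ Top) (sym image≡notTop) (partition-↭ (isTop N A B) (interval 1 n))

      length-Top : length Top ≡ k
      length-Top = +-cancelˡ-≡ N _ _ (begin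
        N + length Top                                ≡⟨ cong (_+ length Top) (trans (sym (length-interval 1 N))
              (sym (LP.length-map g (interval 1 N)))) ⟩
        length (map g (interval 1 N)) + length Top    ≡⟨ sym (LP.length-++ (map g (interval 1 N))) ⟩
        length (map g (interval 1 N) ++ Top)          ≡⟨ sym (PP.↭-length interval-partition) ⟩
        length (interval 1 n)                         ≡⟨ trans (length-interval 1 n) (sym N+k≡n) ⟩
        N + k                                         ∎)
        where open ≡-Reasoning

      Top-increasing : Increasing Top
      Top-increasing = increasing-filterᵇ (isTop N A B) (interval-increasing 1 n)

      Top-bounded : ∀ {v} → v ∈ Top → (1 ≤ v × v ≤ n) × isTop N A B v ≡ true
      Top-bounded m = let (a , b) = ∈-filterᵇ⁻ (isTop N A B) (interval 1 n) m ; (c , d) = ∈-interval⁻ {1} {n} a in (c , ≤-pred d) , b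

      bounded⇒∈Top : ∀ {v} → 1 ≤ v → v ≤ n → isTop N A B v ≡ true → v ∈ Top
      bounded⇒∈Top a b e = ∈-filterᵇ⁺ (isTop N A B) (interval 1 n) (∈-interval⁺ a (s≤s b)) e

-- Entries with a smaller entry to their right

any⁻ : ∀ {A : Set} (p : A → Bool) xs → any p xs ≡ true → ∃ λ s → s ∈ xs × p s ≡ true
any⁻ p (x ∷ xs) e with true-or-false (p x)
... | inj₁ e₁ = x , here refl , e₁
... | inj₂ e₂ rewrite e₂ = let (s , m , q) = any⁻ p xs e in s , there m , q

any-∈⁺ : ∀ {A : Set} (p : A → Bool) {s} xs → s ∈ xs → p s ≡ true → any p xs ≡ true
any-∈⁺ p (x ∷ xs) (here refl) e rewrite e = refl
any-∈⁺ p (x ∷ xs) (there m) e = ∨-trueʳ {p x} (any-∈⁺ p xs m e)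

any-<ᵇ⁻ : ∀ a r → any (_<ᵇ a) r ≡ true → ∃ λ c → c ∈ r × c < a
any-<ᵇ⁻ a r e = let (c , m , lt) = any⁻ (_<ᵇ a) r e in c , m , <ᵇ-true⁻ lt

any-<ᵇ⁺ : ∀ a r c → c ∈ r → c < a → any (_<ᵇ a) r ≡ true
any-<ᵇ⁺ a r c m lt = any-∈⁺ (_<ᵇ a) r m (<ᵇ-true lt)

HasSmallerAfter : List ℕ → ℕ → Set
HasSmallerAfter w v = ∃ λ p → ∃ λ r → w ≡ p ++ v ∷ r × ∃ λ c → c ∈ r × c < v

∈-B₂⁺ : ∀ p v r c → c ∈ r → c < v → v ∈ B₂ (p ++ v ∷ r)
∈-B₂⁺ [] v r c m lt rewrite any-<ᵇ⁺ v r c m lt = here refl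
∈-B₂⁺ (x ∷ p) v r c m lt with any (_<ᵇ x) (p ++ v ∷ r)
... | true = there (∈-B₂⁺ p v r c m lt)
... | false = ∈-B₂⁺ p v r c m lt

hasSmallerAfter⇒∈B₂ : ∀ {w v} → HasSmallerAfter w v → v ∈ B₂ w
hasSmallerAfter⇒∈B₂ (p , r , refl , c , m , lt) = ∈-B₂⁺ p _ r c m lt

∈B₂⇒hasSmallerAfter : ∀ w {v} → v ∈ B₂ w → HasSmallerAfter w v
∈B₂⇒hasSmallerAfter (x ∷ w) {v} m with any (_<ᵇ x) w in e
∈B₂⇒hasSmallerAfter (x ∷ w) {v} (here refl) | true = let (c , cm , lt) = any-<ᵇ⁻ x w e in [] , w , refl , c , cm , lt
∈B₂⇒hasSmallerAfter (x ∷ w) {v} (there m) | true = let (p , r , eq , rest) = ∈B₂⇒hasSmallerAfter w m in x ∷ p , r , cong (x ∷_) eq , rest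
∈B₂⇒hasSmallerAfter (x ∷ w) {v} m | false = let (p , r , eq , rest) = ∈B₂⇒hasSmallerAfter w m in x ∷ p , r , cong (x ∷_) eq , rest

hasSmallerAfter-++ˡ : ∀ pre {xs v} → HasSmallerAfter xs v → HasSmallerAfter (pre ++ xs) v
hasSmallerAfter-++ˡ pre {v = v} (p , r , refl , rest) = pre ++ p , r , sym (LP.++-assoc pre p (v ∷ r)) , rest

hasSmallerAfter-++ʳ : ∀ {xs} ys {v} → HasSmallerAfter xs v → HasSmallerAfter (xs ++ ys) v
hasSmallerAfter-++ʳ ys {v} (p , r , refl , c , m , lt) = p , r ++ ys , LP.++-assoc p (v ∷ r) ys , c , MP.∈-++⁺ˡ m , lt

B₂⊆ : ∀ w {v} → v ∈ B₂ w → v ∈ w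
B₂⊆ w m with ∈B₂⇒hasSmallerAfter w m
... | (p , r , refl , _) = MP.∈-++⁺ʳ p (here refl)

unique-split : ∀ (p : List ℕ) {v r} → Unique (p ++ v ∷ r) → v ∉ p × v ∉ r
unique-split [] (a ∷ u) = (λ ()) , (λ m → lookup a m refl)
unique-split (x ∷ p) {v} (a ∷ u) =
  (λ { (here refl) → lookup a (MP.∈-++⁺ʳ p (here refl)) refl ; (there m) → proj₁ (unique-split p u) m }) , proj₂ (unique-split p u)

split-unique : ∀ (p₁ p₂ : List ℕ) {v r₁ r₂} → v ∉ p₁ → v ∉ p₂ → p₁ ++ v ∷ r₁ ≡ p₂ ++ v ∷ r₂ → p₁ ≡ p₂ × r₁ ≡ r₂
split-unique [] [] n₁ n₂ e = refl , proj₂ (LP.∷-injective e)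
split-unique [] (x ∷ p₂) n₁ n₂ e = ⊥-elim (n₂ (here (proj₁ (LP.∷-injective e))))
split-unique (x ∷ p₁) [] n₁ n₂ e = ⊥-elim (n₁ (here (sym (proj₁ (LP.∷-injective e)))))
split-unique (x ∷ p₁) (y ∷ p₂) n₁ n₂ e with LP.∷-injective e
... | (refl , e′) = let (a , b) = split-unique p₁ p₂ (λ m → n₁ (there m)) (λ m → n₂ (there m)) e′ in cong (x ∷_) a , b

∈B₂-at : ∀ {w : List ℕ} p {v} r → Unique w → w ≡ p ++ v ∷ r → v ∈ B₂ w → ∃ λ c → c ∈ r × c < v
∈B₂-at {w} p {v} r u refl m with ∈B₂⇒hasSmallerAfter w m
... | (p′ , r′ , e , rest) =
  let (n₁ , _) = unique-split p u ; (n₂ , _) = unique-split p′ (subst (Unique {A = ℕ}) e u) ; (_ , er) = split-unique p p′ n₁ n₂ e in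
  subst (λ z → ∃ λ c → c ∈ z × c < v) (sym er) rest

∉B₂-at : ∀ p {v} r c → c ∈ r → v ∉ B₂ (p ++ v ∷ r) → v ≤ c
∉B₂-at p r c m nb = ≮⇒≥ (λ lt → nb (∈-B₂⁺ p _ r c m lt))

noSmallerAfter⇒increasing : ∀ (xs : List ℕ) → Unique xs → (∀ b → HasSmallerAfter xs b → ⊥) → Increasing xs
noSmallerAfter⇒increasing [] u h = []
noSmallerAfter⇒increasing (x ∷ xs) (ax ∷ u) h =
  tabulate (λ {y} m → ≤∧≢⇒< (≮⇒≥ (λ lt → h x ([] , xs , refl , y , m , lt))) (λ e → lookup ax m e))
  ∷ noSmallerAfter⇒increasing xs u (λ b ib → h b (hasSmallerAfter-++ˡ (x ∷ []) ib))

increasing⇒B₂≡[] : ∀ ys → Increasing ys → B₂ ys ≡ []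
increasing⇒B₂≡[] [] _ = refl
increasing⇒B₂≡[] (a ∷ r) (ar ∷ i) with any (_<ᵇ a) r in e
... | true = let (c , cm , lt) = any-<ᵇ⁻ a r e in ⊥-elim (<-irrefl refl (<-trans lt (lookup ar cm)))
... | false = increasing⇒B₂≡[] r i

maxList-upper : ∀ {v} xs → v ∈ xs → v ≤ maxList xs
maxList-upper (x ∷ xs) (here refl) = m≤m⊔n x _
maxList-upper (x ∷ xs) (there m) = ≤-trans (maxList-upper xs m) (m≤n⊔m x _)

maxList-least : ∀ xs t → (∀ u → u ∈ xs → u ≤ t) → maxList xs ≤ t
maxList-least [] t h = z≤n
maxList-least (x ∷ xs) t h = ⊔-lub (h x (here refl)) (maxList-least xs t (λ u m → h u (there m)))

maxList-∈ : ∀ xs → maxList xs ≢ 0 → maxList xs ∈ xs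
maxList-∈ [] ne = ⊥-elim (ne refl)
maxList-∈ (x ∷ xs) ne with ⊔-sel x (maxList xs)
... | inj₁ e rewrite e = here refl
... | inj₂ e rewrite e = there (maxList-∈ xs ne)

maxList-≡ : ∀ xs v → v ∈ xs → (∀ u → u ∈ xs → u ≤ v) → maxList xs ≡ v
maxList-≡ xs v m h = ≤-antisym (maxList-least xs v h) (maxList-upper xs m)

maxBelow-upper : ∀ {v} b xs → v ∈ xs → v < b → v ≤ maxBelow b xs
maxBelow-upper b (x ∷ xs) (here refl) lt rewrite <ᵇ-true lt = m≤m⊔n x _
maxBelow-upper b (x ∷ xs) (there m) lt with x <ᵇ b
... | true = ≤-trans (maxBelow-upper b xs m lt) (m≤n⊔m x _)
... | false = maxBelow-upper b xs m lt

maxBelow-least : ∀ b xs t → (∀ u → u ∈ xs → u < b → u ≤ t) → maxBelow b xs ≤ t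
maxBelow-least b [] t h = z≤n
maxBelow-least b (x ∷ xs) t h with x <ᵇ b in e
... | true = ⊔-lub (h x (here refl) (<ᵇ-true⁻ e)) (maxBelow-least b xs t (λ u m → h u (there m)))
... | false = maxBelow-least b xs t (λ u m → h u (there m))

maxBelow-∈ : ∀ b xs → maxBelow b xs ≢ 0 → maxBelow b xs ∈ xs × maxBelow b xs < b
maxBelow-∈ b [] ne = ⊥-elim (ne refl)
maxBelow-∈ b (x ∷ xs) ne with x <ᵇ b in e
... | false = let (a , c) = maxBelow-∈ b xs ne in there a , c
... | true with ⊔-sel x (maxBelow b xs)
...   | inj₁ e′ rewrite e′ = here refl , <ᵇ-true⁻ e
...   | inj₂ e′ rewrite e′ = let (a , c) = maxBelow-∈ b xs ne in there a , c

maxBelow-< : ∀ b xs → 0 < b → maxBelow b xs < b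
maxBelow-< b xs pos with maxBelow b xs ≟ 0
... | yes e = subst (_< b) (sym e) pos
... | no ne = proj₂ (maxBelow-∈ b xs ne)

maxBelow-0 : ∀ xs → maxBelow 0 xs ≡ 0
maxBelow-0 [] = refl
maxBelow-0 (x ∷ xs) = maxBelow-0 xs

maxBelow-≡ : ∀ b xs v → v ∈ xs → v < b → (∀ u → u ∈ xs → u < b → u ≤ v) → maxBelow b xs ≡ v
maxBelow-≡ b xs v m lt h = ≤-antisym (maxBelow-least b xs v h) (maxBelow-upper b xs m lt)

maxList-cong : ∀ xs ys → (∀ v → v ∈ xs → v ∈ ys) → (∀ v → v ∈ ys → v ∈ xs) → maxList xs ≡ maxList ys
maxList-cong xs ys h₁ h₂ = ≤-antisym (maxList-least xs _ (λ u m → maxList-upper ys (h₁ u m))) (maxList-least ys _ (λ u m → maxList-upper xs (h₂ u m)))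

maxBelow-cong : ∀ b xs ys → (∀ v → v ∈ xs → v ∈ ys) → (∀ v → v ∈ ys → v ∈ xs) → maxBelow b xs ≡ maxBelow b ys
maxBelow-cong b xs ys h₁ h₂ =
  ≤-antisym (maxBelow-least b xs _ (λ u m lt → maxBelow-upper b ys (h₁ u m) lt)) (maxBelow-least b ys _ (λ u m lt → maxBelow-upper b xs (h₂ u m) lt))

after-split : ∀ p {v} r → v ∉ p → after v (p ++ v ∷ r) ≡ r
after-split [] {v} r n rewrite ≡ᵇ-true {v} {v} refl = refl
after-split (x ∷ p) {v} r n rewrite ≡ᵇ-false {x} {v} (λ e → n (here (sym e))) = after-split p r (λ m → n (there m))

-- Subsequences and pattern containment

[]∈subseqs : ∀ w → [] ∈ subseqs w
[]∈subseqs [] = here refl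
[]∈subseqs (x ∷ w) = MP.∈-++⁺ʳ (map (x ∷_) (subseqs w)) ([]∈subseqs w)

∷∈subseqs : ∀ {s} a r → s ∈ subseqs r → (a ∷ s) ∈ subseqs (a ∷ r)
∷∈subseqs a r m = MP.∈-++⁺ˡ (MP.∈-map⁺ (a ∷_) m)

subseqs-skip : ∀ {s} x r → s ∈ subseqs r → s ∈ subseqs (x ∷ r)
subseqs-skip x r m = MP.∈-++⁺ʳ (map (x ∷_) (subseqs r)) m

subseqs-++ˡ : ∀ {s} p r → s ∈ subseqs r → s ∈ subseqs (p ++ r)
subseqs-++ˡ [] r m = m
subseqs-++ˡ (x ∷ p) r m = subseqs-skip x (p ++ r) (subseqs-++ˡ p r m)

subseqs-++ʳ : ∀ {s} xs ys → s ∈ subseqs xs → s ∈ subseqs (xs ++ ys)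
subseqs-++ʳ [] ys (here refl) = []∈subseqs ys
subseqs-++ʳ (x ∷ xs) ys m with MP.∈-++⁻ (map (x ∷_) (subseqs xs)) m
... | inj₁ m₁ = let (s′ , m′ , e) = MP.∈-map⁻ (x ∷_) m₁ in subst (_∈ subseqs (x ∷ xs ++ ys)) (sym e) (∷∈subseqs x (xs ++ ys)
      (subseqs-++ʳ xs ys m′))
... | inj₂ m₂ = subseqs-skip x (xs ++ ys) (subseqs-++ʳ xs ys m₂)

contains-++ : ∀ xs ys v → contains xs v ≡ true → contains (xs ++ ys) v ≡ true
contains-++ xs ys v e =
  let (s , m , so) = any⁻ (λ s → sameOrder s v) (subseqs xs) e in any-∈⁺ (λ s → sameOrder s v) (subseqs (xs ++ ys)) (subseqs-++ʳ xs ys m) so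

avoids⁻ : ∀ w v → avoids w v ≡ true → contains w v ≡ false
avoids⁻ w v e with contains w v
... | false = refl

avoids⁺ : ∀ w v → contains w v ≡ false → avoids w v ≡ true
avoids⁺ w v e rewrite e = refl

avoids-++ : ∀ xs ys v → avoids (xs ++ ys) v ≡ true → avoids xs v ≡ true
avoids-++ xs ys v e with true-or-false (contains xs v)
... | inj₂ f = avoids⁺ xs v f
... | inj₁ t = ⊥-elim (true≢false (trans (sym (contains-++ xs ys v t)) (avoids⁻ (xs ++ ys) v e)))

pattern321 hexPattern₁ hexPattern₂ hexPattern₃ hexPattern₄ : List ℕ
pattern321 = 3 ∷ 2 ∷ 1 ∷ []
hexPattern₁ = 4 ∷ 6 ∷ 7 ∷ 1 ∷ 8 ∷ 2 ∷ 3 ∷ 5 ∷ []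
hexPattern₂ = 4 ∷ 6 ∷ 7 ∷ 8 ∷ 1 ∷ 2 ∷ 3 ∷ 5 ∷ []
hexPattern₃ = 5 ∷ 6 ∷ 7 ∷ 1 ∷ 8 ∷ 2 ∷ 3 ∷ 4 ∷ []
hexPattern₄ = 5 ∷ 6 ∷ 7 ∷ 8 ∷ 1 ∷ 2 ∷ 3 ∷ 4 ∷ []

AvoidsHex : List ℕ → Set
AvoidsHex w = avoids w pattern321 ≡ true × avoids w hexPattern₁ ≡ true × avoids w hexPattern₂ ≡ true
            × avoids w hexPattern₃ ≡ true × avoids w hexPattern₄ ≡ true

hex⁻ : ∀ w → hex w ≡ true → AvoidsHex w
hex⁻ w e =
  let e₁ = ∧-trueʳ {avoids w pattern321} e ; e₂ = ∧-trueʳ {avoids w hexPattern₁} e₁ ; e₃ = ∧-trueʳ {avoids w hexPattern₂} e₂ in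
  ∧-trueˡ e , ∧-trueˡ e₁ , ∧-trueˡ e₂ , ∧-trueˡ e₃ , ∧-trueʳ {avoids w hexPattern₃} e₃

hex⁺ : ∀ w → AvoidsHex w → hex w ≡ true
hex⁺ w (a₀ , a₁ , a₂ , a₃ , a₄) = cong₂ _∧_ a₀ (cong₂ _∧_ a₁ (cong₂ _∧_ a₂ (cong₂ _∧_ a₃ a₄)))

hex-++ : ∀ xs ys → hex (xs ++ ys) ≡ true → hex xs ≡ true
hex-++ xs ys e =
  let (a₀ , a₁ , a₂ , a₃ , a₄) = hex⁻ (xs ++ ys) e in
  hex⁺ xs (avoids-++ xs ys _ a₀ , avoids-++ xs ys _ a₁ , avoids-++ xs ys _ a₂ , avoids-++ xs ys _ a₃ , avoids-++ xs ys _ a₄)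

Avoids321 : List ℕ → Set
Avoids321 w = ∀ p a r b → w ≡ p ++ a ∷ r → HasSmallerAfter r b → b < a → ⊥

hex⇒avoids321 : ∀ w → hex w ≡ true → Avoids321 w
hex⇒avoids321 w e p a r b refl (q , s , refl , c , cm , c<b) b<a =
  true≢false (trans (sym contains321) (avoids⁻ w pattern321 (proj₁ (hex⁻ w e))))
  where
  abc∈subseqs : (a ∷ b ∷ c ∷ []) ∈ subseqs w
  abc∈subseqs = let (ys , zs , eq) = MP.∈-∃++ cm in
    subseqs-++ˡ p (a ∷ q ++ b ∷ s) (∷∈subseqs a (q ++ b ∷ s) (subseqs-++ˡ q (b ∷ s) (∷∈subseqs b s
      (subst (λ z → (c ∷ []) ∈ subseqs z) (sym eq) (subseqs-++ˡ ys (c ∷ zs) (∷∈subseqs c zs ([]∈subseqs zs)))))))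
  abc≈321 : sameOrder (a ∷ b ∷ c ∷ []) pattern321 ≡ true
  abc≈321 rewrite <ᵇ-false {a} {b} (<⇒≤ b<a) | <ᵇ-false {a} {c} (<⇒≤ (<-trans c<b b<a)) | <ᵇ-false {b} {c} (<⇒≤ c<b) = refl
  contains321 : contains w pattern321 ≡ true
  contains321 = any-∈⁺ (λ s → sameOrder s pattern321) (subseqs w) abc∈subseqs abc≈321

-- Structure of 321-avoiding words

module Structure (w : List ℕ) (w-unique : Unique w) (w-avoids321 : Avoids321 w) where
  B : List ℕ
  B = B₂ w

  M L K : ℕ
  M = M-of w
  L = L-of w
  K = K-of w

  ≤M : ∀ {v} → v ∈ B → v ≤ M
  ≤M m = maxList-upper B m

  B₂-cases : ∀ {v} → v ∈ B → v ≤ K ⊎ (v ≡ L ⊎ v ≡ M)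
  B₂-cases {v} m with m≤n⇒m<n∨m≡n (≤M m)
  ... | inj₂ e = inj₂ (inj₂ e)
  ... | inj₁ lt with m≤n⇒m<n∨m≡n (maxBelow-upper M B m lt)
  ...   | inj₂ e = inj₂ (inj₁ e)
  ...   | inj₁ lt₂ = inj₁ (maxBelow-upper L B m lt₂)

  K≤L : K ≤ L
  K≤L with L ≟ 0
  ... | yes e = ≤-reflexive (trans (cong (λ z → maxBelow z B) e) (trans (maxBelow-0 B) (sym e)))
  ... | no ne = <⇒≤ (maxBelow-< L B (n≢0⇒n>0 ne))

  L≤M : L ≤ M
  L≤M with M ≟ 0
  ... | yes e = ≤-reflexive (trans (cong (λ z → maxBelow z B) e) (trans (maxBelow-0 B) (sym e)))
  ... | no ne = <⇒≤ (maxBelow-< M B (n≢0⇒n>0 ne))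

  L≢0⇒ : L ≢ 0 → L ∈ B × L < M
  L≢0⇒ ne = maxBelow-∈ M B ne

  K≢0⇒ : K ≢ 0 → K ∈ B × K < L
  K≢0⇒ ne = maxBelow-∈ L B ne

  module AfterMax (M≢0 : M ≢ 0) where
    M∈B : M ∈ B
    M∈B = maxList-∈ B M≢0

    M-hasSmallerAfter : HasSmallerAfter w M
    M-hasSmallerAfter = ∈B₂⇒hasSmallerAfter w M∈B

    pre A : List ℕ
    pre = proj₁ M-hasSmallerAfter
    A = proj₁ (proj₂ M-hasSmallerAfter)

    w≡pre++M∷A : w ≡ pre ++ M ∷ A
    w≡pre++M∷A = proj₁ (proj₂ (proj₂ M-hasSmallerAfter))

    c₀ : ℕ
    c₀ = proj₁ (proj₂ (proj₂ (proj₂ M-hasSmallerAfter)))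

    c₀∈A : c₀ ∈ A
    c₀∈A = proj₁ (proj₂ (proj₂ (proj₂ (proj₂ M-hasSmallerAfter))))

    c₀<M : c₀ < M
    c₀<M = proj₂ (proj₂ (proj₂ (proj₂ (proj₂ M-hasSmallerAfter))))

    M∉pre : M ∉ pre
    M∉pre = proj₁ (unique-split pre (subst (Unique {A = ℕ}) w≡pre++M∷A w-unique))

    M∉A : M ∉ A
    M∉A = proj₂ (unique-split pre (subst (Unique {A = ℕ}) w≡pre++M∷A w-unique))

    preM : List ℕ
    preM = pre ++ M ∷ []

    w≡preM++A : w ≡ preM ++ A
    w≡preM++A = trans w≡pre++M∷A (sym (LP.++-assoc pre (M ∷ []) A))

    A-unique : Unique A
    A-unique = unique-++ʳ preM (subst (Unique {A = ℕ}) w≡preM++A w-unique)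

    preM-unique : Unique preM
    preM-unique = unique-++ˡ preM (subst (Unique {A = ℕ}) w≡preM++A w-unique)

    preM-A-disjoint : ∀ {v} → v ∈ preM → v ∈ A → ⊥
    preM-A-disjoint m₁ m₂ = unique-++-disjoint preM (subst (Unique {A = ℕ}) w≡preM++A w-unique) m₁ m₂

    M∈preM : M ∈ preM
    M∈preM = MP.∈-++⁺ʳ pre (here refl)

    active≡A : active w ≡ A
    active≡A rewrite ≡ᵇ-false {M} {0} M≢0 = trans (cong (after M) w≡pre++M∷A) (after-split pre A M∉pre)

    A-noSmallerAfter : ∀ b → HasSmallerAfter A b → ⊥
    A-noSmallerAfter b ib =
      let b∈B = hasSmallerAfter⇒∈B₂ (subst (λ z → HasSmallerAfter z b) (sym w≡preM++A) (hasSmallerAfter-++ˡ preM ib))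
          (q , s , A≡ , _) = ib
          b∈A : b ∈ A
          b∈A = subst (b ∈_) (sym A≡) (MP.∈-++⁺ʳ q (here refl))
      in w-avoids321 pre M A b w≡pre++M∷A ib (≤∧≢⇒< (≤M b∈B) (λ e → M∉A (subst (_∈ A) e b∈A)))

    A-increasing : Increasing A
    A-increasing = noSmallerAfter⇒increasing A A-unique A-noSmallerAfter

    B₂∉A : ∀ {v} → v ∈ B → v ∉ A
    B₂∉A {v} vb va =
      let (q , s , A≡) = MP.∈-∃++ va
          w≡ : w ≡ (preM ++ q) ++ v ∷ s
          w≡ = trans w≡preM++A (trans (cong (preM ++_) A≡) (sym (LP.++-assoc preM q (v ∷ s))))
          (c , cm , lt) = ∈B₂-at (preM ++ q) s w-unique w≡ vb
      in A-noSmallerAfter v (q , s , A≡ , c , cm , lt)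

    B₂⊆preM : ∀ {v} → v ∈ B → v ∈ preM
    B₂⊆preM {v} vb with MP.∈-++⁻ preM (subst (v ∈_) w≡preM++A (B₂⊆ w vb))
    ... | inj₁ m = m
    ... | inj₂ m = ⊥-elim (B₂∉A vb m)

    minimum<A : ∀ {a} → a ∈ preM → a ∉ B → ∀ {c} → c ∈ A → a < c
    minimum<A {a} am nb {c} cm =
      let (q , s , preM≡) = MP.∈-∃++ am
          w≡ : w ≡ q ++ a ∷ (s ++ A)
          w≡ = trans w≡preM++A (trans (cong (_++ A) preM≡) (LP.++-assoc q (a ∷ s) A))
          le = ∉B₂-at q (s ++ A) c (MP.∈-++⁺ʳ s cm) (λ z → nb (subst (λ y → a ∈ B₂ y) (sym w≡) z))
      in ≤∧≢⇒< le (λ e → preM-A-disjoint am (subst (_∈ A) (sym e) cm))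

    -- An entry before A that exceeds some t ≥ K is not a right-to-left minimum as soon as
    -- A has an entry ≤ t + 1, so it lies in B₂ above K.
    above-K⇒L⊎M : ∀ t → K ≤ t → ∀ {c} → c ∈ A → c ≤ suc t → ∀ a → a ∈ preM → t < a → a ≡ L ⊎ a ≡ M
    above-K⇒L⊎M t K≤t {c} cm c≤t+1 a am t<a with a ∈? B
    ... | no nb = ⊥-elim (<-irrefl refl (<-≤-trans t<a (≤-pred (<-≤-trans (minimum<A am nb cm) c≤t+1))))
    ... | yes ab with B₂-cases ab
    ...   | inj₁ le = ⊥-elim (<-irrefl refl (<-≤-trans t<a (≤-trans le K≤t)))
    ...   | inj₂ r = r

-- Inflation of a permutation of [1, n - k] to one of [1, n]

-- The constraints on a label (x, k, l, m) that hold as soon as it is the label of some w ∈ H_n.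
record Admissible (n k l m : ℕ) : Set where
  field
    m≤l : m ≤ l
    l≤k : l ≤ k
    k≤n : k ≤ n
    k≡n⇒ : k ≡ n → l ≡ n × m ≡ n
    1+k≡n⇒ : suc k ≡ n → l ≡ k

-- M = n - m and L = n - l - 1 are read off from the counts m and l.
relabel : ℕ → ℕ → ℕ → ℕ → ℕ → ℕ
relabel n k l m = shiftTop (n ∸ k) k (n ∸ l ∸ 1) (n ∸ m)

topBlock : ℕ → ℕ → ℕ → ℕ → List ℕ
topBlock n k l m = filterᵇ (isTop (n ∸ k) (n ∸ l ∸ 1) (n ∸ m)) (interval 1 n)

inflate : ℕ → ℕ → ℕ → ℕ → List ℕ → List ℕ
inflate n k l m u = map (relabel n k l m) u ++ topBlock n k l m

module Inflation (n k l m : ℕ) (adm : Admissible n k l m) where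
  open Admissible adm public

  N valueL valueM : ℕ
  N = n ∸ k
  valueL = n ∸ l ∸ 1
  valueM = n ∸ m

  k<n : 1 ≤ N → k < n
  k<n p = m∸n≢0⇒n<m (λ e → <-irrefl (sym e) p)

  N+k≡n : N + k ≡ n
  N+k≡n = m∸n+n≡m k≤n

  valueL-large : 2 ≤ N → suc (N ∸ 2) ≤ valueL
  valueL-large p = ≤-trans (≤-reflexive (lemma N p)) (∸-monoˡ-≤ 1 (∸-monoʳ-≤ n l≤k))
    where
    lemma : ∀ N → 2 ≤ N → suc (N ∸ 2) ≡ N ∸ 1
    lemma (suc zero) (s≤s ())
    lemma (suc (suc N)) _ = refl

  valueL<valueM : 2 ≤ N → valueL < valueM
  valueL<valueM p = <-≤-trans (pred< (m>n⇒m∸n≢0 (≤-<-trans l≤k (k<n (≤-trans (s≤s z≤n) p))))) (∸-monoʳ-≤ n m≤l)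
    where
    pred< : ∀ {a} → a ≢ 0 → a ∸ 1 < a
    pred< {zero} ne = ⊥-elim (ne refl)
    pred< {suc a} _ = ≤-refl

  valueM-bounded : 1 ≤ N → 1 ≤ valueM × valueM ≤ N + k
  valueM-bounded p = n≢0⇒n>0 (m>n⇒m∸n≢0 (≤-<-trans (≤-trans m≤l l≤k) (k<n p))) , ≤-trans (m∸n≤m n m) (≤-reflexive (sym N+k≡n))

  valueL-vanishes : N ≤ 1 → valueL ≡ 0
  valueL-vanishes p with m≤n⇒m<n∨m≡n p
  ... | inj₁ (s≤s q) = subst (λ z → n ∸ z ∸ 1 ≡ 0) (sym (proj₁ (k≡n⇒ (≤-antisym k≤n (m∸n≡0⇒m≤n (n≤0⇒n≡0 q)))))) (cong (_∸ 1) (n∸n≡0 n))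
  ... | inj₂ e = subst (λ z → n ∸ z ∸ 1 ≡ 0) (sym (1+k≡n⇒ (trans (cong (_+ k) (sym e)) N+k≡n))) (cong (_∸ 1) e)

  valueM-vanishes : N ≡ 0 → valueM ≡ 0
  valueM-vanishes e = subst (λ z → n ∸ z ≡ 0) (sym (proj₂ (k≡n⇒ (≤-antisym k≤n (m∸n≡0⇒m≤n e))))) (n∸n≡0 n)

  open ShiftTop N k valueL valueM public
  open Monotone valueL-large valueL<valueM valueM-bounded public
  open Partition n N+k≡n valueL-vanishes valueM-vanishes public

increasing-split : ∀ t xs → Increasing xs → xs ≡ filterᵇ (not ∘ (t <ᵇ_)) xs ++ filterᵇ (t <ᵇ_) xs
increasing-split t [] i = refl
increasing-split t (x ∷ xs) (ax ∷ i) with true-or-false (t <ᵇ x)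
... | inj₁ e rewrite filterᵇ-accept (t <ᵇ_) {x} xs e | filterᵇ-reject (not ∘ (t <ᵇ_)) {x} xs (cong not e)
       | filterᵇ-none (not ∘ (t <ᵇ_)) xs (λ v m → cong not (<ᵇ-true (<-trans (<ᵇ-true⁻ e) (lookup ax m))))
       | filterᵇ-all (t <ᵇ_) xs (λ v m → <ᵇ-true (<-trans (<ᵇ-true⁻ e) (lookup ax m))) = refl
... | inj₂ e rewrite filterᵇ-reject (t <ᵇ_) {x} xs e | filterᵇ-accept (not ∘ (t <ᵇ_)) {x} xs (cong not e) = cong (x ∷_) (increasing-split t xs i)

labelIs⁻ : ∀ x k l m w → labelIs x k l m w ≡ true → label w ≡ (x , k , l , m)
labelIs⁻ x k l m w e =
  let e₂ = ∧-trueʳ {length (active w) ≡ᵇ x} e ; e₃ = ∧-trueʳ {countᵇ (K-of w <ᵇ_) (active w) ≡ᵇ k} e₂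
      e₄ = ∧-trueʳ {countᵇ (L-of w <ᵇ_) (active w) ≡ᵇ l} e₃ in
  cong₂ _,_ (≡ᵇ-true⁻ (∧-trueˡ e)) (cong₂ _,_ (≡ᵇ-true⁻ (∧-trueˡ e₂)) (cong₂ _,_ (≡ᵇ-true⁻ (∧-trueˡ e₃)) (≡ᵇ-true⁻ e₄)))

labelIs⁺ : ∀ x k l m w → label w ≡ (x , k , l , m) → labelIs x k l m w ≡ true
labelIs⁺ x k l m w e
  rewrite cong proj₁ e | cong (proj₁ ∘ proj₂) e | cong (proj₁ ∘ proj₂ ∘ proj₂) e | cong (proj₂ ∘ proj₂ ∘ proj₂) e
        | ≡ᵇ-true {x} {x} refl | ≡ᵇ-true {k} {k} refl | ≡ᵇ-true {l} {l} refl | ≡ᵇ-true {m} {m} refl = refl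

B₂≡[]⇒label : ∀ xs → B₂ xs ≡ [] → (∀ v → v ∈ xs → 1 ≤ v) → label xs ≡ (length xs , length xs , length xs , length xs)
B₂≡[]⇒label xs B≡[] pos rewrite B≡[] = cong₂ _,_ refl (cong₂ _,_ all> (cong₂ _,_ all> all>))
  where
  all> : countᵇ (0 <ᵇ_) xs ≡ length xs
  all> = countᵇ-all (0 <ᵇ_) xs (λ v m → <ᵇ-true (pos v m))

lastIs-∷ʳ : ∀ N u → lastIs N (u ++ N ∷ []) ≡ true
lastIs-∷ʳ N [] = ≡ᵇ-true {N} {N} refl
lastIs-∷ʳ N (a ∷ []) = ≡ᵇ-true {N} {N} refl
lastIs-∷ʳ N (a ∷ b ∷ u) = lastIs-∷ʳ N (b ∷ u)

lastIs⁻ : ∀ N u → 1 ≤ N → lastIs N u ≡ true → ∃ λ u′ → u ≡ u′ ++ N ∷ []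
lastIs⁻ N [] p e = ⊥-elim (<-irrefl (sym (≡ᵇ-true⁻ {N} {0} e)) p)
lastIs⁻ N (a ∷ []) p e = [] , cong (_∷ []) (≡ᵇ-true⁻ e)
lastIs⁻ N (a ∷ b ∷ u) p e = let (u′ , eq) = lastIs⁻ N (b ∷ u) p e in a ∷ u′ , cong (a ∷_) eq

map-∷ʳ⁻ : ∀ (f : ℕ → ℕ) u ys a → map f u ≡ ys ++ a ∷ [] → ∃ λ u′ → ∃ λ j → u ≡ u′ ++ j ∷ [] × f j ≡ a
map-∷ʳ⁻ f [] [] a ()
map-∷ʳ⁻ f [] (_ ∷ _) a ()
map-∷ʳ⁻ f (x ∷ []) [] a e = [] , x , refl , proj₁ (LP.∷-injective e)
map-∷ʳ⁻ f (x ∷ []) (y ∷ []) a ()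
map-∷ʳ⁻ f (x ∷ []) (y ∷ _ ∷ _) a ()
map-∷ʳ⁻ f (x ∷ x′ ∷ u) [] a ()
map-∷ʳ⁻ f (x ∷ x′ ∷ u) (y ∷ ys) a e =
  let (u′ , j , eq , fj) = map-∷ʳ⁻ f (x′ ∷ u) ys a (proj₂ (LP.∷-injective e)) in x ∷ u′ , j , cong (x ∷_) eq , fj

↭-cancelʳ : ∀ (xs ys zs : List ℕ) → xs ++ zs ↭ ys ++ zs → xs ↭ ys
↭-cancelʳ xs ys zs r = cancelˡ zs (↭-trans (PP.++-comm zs xs) (↭-trans r (PP.++-comm ys zs)))
  where
  cancelˡ : ∀ zs → zs ++ xs ↭ zs ++ ys → xs ↭ ys
  cancelˡ [] r = r
  cancelˡ (z ∷ zs) r = cancelˡ zs (PP.drop-∷ r)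

∸-bound : ∀ n k j t → n ∸ t ≤ j + k → n ∸ k ∸ j ≤ t
∸-bound n k j t le = subst (_≤ t) (sym (∸-+-assoc n k j)) (m≤n+o⇒m∸n≤o n (k + j)
  (≤-trans (m≤n+m∸n n t) (≤-trans (+-monoʳ-≤ t (≤-trans le (≤-reflexive (+-comm j k)))) (≤-reflexive (+-comm t (k + j))))))

∸-suc-inverse : ∀ n L l → L ≤ n → n ∸ L ≡ suc l → L ≡ n ∸ l ∸ 1
∸-suc-inverse n L l le e = trans (sym (m∸[m∸n]≡n le)) (trans (cong (n ∸_) (trans e (+-comm 1 l))) (sym (∸-+-assoc n l 1)))

∸-inverse : ∀ n M m → M ≤ n → n ∸ M ≡ m → M ≡ n ∸ m
∸-inverse n M m le e = trans (sym (m∸[m∸n]≡n le)) (cong (n ∸_) e)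

-- Deflation

-- u ∈ H_N(x - k, 0, 0, 0), split according to the convention for the label (0, 0, 0, 0).
record Core (N x k : ℕ) (u : List ℕ) : Set where
  field
    is-perm : u ↭ interval 1 N
    is-hex : hex u ≡ true
    ends-with-N : x ≡ k → lastIs N u ≡ true
    has-label : k < x → label u ≡ (x ∸ k , 0 , 0 , 0)

record Deflation (n x k l m : ℕ) (w : List ℕ) : Set where
  field
    admissible : Admissible n k l m
    k≤x : k ≤ x
    x≡k⇒ : x ≡ k → m < k ⊎ (k ≡ n × l ≡ n × m ≡ n)
    core : List ℕ
    core-ok : Core (n ∸ k) x k core
    w≡inflate : w ≡ inflate n k l m core
    countedByK≡ : countedByK w ≡ topBlock n k l m

deflate-increasing : ∀ n w → w ↭ interval 1 n → M-of w ≡ 0 → label w ≡ (n , n , n , n) × Deflation n n n n n w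
deflate-increasing n w r M≡0 = label≡ , record
  { admissible = record { m≤l = ≤-refl ; l≤k = ≤-refl ; k≤n = ≤-refl ; k≡n⇒ = λ _ → refl , refl ; 1+k≡n⇒ = λ _ → refl }
  ; k≤x = ≤-refl
  ; x≡k⇒ = λ _ → inj₂ (refl , refl , refl)
  ; core = []
  ; core-ok = record
    { is-perm = subst (λ z → [] ↭ interval 1 z) (sym (n∸n≡0 n)) ↭-refl
    ; is-hex = refl
    ; ends-with-N = λ _ → subst (λ z → lastIs z [] ≡ true) (sym (n∸n≡0 n)) refl
    ; has-label = λ lt → ⊥-elim (<-irrefl refl lt)
    }
  ; w≡inflate = trans w≡interval (sym top≡interval)
  ; countedByK≡ = trans (cong₂ filterᵇ (cong _<ᵇ_ K≡0) active≡w) (trans (filterᵇ-all (0 <ᵇ_) w (λ v m → <ᵇ-true (pos m)))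
        (trans w≡interval (sym top≡interval)))
  }
  where
  pos : ∀ {v} → v ∈ w → 1 ≤ v
  pos m = proj₁ (Permutation.bounded r m)
  B≡[] : B₂ w ≡ []
  B≡[] = empty (B₂ w) (λ m → <-irrefl refl (≤-trans (pos (B₂⊆ w m)) (≤-trans (maxList-upper (B₂ w) m) (≤-reflexive M≡0))))
    where
    empty : ∀ (xs : List ℕ) → (∀ {v} → v ∈ xs → ⊥) → xs ≡ []
    empty [] _ = refl
    empty (x ∷ xs) h = ⊥-elim (h (here refl))
  active≡w : active w ≡ w
  active≡w = cong (λ z → if z ≡ᵇ 0 then w else after z w) M≡0
  K≡0 : K-of w ≡ 0
  K≡0 = cong (maxBelow (L-of w)) B≡[]
  label≡ : label w ≡ (n , n , n , n)
  label≡ = trans (B₂≡[]⇒label w B≡[] (λ v m → pos m)) (cong (λ z → z , z , z , z) (Permutation.length≡ r))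
  w≡interval : w ≡ interval 1 n
  w≡interval = increasing-≐⇒≡ w (interval 1 n)
    (noSmallerAfter⇒increasing w (Permutation.unique r) (λ b ib → subst (λ z → b ∈ z → ⊥) (sym B≡[]) (λ ()) (hasSmallerAfter⇒∈B₂ ib)))
    (interval-increasing 1 n) (λ v m → PP.∈-resp-↭ r m) (λ v m → PP.∈-resp-↭ (↭-sym r) m)
  top≡interval : topBlock n n n n ≡ interval 1 n
  top≡interval rewrite n∸n≡0 n = filterᵇ-all (isTop 0 0 0) (interval 1 n) (λ v m → positive (proj₁ (∈-interval⁻ {1} {n} m)))
    where
    positive : ∀ {v} → 1 ≤ v → isTop 0 0 0 v ≡ true
    positive {suc v} _ = refl

-- Counting entries of w above K, L and M in preM and in A pins down M = n - m and
-- L = n - l - 1, and identifies the entries of A above K with the top block.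
module DeflateNonIncreasing (n x k l m : ℕ) (w : List ℕ) (w-perm : w ↭ interval 1 n) (w-hex : hex w ≡ true)
                            (w-label : label w ≡ (x , k , l , m)) (M≢0 : M-of w ≢ 0) where
  open Structure w (Permutation.unique w-perm) (hex⇒avoids321 w w-hex)
  open AfterMax M≢0

  w-positive : ∀ {v} → v ∈ w → 1 ≤ v
  w-positive m = proj₁ (Permutation.bounded w-perm m)

  w-≤n : ∀ {v} → v ∈ w → v ≤ n
  w-≤n m = proj₂ (Permutation.bounded w-perm m)

  A⊆w : ∀ {v} → v ∈ A → v ∈ w
  A⊆w m = subst (_ ∈_) (sym w≡preM++A) (MP.∈-++⁺ʳ preM m)

  preM⊆w : ∀ {v} → v ∈ preM → v ∈ w
  preM⊆w m = subst (_ ∈_) (sym w≡preM++A) (MP.∈-++⁺ˡ m)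

  length-A : length A ≡ x
  length-A = trans (cong length (sym active≡A)) (cong proj₁ w-label)

  A-above-K : countᵇ (K <ᵇ_) A ≡ k
  A-above-K = trans (cong (countᵇ (K <ᵇ_)) (sym active≡A)) (cong (proj₁ ∘ proj₂) w-label)

  A-above-L : countᵇ (L <ᵇ_) A ≡ l
  A-above-L = trans (cong (countᵇ (L <ᵇ_)) (sym active≡A)) (cong (proj₁ ∘ proj₂ ∘ proj₂) w-label)

  A-above-M : countᵇ (M <ᵇ_) A ≡ m
  A-above-M = trans (cong (countᵇ (M <ᵇ_)) (sym active≡A)) (cong (proj₂ ∘ proj₂ ∘ proj₂) w-label)

  w-above : ∀ t → countᵇ (t <ᵇ_) w ≡ n ∸ t
  w-above t = trans (countᵇ-resp-↭ (t <ᵇ_) w-perm) (countᵇ->-interval t n)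

  w-count-split : ∀ (p : ℕ → Bool) → countᵇ p w ≡ countᵇ p preM + countᵇ p A
  w-count-split p = trans (cong (countᵇ p) w≡preM++A) (countᵇ-++ p preM A)

  Alow Ahigh : List ℕ
  Alow = filterᵇ (not ∘ (K <ᵇ_)) A
  Ahigh = filterᵇ (K <ᵇ_) A

  A≡Alow++Ahigh : A ≡ Alow ++ Ahigh
  A≡Alow++Ahigh = increasing-split K A A-increasing

  Alow≤K : ∀ {v} → v ∈ Alow → v ≤ K
  Alow≤K m = <ᵇ-false⁻ (not-true⁻ (proj₂ (∈-filterᵇ⁻ (not ∘ (K <ᵇ_)) A m)))

  Ahigh>K : ∀ {v} → v ∈ Ahigh → K < v
  Ahigh>K m = <ᵇ-true⁻ (proj₂ (∈-filterᵇ⁻ (K <ᵇ_) A m))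

  Ahigh⊆A : ∀ {v} → v ∈ Ahigh → v ∈ A
  Ahigh⊆A m = proj₁ (∈-filterᵇ⁻ (K <ᵇ_) A m)

  length-Alow+k : length Alow + k ≡ x
  length-Alow+k = trans (cong (length Alow +_) (sym A-above-K)) (trans (sym (LP.length-++ Alow))
        (trans (cong length (sym A≡Alow++Ahigh)) length-A))

  A-count-split : ∀ (p : ℕ → Bool) → countᵇ p A ≡ countᵇ p Alow + countᵇ p Ahigh
  A-count-split p = trans (cong (countᵇ p) A≡Alow++Ahigh) (countᵇ-++ p Alow Ahigh)

  Alow-above : ∀ t → K ≤ t → countᵇ (t <ᵇ_) Alow ≡ 0
  Alow-above t K≤t = countᵇ-none (t <ᵇ_) Alow (λ v vm → <ᵇ-false (≤-trans (Alow≤K vm) K≤t))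

  A-above≤k : ∀ t → K ≤ t → countᵇ (t <ᵇ_) A ≤ k
  A-above≤k t K≤t = begin
    countᵇ (t <ᵇ_) A                               ≡⟨ A-count-split (t <ᵇ_) ⟩
    countᵇ (t <ᵇ_) Alow + countᵇ (t <ᵇ_) Ahigh     ≡⟨ cong (_+ countᵇ (t <ᵇ_) Ahigh) (Alow-above t K≤t) ⟩
    countᵇ (t <ᵇ_) Ahigh                           ≤⟨ countᵇ≤length (t <ᵇ_) Ahigh ⟩
    length Ahigh                                   ≡⟨ A-above-K ⟩
    k                                              ∎
    where open ≤-Reasoning

  length-w : length w ≡ length preM + x
  length-w = trans (cong length w≡preM++A) (trans (LP.length-++ preM) (cong (length preM +_) length-A))

  x<n : x < n
  x<n = subst (x <_) (trans (sym length-w) (Permutation.length≡ w-perm))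
          (+-monoˡ-≤ x (≤-trans (s≤s z≤n) (≤-reflexive (sym (trans (LP.length-++ pre) (+-comm (length pre) 1))))))

  preM-above-M : countᵇ (M <ᵇ_) preM ≡ 0
  preM-above-M = countᵇ-none (M <ᵇ_) preM (λ a am → <ᵇ-false (≮⇒≥ (λ lt →
    [ (λ e → <-irrefl refl (<-≤-trans lt (≤-trans (≤-reflexive e) L≤M))) , (λ e → <-irrefl (sym e) lt) ]′
      (above-K⇒L⊎M M (≤-trans K≤L L≤M) c₀∈A (≤-trans (<⇒≤ c₀<M) (n≤1+n _)) a am lt))))

  M≡n∸m : M ≡ n ∸ m
  M≡n∸m = ∸-inverse n M m (w-≤n (preM⊆w M∈preM))
    (trans (sym (w-above M)) (trans (w-count-split (M <ᵇ_)) (trans (cong (_+ countᵇ (M <ᵇ_) A) preM-above-M) A-above-M)))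

  m<x : m < x
  m<x = subst₂ _<_ A-above-M length-A (≤∧≢⇒< (countᵇ≤length (M <ᵇ_) A)
          (λ e → <-irrefl refl (<-trans (<ᵇ-true⁻ (countᵇ-all⁻ (M <ᵇ_) A e c₀ c₀∈A)) c₀<M)))

  m≤l : m ≤ l
  m≤l = subst₂ _≤_ A-above-M A-above-L (countᵇ-mono (M <ᵇ_) (L <ᵇ_) A (λ v _ e → <ᵇ-true {L} {v} (≤-<-trans L≤M (<ᵇ-true⁻ {M} {v} e))))

  l≤k : l ≤ k
  l≤k = subst₂ _≤_ A-above-L A-above-K (countᵇ-mono (L <ᵇ_) (K <ᵇ_) A (λ v _ e → <ᵇ-true {K} {v} (≤-<-trans K≤L (<ᵇ-true⁻ {L} {v} e))))

  k≤x : k ≤ x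
  k≤x = subst₂ _≤_ A-above-K length-A (countᵇ≤length (K <ᵇ_) A)

  k<n : k < n
  k<n = ≤-<-trans k≤x x<n

  module L-below-K (l<k : l < k) where
    L≢0 : L ≢ 0
    L≢0 e = <-irrefl refl (<-≤-trans l<k (≤-trans k≤x (≤-reflexive (begin
      x                   ≡⟨ sym length-A ⟩
      length A            ≡⟨ sym (countᵇ-all (0 <ᵇ_) A (λ v m → <ᵇ-true (w-positive (A⊆w m)))) ⟩
      countᵇ (0 <ᵇ_) A    ≡⟨ cong (λ z → countᵇ (z <ᵇ_) A) (sym e) ⟩
      countᵇ (L <ᵇ_) A    ≡⟨ A-above-L ⟩
      l                   ∎))))
      where open ≡-Reasoning

    L∈B : L ∈ B
    L∈B = proj₁ (L≢0⇒ L≢0)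

    L<M : L < M
    L<M = proj₂ (L≢0⇒ L≢0)

    A-not-above-L : ∃ λ c → c ∈ A × (L <ᵇ c) ≡ false
    A-not-above-L = countᵇ<length⁻ (L <ᵇ_) A (subst₂ _<_ (sym A-above-L) (sym length-A) (<-≤-trans l<k k≤x))

    preM-above-L : countᵇ (L <ᵇ_) preM ≡ 1
    preM-above-L = ≤-antisym
      (countᵇ≤1 (L <ᵇ_) M preM preM-unique (λ a am e →
        [ (λ z → ⊥-elim (<-irrefl (sym z) (<ᵇ-true⁻ {L} {a} e))) , (λ z → z) ]′
          (above-K⇒L⊎M L K≤L (proj₁ (proj₂ A-not-above-L)) (≤-trans (<ᵇ-false⁻ (proj₂ (proj₂ A-not-above-L)))
                (n≤1+n _)) a am (<ᵇ-true⁻ e))))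
      (countᵇ≥1 (L <ᵇ_) preM M∈preM (<ᵇ-true L<M))

    L≡n∸l∸1 : L ≡ n ∸ l ∸ 1
    L≡n∸l∸1 = ∸-suc-inverse n L l (w-≤n (B₂⊆ w L∈B))
      (trans (sym (w-above L)) (trans (w-count-split (L <ᵇ_)) (trans (cong (_+ countᵇ (L <ᵇ_) A) preM-above-L) (cong suc A-above-L))))

    2≤length-preM : 2 ≤ length preM
    2≤length-preM = ≤-trans (countᵇ≥2 (λ _ → true) preM (B₂⊆preM L∈B) M∈preM (λ e → <-irrefl e L<M) refl refl) (countᵇ≤length (λ _ → true) preM)

  1+k≡n⇒l≡k : suc k ≡ n → l ≡ k
  1+k≡n⇒l≡k e with m≤n⇒m<n∨m≡n l≤k
  ... | inj₂ q = q
  ... | inj₁ l<k = ⊥-elim (<-irrefl e (≤-trans (s≤s (+-monoʳ-≤ 1 k≤x))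
          (≤-trans (+-monoˡ-≤ x (L-below-K.2≤length-preM l<k)) (≤-reflexive (trans (sym length-w) (Permutation.length≡ w-perm))))))

  admissible : Admissible n k l m
  admissible = record { m≤l = m≤l ; l≤k = l≤k ; k≤n = <⇒≤ k<n ; k≡n⇒ = λ e → ⊥-elim (<-irrefl e k<n) ; 1+k≡n⇒ = 1+k≡n⇒l≡k }

  open Inflation n k l m admissible using (g; mono; Top; length-Top; Top-increasing; bounded⇒∈Top; interval-partition; at-N; N)

  -- Every t with K ≤ t < d for some d ∈ Ahigh is exceeded by at most k entries of A and at most
  -- the two entries L, M of preM, so n - t ≤ k + 2 (and ≤ k + 1 once t ≥ L).
  Ahigh-above : ∀ {d} → d ∈ Ahigh → n ∸ k ∸ 2 < d
  Ahigh-above {zero} dm = ⊥-elim (<-irrefl refl (<-≤-trans (Ahigh>K dm) z≤n))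
  Ahigh-above {suc t} dm = s≤s (∸-bound n k 2 t (≤-trans (≤-reflexive (trans (sym (w-above t)) (w-count-split (t <ᵇ_))))
        (+-mono-≤ preM-bound (A-above≤k t K≤t))))
    where
    K≤t : K ≤ t
    K≤t = ≤-pred (Ahigh>K dm)
    preM-bound : countᵇ (t <ᵇ_) preM ≤ 2
    preM-bound = countᵇ≤2 (t <ᵇ_) L M preM preM-unique (λ a am e → above-K⇒L⊎M t K≤t (Ahigh⊆A dm) ≤-refl a am (<ᵇ-true⁻ e))

  Ahigh-above-L : l ≡ k → ∀ {d} → d ∈ Ahigh → n ∸ k ∸ 1 < d
  Ahigh-above-L l≡k {zero} dm = ⊥-elim (<-irrefl refl (<-≤-trans (Ahigh>K dm) z≤n))
  Ahigh-above-L l≡k {suc t} dm = s≤s (∸-bound n k 1 t (≤-trans (≤-reflexive (trans (sym (w-above t)) (w-count-split (t <ᵇ_))))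
        (+-mono-≤ preM-bound (A-above≤k t K≤t))))
    where
    K≤t : K ≤ t
    K≤t = ≤-pred (Ahigh>K dm)
    Ahigh-above-L-all : countᵇ (L <ᵇ_) Ahigh ≡ length Ahigh
    Ahigh-above-L-all = trans (sym (trans (A-count-split (L <ᵇ_)) (cong (_+ countᵇ (L <ᵇ_) Ahigh) (Alow-above L K≤L))))
                              (trans A-above-L (trans l≡k (sym A-above-K)))
    L≤t : L ≤ t
    L≤t = ≤-pred (<ᵇ-true⁻ (countᵇ-all⁻ (L <ᵇ_) Ahigh Ahigh-above-L-all (suc t) dm))
    preM-bound : countᵇ (t <ᵇ_) preM ≤ 1
    preM-bound = countᵇ≤1 (t <ᵇ_) M preM preM-unique (λ a am e →
      [ (λ a≡L → ⊥-elim (<-irrefl refl (<-≤-trans (<ᵇ-true⁻ e) (≤-trans (≤-reflexive a≡L) L≤t)))) , (λ z → z) ]′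
        (above-K⇒L⊎M t K≤t (Ahigh⊆A dm) ≤-refl a am (<ᵇ-true⁻ e)))

  Ahigh≢valueL : ∀ {d} → d ∈ Ahigh → d ≢ n ∸ l ∸ 1
  Ahigh≢valueL {d} dm with m≤n⇒m<n∨m≡n l≤k
  ... | inj₁ l<k = λ e → B₂∉A (L-below-K.L∈B l<k) (subst (_∈ A) (trans e (sym (L-below-K.L≡n∸l∸1 l<k))) (Ahigh⊆A dm))
  ... | inj₂ l≡k = λ e → <-irrefl (sym (trans e (cong (λ z → n ∸ z ∸ 1) l≡k))) (Ahigh-above-L l≡k dm)

  Ahigh≢valueM : ∀ {d} → d ∈ Ahigh → d ≢ n ∸ m
  Ahigh≢valueM dm e = M∉A (subst (_∈ A) (trans e (sym M≡n∸m)) (Ahigh⊆A dm))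

  Ahigh≡Top : Ahigh ≡ Top
  Ahigh≡Top = increasing-⊆⇒≡ Ahigh Top (increasing-filterᵇ (K <ᵇ_) A-increasing) Top-increasing Ahigh⊆Top
                (≤-reflexive (trans length-Top (sym A-above-K)))
    where
    Ahigh⊆Top : ∀ d → d ∈ Ahigh → d ∈ Top
    Ahigh⊆Top d dm = bounded⇒∈Top (w-positive (A⊆w (Ahigh⊆A dm))) (w-≤n (A⊆w (Ahigh⊆A dm)))
      (subst (λ z → z ∧ (not (d ≡ᵇ n ∸ l ∸ 1) ∧ not (d ≡ᵇ n ∸ m)) ≡ true) (sym (<ᵇ-true (Ahigh-above dm)))
        (subst (λ z → not z ∧ not (d ≡ᵇ n ∸ m) ≡ true) (sym (≡ᵇ-false (Ahigh≢valueL dm)))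
          (subst (λ z → not z ≡ true) (sym (≡ᵇ-false (Ahigh≢valueM dm))) refl)))

  front : List ℕ
  front = preM ++ Alow

  w≡front++Top : w ≡ front ++ Top
  w≡front++Top = trans w≡preM++A (trans (cong (preM ++_) (trans A≡Alow++Ahigh (cong (Alow ++_) Ahigh≡Top)))
        (sym (LP.++-assoc preM Alow Top)))

  front-preimage : ∃ λ u → front ≡ map g u × interval 1 N ↭ u
  front-preimage = PP.↭-map-inv g (↭-sym (↭-cancelʳ front (map g (interval 1 N)) Top (↭-trans (subst (_↭ interval 1 n) w≡front++Top w-perm) interval-partition)))

  u : List ℕ
  u = proj₁ front-preimage

  front≡map-g-u : front ≡ map g u
  front≡map-g-u = proj₁ (proj₂ front-preimage)

  u-perm : u ↭ interval 1 N
  u-perm = ↭-sym (proj₂ (proj₂ front-preimage))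

  w≡inflate-u : w ≡ map g u ++ Top
  w≡inflate-u = trans w≡front++Top (cong (_++ Top) front≡map-g-u)

  u-hex : hex u ≡ true
  u-hex = trans (sym (hex-map g mono u)) (hex-++ (map g u) Top (subst (λ z → hex z ≡ true) w≡inflate-u w-hex))

  u-last : x ≡ k → lastIs N u ≡ true
  u-last x≡k =
    let (u′ , j , u≡ , gj) = map-∷ʳ⁻ g u pre M (trans (sym front≡map-g-u) (trans (cong (preM ++_) Alow≡[]) (LP.++-identityʳ preM)))
        j≡N : j ≡ N
        j≡N = monotone-injective g mono (trans gj (trans M≡n∸m (sym g-N)))
    in subst (λ z → lastIs N z ≡ true) (sym (trans u≡ (cong (λ z → u′ ++ z ∷ []) j≡N))) (lastIs-∷ʳ N u′)
    where
    Alow≡[] : Alow ≡ []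
    Alow≡[] = length≡0 Alow (+-cancelʳ-≡ k (length Alow) 0 (trans length-Alow+k x≡k))
      where
      length≡0 : ∀ (xs : List ℕ) → length xs ≡ 0 → xs ≡ []
      length≡0 [] _ = refl
    g-N : g N ≡ n ∸ m
    g-N = at-N′ N refl (n≢0⇒n>0 (m>n⇒m∸n≢0 k<n))
      where
      at-N′ : ∀ N′ → N′ ≡ N → 1 ≤ N′ → g N′ ≡ n ∸ m
      at-N′ (suc j) e _ = at-N j e

  module K-below-x (k<x : k < x) where
    length-Alow : length Alow ≡ x ∸ k
    length-Alow = trans (sym (m+n∸n≡m (length Alow) k)) (cong (_∸ k) length-Alow+k)

    Alow-nonempty : ∃ λ a → a ∈ Alow
    Alow-nonempty with Alow | length-Alow+k
    ... | [] | e = ⊥-elim (<-irrefl refl (<-≤-trans k<x (≤-reflexive (sym e))))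
    ... | a ∷ _ | _ = a , here refl

    a₁ : ℕ
    a₁ = proj₁ Alow-nonempty

    a₁∈Alow : a₁ ∈ Alow
    a₁∈Alow = proj₂ Alow-nonempty

    B₂-front⊆B : ∀ v → v ∈ B₂ front → v ∈ B
    B₂-front⊆B v vm = subst (λ z → v ∈ B₂ z) (sym w≡front++Top) (hasSmallerAfter⇒∈B₂ (hasSmallerAfter-++ʳ Top (∈B₂⇒hasSmallerAfter front vm)))

    -- An entry of B₂ w keeps a smaller entry to its right in front: either the old witness, or
    -- the entry a₁ ≤ K of Alow when the old witness was in the top block.
    B⊆B₂-front : ∀ v → v ∈ B → v ∈ B₂ front
    B⊆B₂-front v vB with MP.∈-∃++ (B₂⊆preM vB)
    ... | (q , s , preM≡) =
      let w≡ : w ≡ q ++ v ∷ (s ++ A)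
          w≡ = trans w≡preM++A (trans (cong (_++ A) preM≡) (LP.++-assoc q (v ∷ s) A))
          front≡ : front ≡ q ++ v ∷ (s ++ Alow)
          front≡ = trans (cong (_++ Alow) preM≡) (LP.++-assoc q (v ∷ s) Alow)
          (c , cm , c<v) = ∈B₂-at q (s ++ A) (Permutation.unique w-perm) w≡ vB
          smaller : ∀ c′ → c′ ∈ s ++ Alow → c′ < v → v ∈ B₂ front
          smaller c′ m′ lt = subst (λ z → v ∈ B₂ z) (sym front≡) (∈-B₂⁺ q v (s ++ Alow) c′ m′ lt)
      in [ (λ c∈s → smaller c (MP.∈-++⁺ˡ c∈s) c<v)
         , (λ c∈A → [ (λ c∈Alow → smaller c (MP.∈-++⁺ʳ s c∈Alow) c<v)
                    , (λ c∈Ahigh → smaller a₁ (MP.∈-++⁺ʳ s a₁∈Alow) (≤-<-trans (Alow≤K a₁∈Alow) (<-trans (Ahigh>K c∈Ahigh) c<v))) ]′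
                    (MP.∈-++⁻ Alow (subst (c ∈_) A≡Alow++Ahigh c∈A))) ]′
         (MP.∈-++⁻ s cm)

    M-front : M-of front ≡ M
    M-front = maxList-cong (B₂ front) B B₂-front⊆B B⊆B₂-front

    L-front : L-of front ≡ L
    L-front = trans (cong (λ z → maxBelow z (B₂ front)) M-front) (maxBelow-cong M (B₂ front) B B₂-front⊆B B⊆B₂-front)

    K-front : K-of front ≡ K
    K-front = trans (cong (λ z → maxBelow z (B₂ front)) L-front) (maxBelow-cong L (B₂ front) B B₂-front⊆B B⊆B₂-front)

    active-front : active front ≡ Alow
    active-front = trans (cong (λ z → if z ≡ᵇ 0 then front else after z front) M-front)
      (subst (λ b → (if b then front else after M front) ≡ Alow) (sym (≡ᵇ-false {M} {0} M≢0))
        (trans (cong (after M) (LP.++-assoc pre (M ∷ []) Alow)) (after-split pre Alow M∉pre)))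

    label-front : label front ≡ (x ∸ k , 0 , 0 , 0)
    label-front = cong₂ _,_ (trans (cong length active-front) length-Alow)
      (cong₂ _,_ (trans (cong₂ countᵇ (cong _<ᵇ_ K-front) active-front) (Alow-above K ≤-refl))
        (cong₂ _,_ (trans (cong₂ countᵇ (cong _<ᵇ_ L-front) active-front) (Alow-above L K≤L))
                   (trans (cong₂ countᵇ (cong _<ᵇ_ M-front) active-front) (Alow-above M (≤-trans K≤L L≤M)))))

  u-label : k < x → label u ≡ (x ∸ k , 0 , 0 , 0)
  u-label k<x = trans (sym (label-map g mono refl u)) (trans (cong label (sym front≡map-g-u)) (K-below-x.label-front k<x))

  deflation : Deflation n x k l m w
  deflation = record
    { admissible = admissible ; k≤x = k≤x ; x≡k⇒ = λ e → inj₁ (subst (m <_) e m<x)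
    ; core = u ; core-ok = record { is-perm = u-perm ; is-hex = u-hex ; ends-with-N = u-last ; has-label = u-label }
    ; w≡inflate = w≡inflate-u ; countedByK≡ = trans (cong (filterᵇ (K <ᵇ_)) active≡A) Ahigh≡Top }

deflate : ∀ n x k l m w → w ↭ interval 1 n → hex w ≡ true → label w ≡ (x , k , l , m) → Deflation n x k l m w
deflate n x k l m w r hw lab with M-of w ≟ 0
... | no M≢0 = DeflateNonIncreasing.deflation n x k l m w r hw lab M≢0
... | yes M≡0 with trans (sym (proj₁ (deflate-increasing n w r M≡0))) lab
...   | refl = proj₂ (deflate-increasing n w r M≡0)

subseqs-++⁻ : ∀ xs ys {s} → s ∈ subseqs (xs ++ ys) → ∃ λ s₁ → ∃ λ s₂ → s ≡ s₁ ++ s₂ × s₁ ∈ subseqs xs × s₂ ∈ subseqs ys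
subseqs-++⁻ [] ys m = [] , _ , refl , here refl , m
subseqs-++⁻ (x ∷ xs) ys m with MP.∈-++⁻ (map (x ∷_) (subseqs (xs ++ ys))) m
... | inj₁ m₁ = let (s′ , m′ , e) = MP.∈-map⁻ (x ∷_) m₁ ; (s₁ , s₂ , e₂ , a , b) = subseqs-++⁻ xs ys m′ in
                x ∷ s₁ , s₂ , trans e (cong (x ∷_) e₂) , ∷∈subseqs x xs a , b
... | inj₂ m₂ = let (s₁ , s₂ , e₂ , a , b) = subseqs-++⁻ xs ys m₂ in s₁ , s₂ , e₂ , subseqs-skip x xs a , b

subseqs-⊆ : ∀ w {s v} → s ∈ subseqs w → v ∈ s → v ∈ w
subseqs-⊆ [] (here refl) ()
subseqs-⊆ (x ∷ w) m vm with MP.∈-++⁻ (map (x ∷_) (subseqs w)) m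
... | inj₁ m₁ with MP.∈-map⁻ (x ∷_) m₁
...   | (s′ , m′ , refl) with vm
...     | here refl = here refl
...     | there vm′ = there (subseqs-⊆ w m′ vm′)
subseqs-⊆ (x ∷ w) m vm | inj₂ m₂ = there (subseqs-⊆ w m₂ vm)

subseqs-pairwise : ∀ {R : ℕ → ℕ → Set} w {s} → s ∈ subseqs w → AllPairs R w → AllPairs R s
subseqs-pairwise [] (here refl) u = []
subseqs-pairwise (x ∷ w) m (ax ∷ u) with MP.∈-++⁻ (map (x ∷_) (subseqs w)) m
... | inj₁ m₁ with MP.∈-map⁻ (x ∷_) m₁
...   | (s′ , m′ , refl) = tabulate (λ vm → lookup ax (subseqs-⊆ w m′ vm)) ∷ subseqs-pairwise w m′ u
subseqs-pairwise (x ∷ w) m (ax ∷ u) | inj₂ m₂ = subseqs-pairwise w m₂ u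

subseqs-∷⁻ : ∀ w {a s} → (a ∷ s) ∈ subseqs w → ∃ λ p → ∃ λ r → w ≡ p ++ a ∷ r × s ∈ subseqs r
subseqs-∷⁻ [] (here ())
subseqs-∷⁻ [] (there ())
subseqs-∷⁻ (x ∷ w) m with MP.∈-++⁻ (map (x ∷_) (subseqs w)) m
... | inj₁ m₁ with MP.∈-map⁻ (x ∷_) m₁
...   | (s′ , m′ , refl) = [] , w , refl , m′
subseqs-∷⁻ (x ∷ w) m | inj₂ m₂ = let (p , r , e , sm) = subseqs-∷⁻ w m₂ in x ∷ p , r , cong (x ∷_) e , sm

contains⁻ : ∀ w π → contains w π ≡ true → ∃ λ s → s ∈ subseqs w × sameOrder s π ≡ true
contains⁻ w π = any⁻ (λ s → sameOrder s π) (subseqs w)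

contains⁺ : ∀ w π {s} → s ∈ subseqs w → sameOrder s π ≡ true → contains w π ≡ true
contains⁺ w π m so = any-∈⁺ (λ s → sameOrder s π) (subseqs w) m so

not-xor⇒≡ : ∀ {a b} → not (a xor b) ≡ true → a ≡ b
not-xor⇒≡ {true} {true} e = refl
not-xor⇒≡ {false} {false} e = refl

orderedLike : ℕ → ℕ → List ℕ → List ℕ → Bool
orderedLike a b s π = and (zipWith (λ a′ b′ → not ((a <ᵇ a′) xor (b <ᵇ b′))) s π)

zipWith-at : ∀ (f : ℕ → ℕ → Bool) xs ys d p xs′ ys′ → length xs ≡ length xs′ →
             and (zipWith f (xs ++ d ∷ ys) (xs′ ++ p ∷ ys′)) ≡ true → f d p ≡ true
zipWith-at f [] ys d p [] ys′ e h = ∧-trueˡ h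
zipWith-at f (x ∷ xs) ys d p (x′ ∷ xs′) ys′ e h = zipWith-at f xs ys d p xs′ ys′ (suc-injective e) (∧-trueʳ {f x x′} h)

countᵇ-≥-∷ : ∀ a b d p s π → (a <ᵇ d) ≡ (b <ᵇ p) → countᵇ (not ∘ (_<ᵇ d)) s ≡ countᵇ (not ∘ (_<ᵇ p)) π →
             countᵇ (not ∘ (_<ᵇ d)) (a ∷ s) ≡ countᵇ (not ∘ (_<ᵇ p)) (b ∷ π)
countᵇ-≥-∷ a b d p s π ab ce with true-or-false (a <ᵇ d)
... | inj₁ t = trans (countᵇ-reject (not ∘ (_<ᵇ d)) {a} s (cong not t)) (trans ce (sym (countᵇ-reject (not ∘ (_<ᵇ p)) {b} π (cong not (trans (sym ab) t)))))
... | inj₂ f = trans (countᵇ-accept (not ∘ (_<ᵇ d)) {a} s (cong not f)) (trans (cong suc ce)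
      (sym (countᵇ-accept (not ∘ (_<ᵇ p)) {b} π (cong not (trans (sym ab) f)))))

sameOrder-split : ∀ s₁ d s₂ π → sameOrder (s₁ ++ d ∷ s₂) π ≡ true →
  ∃ λ π₁ → ∃ λ p → ∃ λ π₂ → π ≡ π₁ ++ p ∷ π₂ × length π₁ ≡ length s₁ ×
    countᵇ (not ∘ (_<ᵇ d)) s₁ ≡ countᵇ (not ∘ (_<ᵇ p)) π₁ × sameOrder (d ∷ s₂) (p ∷ π₂) ≡ true
sameOrder-split [] d s₂ (p ∷ π₂) h = [] , p , π₂ , refl , refl , refl , h
sameOrder-split (a ∷ s₁) d s₂ (b ∷ π) h =
  let head-ok = ∧-trueˡ h
      (π₁ , p , π₂ , eq , le , ce , so) = sameOrder-split s₁ d s₂ π (∧-trueʳ {orderedLike a b (s₁ ++ d ∷ s₂) π} h)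
      ab = not-xor⇒≡ (zipWith-at (λ a′ b′ → not ((a <ᵇ a′) xor (b <ᵇ b′))) s₁ s₂ d p π₁ π₂ (sym le)
             (subst (λ z → orderedLike a b (s₁ ++ d ∷ s₂) z ≡ true) eq head-ok))
  in b ∷ π₁ , p , π₂ , cong (b ∷_) eq , cong suc le , countᵇ-≥-∷ a b d p s₁ π₁ ab ce , so

allᵇ : (ℕ → Bool) → List ℕ → Bool
allᵇ q [] = true
allᵇ q (x ∷ xs) = q x ∧ allᵇ q xs

increasingᵇ : List ℕ → Bool
increasingᵇ [] = true
increasingᵇ (a ∷ τ) = allᵇ (a <ᵇ_) τ ∧ increasingᵇ τ

sameOrder-length : ∀ s π → sameOrder s π ≡ true → length s ≡ length π
sameOrder-length [] [] e = refl
sameOrder-length (a ∷ s) (b ∷ π) e = cong suc (sameOrder-length s π (∧-trueʳ {orderedLike a b s π} e))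

orderedLike-allᵇ : ∀ a b s π → All (a <_) s → length s ≡ length π → orderedLike a b s π ≡ true → allᵇ (b <ᵇ_) π ≡ true
orderedLike-allᵇ a b [] [] _ _ _ = refl
orderedLike-allᵇ a b (x ∷ s) (y ∷ π) (ax ∷ as) le h =
  cong₂ _∧_ (trans (sym (not-xor⇒≡ (∧-trueˡ h))) (<ᵇ-true ax)) (orderedLike-allᵇ a b s π as (suc-injective le)
        (∧-trueʳ {not ((a <ᵇ x) xor (b <ᵇ y))} h))

sameOrder-increasing : ∀ t τ → Increasing t → sameOrder t τ ≡ true → increasingᵇ τ ≡ true
sameOrder-increasing [] [] _ _ = refl
sameOrder-increasing (a ∷ t) (b ∷ τ) (at ∷ it) h =
  let rest = ∧-trueʳ {orderedLike a b t τ} h in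
  cong₂ _∧_ (orderedLike-allᵇ a b t τ at (sameOrder-length t τ rest) (∧-trueˡ h)) (sameOrder-increasing t τ it rest)

NeedsThreeAbove : List ℕ → Set
NeedsThreeAbove π = ∀ π₁ p π₂ → π ≡ π₁ ++ p ∷ π₂ → increasingᵇ (p ∷ π₂) ≡ true → (2 <ᵇ countᵇ (not ∘ (_<ᵇ p)) π₁) ≡ true

threeAbove? : List ℕ → List ℕ → Bool
threeAbove? π₁ [] = true
threeAbove? π₁ (p ∷ π₂) = (not (increasingᵇ (p ∷ π₂)) ∨ (2 <ᵇ countᵇ (not ∘ (_<ᵇ p)) π₁)) ∧ threeAbove? (π₁ ++ [ p ]) π₂

threeAbove?-sound : ∀ π₀ π₁ p π₂ → threeAbove? π₀ (π₁ ++ p ∷ π₂) ≡ true → increasingᵇ (p ∷ π₂) ≡ true →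
                    (2 <ᵇ countᵇ (not ∘ (_<ᵇ p)) (π₀ ++ π₁)) ≡ true
threeAbove?-sound π₀ [] p π₂ e inc rewrite LP.++-identityʳ π₀ = implies (∧-trueˡ e) inc
  where
  implies : ∀ {b c} → (not b ∨ c) ≡ true → b ≡ true → c ≡ true
  implies {true} e refl = e
threeAbove?-sound π₀ (x ∷ π₁) p π₂ e inc rewrite sym (LP.++-assoc π₀ [ x ] π₁) =
  threeAbove?-sound (π₀ ++ [ x ]) π₁ p π₂ (∧-trueʳ {not (increasingᵇ (x ∷ π₁ ++ p ∷ π₂)) ∨ (2 <ᵇ countᵇ (not ∘ (_<ᵇ x)) π₀)} e) inc

needsThreeAbove : ∀ π → threeAbove? [] π ≡ true → NeedsThreeAbove π
needsThreeAbove π ok π₁ p π₂ refl inc = threeAbove?-sound [] π₁ p π₂ ok inc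

split321 : ∀ π₁ p π₂ → pattern321 ≡ π₁ ++ p ∷ π₂ → increasingᵇ (p ∷ π₂) ≡ true → π₁ ≡ 3 ∷ 2 ∷ [] × p ≡ 1
split321 [] p π₂ refl ()
split321 (a ∷ []) p π₂ refl ()
split321 (a ∷ b ∷ []) p π₂ refl _ = refl , refl
split321 (a ∷ b ∷ c ∷ []) p π₂ ()
split321 (a ∷ b ∷ c ∷ d ∷ π₁) p π₂ ()

-- An occurrence of a pattern in the inflation either lies in the relabelled core (and then
-- in the core itself), or reaches into the top block.  A top entry d is exceeded only by the
-- images of N - 1 and N, which rules out the four long patterns outright, and a 321 ending
-- in the top block forces N before N - 1 in the core.
module InflateHex (n k l m : ℕ) (adm : Admissible n k l m) (u : List ℕ) (u-perm : u ↭ interval 1 (n ∸ k)) (u-hex : hex u ≡ true)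
                  (N-1-not-after-N : ∀ p r → u ≡ p ++ (n ∸ k) ∷ r → (n ∸ k) ∸ 1 ∈ r → ⊥) where
  open Inflation n k l m adm

  w : List ℕ
  w = map g u ++ Top

  w-perm : w ↭ interval 1 n
  w-perm = ↭-trans (PP.++⁺ʳ Top (PP.map⁺ g u-perm)) (↭-sym interval-partition)

  top-below-g⇒near-N : ∀ {j d} → j ∈ u → d ∈ Top → d ≤ g j → N ∸ 1 ≤ j × j ≤ N
  top-below-g⇒near-N {j} {d} jm dm le with Permutation.bounded u-perm jm
  ... | (s≤s {_} {j′} _ , jN) with <-cmp (suc (suc j′)) N
  ...   | tri< lt _ _ = ⊥-elim (<-irrefl refl (≤-<-trans (≤-trans (subst (d ≤_) (below j′ lt) le) (∸-monoˡ-≤ 2 lt))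
        (<ᵇ-true⁻ {N ∸ 2} {d} (∧-trueˡ (proj₂ (Top-bounded dm))))))
  ...   | tri≈ _ e _ = ≤-reflexive (cong (_∸ 1) (sym e)) , jN
  ...   | tri> _ _ gt = ≤-trans (∸-monoˡ-≤ 1 (≤-pred gt)) (n≤1+n j′) , jN

  TopOccurrence : List ℕ → Set
  TopOccurrence π = ∃ λ s₁ → ∃ λ d → ∃ λ s₂ → s₁ ∈ subseqs u × (d ∷ s₂) ∈ subseqs Top × sameOrder (map g s₁ ++ d ∷ s₂) π ≡ true

  occurrence-cases : ∀ π → contains w π ≡ true → contains u π ≡ true ⊎ TopOccurrence π
  occurrence-cases π c with contains⁻ w π c
  ... | (s , sm , so) with subseqs-++⁻ (map g u) Top sm
  ... | (s₁ , s₂ , refl , m₁ , m₂) with MP.∈-map⁻ (map g) (subst (s₁ ∈_) (subseqs-map g mono u) m₁)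
  ... | (s₁′ , m₁′ , refl) with s₂
  ... | [] = inj₁ (contains⁺ u π m₁′ (trans (sym (sameOrder-map g mono s₁′ π)) (subst (λ z → sameOrder z π ≡ true)
        (LP.++-identityʳ (map g s₁′)) so)))
  ... | d ∷ s₂′ = inj₂ (s₁′ , d , s₂′ , m₁′ , m₂ , so)

  top-entry : ∀ π s₁ d s₂ → (d ∷ s₂) ∈ subseqs Top → sameOrder (map g s₁ ++ d ∷ s₂) π ≡ true →
    ∃ λ π₁ → ∃ λ p → ∃ λ π₂ → π ≡ π₁ ++ p ∷ π₂ × length π₁ ≡ length s₁ × countᵇ (not ∘ (_<ᵇ d) ∘ g) s₁ ≡ countᵇ (not ∘ (_<ᵇ p)) π₁ × increasingᵇ (p ∷ π₂) ≡ true
  top-entry π s₁ d s₂ m₂ so =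
    let (π₁ , p , π₂ , eq , le , ce , so₂) = sameOrder-split (map g s₁) d s₂ π so in
    π₁ , p , π₂ , eq , trans le (LP.length-map g s₁) , trans (sym (countᵇ-map (not ∘ (_<ᵇ d)) g s₁)) ce ,
    sameOrder-increasing (d ∷ s₂) (p ∷ π₂) (subseqs-pairwise Top m₂ Top-increasing) so₂

  at-most-two-above : ∀ s₁ d → s₁ ∈ subseqs u → d ∈ Top → countᵇ (not ∘ (_<ᵇ d) ∘ g) s₁ ≤ 2
  at-most-two-above s₁ d m dm = countᵇ≤2 _ (N ∸ 1) N s₁ (subseqs-pairwise u m (Permutation.unique u-perm)) (λ j jm e →
    let (lo , hi) = top-below-g⇒near-N (subseqs-⊆ u m jm) dm (<ᵇ-false⁻ (not-true⁻ e)) in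
    [ (λ lt → inj₁ (≤-antisym (≤-pred′ lt) lo)) , inj₂ ]′ (m≤n⇒m<n∨m≡n hi))
    where
    ≤-pred′ : ∀ {j N} → j < N → j ≤ N ∸ 1
    ≤-pred′ {N = suc N} (s≤s q) = q

  contains-lift : ∀ π → (TopOccurrence π → ⊥) → contains u π ≡ false → contains w π ≡ false
  contains-lift π no-top cu with true-or-false (contains w π)
  ... | inj₂ f = f
  ... | inj₁ t = [ (λ cu′ → ⊥-elim (true≢false (trans (sym cu′) cu))) , (λ occ → ⊥-elim (no-top occ)) ]′ (occurrence-cases π t)

  no-long-top-occurrence : ∀ π → NeedsThreeAbove π → TopOccurrence π → ⊥
  no-long-top-occurrence π need (s₁ , d , s₂ , m₁ , m₂ , so) =
    let (π₁ , p , π₂ , eq , _ , ce , inc) = top-entry π s₁ d s₂ m₂ so in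
    <-irrefl refl (<-≤-trans (<ᵇ-true⁻ (need π₁ p π₂ eq inc)) (subst (_≤ 2) ce (at-most-two-above s₁ d m₁ (subseqs-⊆ Top m₂ (here refl)))))

  no-321-top-occurrence : TopOccurrence pattern321 → ⊥
  no-321-top-occurrence (s₁ , d , s₂ , m₁ , m₂ , so) with top-entry pattern321 s₁ d s₂ m₂ so
  ... | (π₁ , p , π₂ , eq , len , ce , inc) with split321 π₁ p π₂ eq inc
  ... | (refl , refl) with s₁ | len
  ... | ja ∷ jb ∷ [] | _ =
    let both-above = countᵇ-all⁻ (not ∘ (_<ᵇ d) ∘ g) (ja ∷ jb ∷ []) ce
        dm = subseqs-⊆ Top m₂ (here refl)
        (_ , ja≤N) = top-below-g⇒near-N (subseqs-⊆ u m₁ (here refl)) dm (<ᵇ-false⁻ (not-true⁻ (both-above ja (here refl))))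
        (N-1≤jb , _) = top-below-g⇒near-N (subseqs-⊆ u m₁ (there (here refl))) dm (<ᵇ-false⁻ (not-true⁻ (both-above jb (there (here refl)))))
        gjb≤gja : g jb ≤ g ja
        gjb≤gja = <ᵇ-false⁻ (not-xor⇒≡ (∧-trueˡ (∧-trueˡ so)))
        ja≢jb : ja ≢ jb
        ja≢jb = lookup (AllPairs.head (subseqs-pairwise u m₁ (Permutation.unique u-perm))) (here refl)
        jb<ja : jb < ja
        jb<ja = ≤∧≢⇒< (≮⇒≥ (λ lt → <-irrefl refl (<-≤-trans (monotone-< g mono lt) gjb≤gja))) (λ e → ja≢jb (sym e))
        ja≡N : ja ≡ N
        ja≡N = ≤-antisym ja≤N (≤-trans (m≤n+m∸n N 1) (≤-trans (s≤s N-1≤jb) jb<ja))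
        jb≡N-1 : jb ≡ N ∸ 1
        jb≡N-1 = ≤-antisym (∸-monoˡ-≤ 1 (subst (suc jb ≤_) ja≡N jb<ja)) N-1≤jb
        (p′ , r′ , u≡ , rest) = subseqs-∷⁻ u (subst (λ z → z ∈ subseqs u) (cong₂ (λ x y → x ∷ y ∷ []) ja≡N jb≡N-1) m₁)
    in N-1-not-after-N p′ r′ u≡ (subseqs-⊆ r′ rest (here refl))

  w-hex : hex w ≡ true
  w-hex =
    let (a₀ , a₁ , a₂ , a₃ , a₄) = hex⁻ u u-hex
        lift : ∀ π → (TopOccurrence π → ⊥) → avoids u π ≡ true → avoids w π ≡ true
        lift π no-top a = avoids⁺ w π (contains-lift π no-top (avoids⁻ u π a))
        long : ∀ π → threeAbove? [] π ≡ true → avoids u π ≡ true → avoids w π ≡ true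
        long π ok = lift π (no-long-top-occurrence π (needsThreeAbove π ok))
    in hex⁺ w (lift pattern321 no-321-top-occurrence a₀ , long hexPattern₁ refl a₁ , long hexPattern₂ refl a₂ , long hexPattern₃ refl a₃ , long hexPattern₄ refl a₄)

-- Labels of an inflation

∈B₂-++⁻ : ∀ xs ys {v} → v ∈ B₂ (xs ++ ys) → v ∈ B₂ ys ⊎ (∃ λ p → ∃ λ r → xs ≡ p ++ v ∷ r × ∃ λ c → c ∈ r ++ ys × c < v)
∈B₂-++⁻ [] ys m = inj₁ m
∈B₂-++⁻ (x ∷ xs) ys {v} m with any (_<ᵇ x) (xs ++ ys) in e
∈B₂-++⁻ (x ∷ xs) ys {v} (here refl) | true = let (c , cm , lt) = any-<ᵇ⁻ x (xs ++ ys) e in inj₂ ([] , xs , refl , c , cm , lt)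
∈B₂-++⁻ (x ∷ xs) ys {v} (there m) | true = [ inj₁ , (λ { (p , r , eq , rest) → inj₂ (x ∷ p , r , cong (x ∷_) eq , rest) }) ]′ (∈B₂-++⁻ xs ys m)
∈B₂-++⁻ (x ∷ xs) ys {v} m | false = [ inj₁ , (λ { (p , r , eq , rest) → inj₂ (x ∷ p , r , cong (x ∷_) eq , rest) }) ]′ (∈B₂-++⁻ xs ys m)

2≤⇒1≤∸1 : ∀ {N} → 2 ≤ N → 1 ≤ N ∸ 1
2≤⇒1≤∸1 {suc zero} (s≤s ())
2≤⇒1≤∸1 {suc (suc N)} _ = s≤s z≤n

2≤⇒∸1< : ∀ {N} → 2 ≤ N → N ∸ 1 < N
2≤⇒∸1< {suc zero} (s≤s ())
2≤⇒∸1< {suc (suc N)} _ = ≤-refl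

module InflateLabel (n k l m : ℕ) (adm : Admissible n k l m) (u : List ℕ) (u-perm : u ↭ interval 1 (n ∸ k)) where
  open Inflation n k l m adm

  u-unique : Unique u
  u-unique = Permutation.unique u-perm

  u-positive : ∀ {v} → v ∈ u → 1 ≤ v
  u-positive m = proj₁ (Permutation.bounded u-perm m)

  u-≤N : ∀ {v} → v ∈ u → v ≤ N
  u-≤N m = proj₂ (Permutation.bounded u-perm m)

  w : List ℕ
  w = map g u ++ Top

  g-cases : ∀ j → 1 ≤ j → j ≤ N → (suc j < N × g j ≡ j) ⊎ ((suc j ≡ N × g j ≡ valueL) ⊎ (j ≡ N × g j ≡ valueM))
  g-cases (suc j) _ jN with <-cmp (suc (suc j)) N
  ... | tri< lt _ _ = inj₁ (lt , below j lt)
  ... | tri≈ _ e _ = inj₂ (inj₁ (e , at-pred j e))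
  ... | tri> _ _ gt = inj₂ (inj₂ (≤-antisym jN (≤-pred gt) , at-N j (≤-antisym jN (≤-pred gt))))

  g-N : 1 ≤ N → g N ≡ valueM
  g-N p with g-cases N p ≤-refl
  ... | inj₁ (lt , _) = ⊥-elim (<-irrefl refl (≤-trans (n≤1+n _) lt))
  ... | inj₂ (inj₁ (e , _)) = ⊥-elim (<-irrefl (sym e) (n<1+n N))
  ... | inj₂ (inj₂ (_ , q)) = q

  g-N∸1 : 2 ≤ N → g (N ∸ 1) ≡ valueL
  g-N∸1 p with g-cases (N ∸ 1) (2≤⇒1≤∸1 p) (m∸n≤m N 1)
  ... | inj₁ (lt , _) = ⊥-elim (<-irrefl (lemma N p) lt)
    where
    lemma : ∀ N → 2 ≤ N → suc (N ∸ 1) ≡ N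
    lemma (suc zero) (s≤s ())
    lemma (suc (suc N)) _ = refl
  ... | inj₂ (inj₁ (_ , q)) = q
  ... | inj₂ (inj₂ (e , _)) = ⊥-elim (<-irrefl e (2≤⇒∸1< p))

  Top>N∸2 : ∀ {d} → d ∈ Top → N ∸ 2 < d
  Top>N∸2 {d} dm = <ᵇ-true⁻ {N ∸ 2} {d} (∧-trueˡ (proj₂ (Top-bounded dm)))

  Top≢values : ∀ {d} → d ∈ Top → d ≢ valueL × d ≢ valueM
  Top≢values {d} dm =
    let e = ∧-trueʳ {N ∸ 2 <ᵇ d} (proj₂ (Top-bounded dm)) in
    (λ q → true≢false (trans (sym (∧-trueˡ e)) (cong not (≡ᵇ-true q)))) ,
    (λ q → true≢false (trans (sym (∧-trueʳ {not (d ≡ᵇ valueL)} e)) (cong not (≡ᵇ-true q))))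

  Top-above-all : ∀ t → (∀ d → d ∈ Top → t < d) → countᵇ (t <ᵇ_) Top ≡ k
  Top-above-all t h = trans (countᵇ-all (t <ᵇ_) Top (λ d dm → <ᵇ-true (h d dm))) length-Top

  Top-above-small : ∀ t → t ≤ N ∸ 2 → countᵇ (t <ᵇ_) Top ≡ k
  Top-above-small t le = Top-above-all t (λ d dm → ≤-<-trans le (Top>N∸2 dm))

  Top-above-image : ∀ t → t ≤ N → countᵇ (g t <ᵇ_) Top ≡ n ∸ g t ∸ (N ∸ t)
  Top-above-image t t≤N = sym (begin
    n ∸ g t ∸ (N ∸ t)                                                    ≡⟨ cong (_∸ (N ∸ t)) (sym (countᵇ->-interval (g t) n)) ⟩
    countᵇ (g t <ᵇ_) (interval 1 n) ∸ (N ∸ t)                             ≡⟨ cong (_∸ (N ∸ t)) (countᵇ-resp-↭ (g t <ᵇ_) interval-partition) ⟩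
    countᵇ (g t <ᵇ_) (map g (interval 1 N) ++ Top) ∸ (N ∸ t)              ≡⟨ cong (_∸ (N ∸ t)) (countᵇ-++ (g t <ᵇ_)
          (map g (interval 1 N)) Top) ⟩
    countᵇ (g t <ᵇ_) (map g (interval 1 N)) + countᵇ (g t <ᵇ_) Top ∸ (N ∸ t) ≡⟨ cong (λ z → z + countᵇ (g t <ᵇ_) Top ∸ (N ∸ t)) (trans (countᵇ->-map g mono t (interval 1 N)) (countᵇ->-interval t N)) ⟩
    N ∸ t + countᵇ (g t <ᵇ_) Top ∸ (N ∸ t)                               ≡⟨ m+n∸m≡n (N ∸ t) _ ⟩
    countᵇ (g t <ᵇ_) Top                                                 ∎)
    where open ≡-Reasoning

  Top-above-valueM : 1 ≤ N → countᵇ (valueM <ᵇ_) Top ≡ m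
  Top-above-valueM p = begin
    countᵇ (valueM <ᵇ_) Top          ≡⟨ cong (λ z → countᵇ (z <ᵇ_) Top) (sym (g-N p)) ⟩
    countᵇ (g N <ᵇ_) Top             ≡⟨ Top-above-image N ≤-refl ⟩
    n ∸ g N ∸ (N ∸ N)                ≡⟨ cong₂ (λ a b → n ∸ a ∸ b) (g-N p) (n∸n≡0 N) ⟩
    n ∸ (n ∸ m)                      ≡⟨ m∸[m∸n]≡n (≤-trans m≤l (≤-trans l≤k k≤n)) ⟩
    m                                ∎
    where open ≡-Reasoning

  Top-above-valueL : 2 ≤ N → countᵇ (valueL <ᵇ_) Top ≡ l
  Top-above-valueL p = begin
    countᵇ (valueL <ᵇ_) Top          ≡⟨ cong (λ z → countᵇ (z <ᵇ_) Top) (sym (g-N∸1 p)) ⟩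
    countᵇ (g (N ∸ 1) <ᵇ_) Top       ≡⟨ Top-above-image (N ∸ 1) (m∸n≤m N 1) ⟩
    n ∸ g (N ∸ 1) ∸ (N ∸ (N ∸ 1))    ≡⟨ cong₂ (λ a b → n ∸ a ∸ b) (g-N∸1 p) (m∸[m∸n]≡n (≤-trans (s≤s z≤n) p)) ⟩
    n ∸ (n ∸ l ∸ 1) ∸ 1              ≡⟨ cong (_∸ 1) (trans (cong (n ∸_) (∸-+-assoc n l 1)) (m∸[m∸n]≡n (subst (_≤ n) (+-comm 1 l) l<n))) ⟩
    l + 1 ∸ 1                        ≡⟨ m+n∸n≡m l 1 ⟩
    l                                ∎
    where
    open ≡-Reasoning
    l<n : l < n
    l<n = ≤-<-trans l≤k (k<n (≤-trans (s≤s z≤n) p))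

  B₂-inflate⁻ : ∀ {v} → v ∈ B₂ w → ∃ λ p → ∃ λ r → map g u ≡ p ++ v ∷ r × ∃ λ c → c ∈ r ++ Top × c < v
  B₂-inflate⁻ m with ∈B₂-++⁻ (map g u) Top m
  ... | inj₁ m′ = ⊥-elim (subst (λ z → _ ∈ z → ⊥) (sym (increasing⇒B₂≡[] Top Top-increasing)) (λ ()) m′)
  ... | inj₂ r = r

  B₂-inflate⊆ : ∀ {v} → v ∈ B₂ w → ∃ λ j → j ∈ u × v ≡ g j
  B₂-inflate⊆ m with B₂-inflate⁻ m
  ... | (p , r , e , _) = MP.∈-map⁻ g (subst (_ ∈_) (sym e) (MP.∈-++⁺ʳ p (here refl)))

  label-w : ∀ {X A} → active w ≡ A → length A ≡ X → countᵇ (K-of w <ᵇ_) A ≡ k → countᵇ (L-of w <ᵇ_) A ≡ l →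
            countᵇ (M-of w <ᵇ_) A ≡ m → label w ≡ (X , k , l , m)
  label-w act lenA cK cL cM = cong₂ _,_ (trans (cong length act) lenA)
    (cong₂ _,_ (trans (cong (countᵇ (K-of w <ᵇ_)) act) cK) (cong₂ _,_ (trans (cong (countᵇ (L-of w <ᵇ_)) act) cL)
          (trans (cong (countᵇ (M-of w <ᵇ_)) act) cM)))

-- For k < x the core has a nonempty active region with no entry above K, which forces
-- K = N - 2, L = N - 1 and M = N; the relabelling sends them to K, valueL and valueM.
module InflateLabelLong (n k l m : ℕ) (adm : Admissible n k l m) (u : List ℕ) (u-perm : u ↭ interval 1 (n ∸ k)) (u-hex : hex u ≡ true)
                        (x : ℕ) (k<x : k < x) (u-label : label u ≡ (x ∸ k , 0 , 0 , 0)) where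
  open InflateLabel n k l m adm u u-perm
  open Inflation n k l m adm
  module U = Structure u u-unique (hex⇒avoids321 u u-hex)
  open U using (B; M; L; K; K≤L; L≤M; K≢0⇒; L≢0⇒)

  length-active : length (active u) ≡ x ∸ k
  length-active = cong proj₁ u-label

  active-above-K : countᵇ (K <ᵇ_) (active u) ≡ 0
  active-above-K = cong (proj₁ ∘ proj₂) u-label

  1≤x∸k : 1 ≤ x ∸ k
  1≤x∸k = n≢0⇒n>0 (m>n⇒m∸n≢0 k<x)

  M≢0 : M ≢ 0
  M≢0 M≡0 = <-irrefl refl (<-≤-trans (subst (0 <_) (trans (sym length-active) (trans (cong length active≡u) length≡0)) 1≤x∸k) z≤n)
    where
    active≡u : active u ≡ u
    active≡u = cong (λ z → if z ≡ᵇ 0 then u else after z u) M≡0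
    K≡0 : K ≡ 0
    K≡0 = trans (cong (λ z → maxBelow z B) (trans (cong (λ z → maxBelow z B) M≡0) (maxBelow-0 B))) (maxBelow-0 B)
    length≡0 : length u ≡ 0
    length≡0 = trans (sym (countᵇ-all (0 <ᵇ_) u (λ v vm → <ᵇ-true (u-positive vm))))
                     (trans (cong₂ countᵇ (cong _<ᵇ_ (sym K≡0)) (sym active≡u)) active-above-K)

  open U.AfterMax M≢0

  A≤K : ∀ {v} → v ∈ A → v ≤ K
  A≤K vm = <ᵇ-false⁻ (countᵇ-none⁻ (K <ᵇ_) A (trans (cong (countᵇ (K <ᵇ_)) (sym active≡A)) active-above-K) _ vm)

  A-nonempty : ∃ λ a → a ∈ A
  A-nonempty with A | active≡A
  ... | [] | e = ⊥-elim (<-irrefl refl (<-≤-trans (subst (0 <_) (trans (sym length-active) (cong length e)) 1≤x∸k) z≤n))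
  ... | a ∷ _ | _ = a , here refl

  a₀ : ℕ
  a₀ = proj₁ A-nonempty

  a₀∈A : a₀ ∈ A
  a₀∈A = proj₂ A-nonempty

  A⊆u : ∀ {v} → v ∈ A → v ∈ u
  A⊆u vm = subst (_ ∈_) (sym w≡preM++A) (MP.∈-++⁺ʳ preM vm)

  preM⊆u : ∀ {v} → v ∈ preM → v ∈ u
  preM⊆u vm = subst (_ ∈_) (sym w≡preM++A) (MP.∈-++⁺ˡ vm)

  K≢0 : K ≢ 0
  K≢0 e = <-irrefl refl (<-≤-trans (u-positive (A⊆u a₀∈A)) (subst (a₀ ≤_) e (A≤K a₀∈A)))

  K∈B : K ∈ B
  K∈B = proj₁ (K≢0⇒ K≢0)

  K<L : K < L
  K<L = proj₂ (K≢0⇒ K≢0)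

  L≢0 : L ≢ 0
  L≢0 e = n≮0 (subst (K <_) e K<L)

  L∈B : L ∈ B
  L∈B = proj₁ (L≢0⇒ L≢0)

  L<M : L < M
  L<M = proj₂ (L≢0⇒ L≢0)

  u-above-split : ∀ t → K ≤ t → N ∸ t ≡ countᵇ (t <ᵇ_) preM
  u-above-split t K≤t = begin
    N ∸ t                                          ≡⟨ sym (countᵇ->-interval t N) ⟩
    countᵇ (t <ᵇ_) (interval 1 N)                  ≡⟨ sym (countᵇ-resp-↭ (t <ᵇ_) u-perm) ⟩
    countᵇ (t <ᵇ_) u                               ≡⟨ cong (countᵇ (t <ᵇ_)) w≡preM++A ⟩
    countᵇ (t <ᵇ_) (preM ++ A)                     ≡⟨ countᵇ-++ (t <ᵇ_) preM A ⟩
    countᵇ (t <ᵇ_) preM + countᵇ (t <ᵇ_) A         ≡⟨ cong (countᵇ (t <ᵇ_) preM +_) (countᵇ-none (t <ᵇ_) A (λ v vm → <ᵇ-false (≤-trans (A≤K vm) K≤t))) ⟩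
    countᵇ (t <ᵇ_) preM + 0                        ≡⟨ +-identityʳ _ ⟩
    countᵇ (t <ᵇ_) preM                            ∎
    where open ≡-Reasoning

  preM-above⇒L⊎M : ∀ t → K ≤ t → ∀ a → a ∈ preM → t < a → a ≡ L ⊎ a ≡ M
  preM-above⇒L⊎M t K≤t = above-K⇒L⊎M t K≤t a₀∈A (≤-trans (A≤K a₀∈A) (≤-trans K≤t (n≤1+n t)))

  K≡N∸2 : K ≡ N ∸ 2
  K≡N∸2 = ∸-inverse N K 2 (u-≤N (preM⊆u (B₂⊆preM K∈B))) (trans (u-above-split K ≤-refl)
    (≤-antisym (countᵇ≤2 (K <ᵇ_) L M preM preM-unique (λ a am e → preM-above⇒L⊎M K ≤-refl a am (<ᵇ-true⁻ e)))
               (countᵇ≥2 (K <ᵇ_) preM (B₂⊆preM L∈B) M∈preM (λ e → <-irrefl e L<M) (<ᵇ-true K<L) (<ᵇ-true (<-trans K<L L<M)))))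

  L≡N∸1 : L ≡ N ∸ 1
  L≡N∸1 = ∸-inverse N L 1 (u-≤N (preM⊆u (B₂⊆preM L∈B))) (trans (u-above-split L K≤L)
    (≤-antisym (countᵇ≤1 (L <ᵇ_) M preM preM-unique (λ a am e →
                  [ (λ z → ⊥-elim (<-irrefl (sym z) (<ᵇ-true⁻ {L} {a} e))) , (λ z → z) ]′ (preM-above⇒L⊎M L K≤L a am (<ᵇ-true⁻ e))))
               (countᵇ≥1 (L <ᵇ_) preM M∈preM (<ᵇ-true L<M))))

  M≡N : M ≡ N
  M≡N = ∸-inverse N M 0 (u-≤N (preM⊆u M∈preM)) (trans (u-above-split M (≤-trans K≤L L≤M))
    (countᵇ-none (M <ᵇ_) preM (λ a am → <ᵇ-false (≮⇒≥ (λ lt →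
      [ (λ z → <-irrefl refl (<-≤-trans lt (≤-trans (≤-reflexive z) L≤M))) , (λ z → <-irrefl (sym z) lt) ]′
        (preM-above⇒L⊎M M (≤-trans K≤L L≤M) a am lt))))))

  N-1-not-after-N : ∀ p r → u ≡ p ++ N ∷ r → N ∸ 1 ∈ r → ⊥
  N-1-not-after-N p r e mr =
    let (_ , r≡A) = split-unique pre p (subst (_∉ pre) M≡N M∉pre) (proj₁ (unique-split p (subst (Unique {A = ℕ}) e u-unique)))
                      (trans (sym (subst (λ z → u ≡ pre ++ z ∷ A) M≡N w≡pre++M∷A)) e)
    in B₂∉A L∈B (subst (_∈ A) (sym L≡N∸1) (subst (N ∸ 1 ∈_) (sym r≡A) mr))

  open InflateHex n k l m adm u u-perm u-hex N-1-not-after-N using (top-below-g⇒near-N)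

  3≤N : 3 ≤ N
  3≤N = lemma N (subst (1 ≤_) K≡N∸2 (n≢0⇒n>0 K≢0))
    where
    lemma : ∀ N → 1 ≤ N ∸ 2 → 3 ≤ N
    lemma zero ()
    lemma (suc zero) ()
    lemma (suc (suc zero)) ()
    lemma (suc (suc (suc N))) _ = s≤s (s≤s (s≤s z≤n))

  2+K≡N : suc (suc K) ≡ N
  2+K≡N = trans (cong (suc ∘ suc) K≡N∸2) (lemma N 3≤N)
    where
    lemma : ∀ N → 3 ≤ N → suc (suc (N ∸ 2)) ≡ N
    lemma (suc zero) (s≤s ())
    lemma (suc (suc zero)) (s≤s (s≤s ()))
    lemma (suc (suc (suc N))) _ = refl

  g-K : g K ≡ K
  g-K = lemma K refl (n≢0⇒n>0 K≢0)
    where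
    lemma : ∀ K′ → K′ ≡ K → 1 ≤ K′ → g K′ ≡ K′
    lemma (suc j) e _ = below j (subst (suc (suc j) <_) (trans (cong (suc ∘ suc) e) 2+K≡N) ≤-refl)

  g-L : g L ≡ valueL
  g-L = trans (cong g L≡N∸1) (g-N∸1 (≤-trans (s≤s (s≤s z≤n)) 3≤N))

  g-M : g M ≡ valueM
  g-M = trans (cong g M≡N) (g-N (≤-trans (s≤s z≤n) 3≤N))

  near-N⇒∈B : ∀ j → N ∸ 1 ≤ j → j ≤ N → j ∈ B
  near-N⇒∈B j N-1≤j j≤N with m≤n⇒m<n∨m≡n j≤N
  ... | inj₁ j<N = subst (_∈ B) (trans L≡N∸1 (≤-antisym N-1≤j (∸-monoˡ-≤ 1 j<N))) L∈B
  ... | inj₂ j≡N = subst (_∈ B) (trans M≡N (sym j≡N)) M∈B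

  B₂-w⊆ : ∀ v → v ∈ B₂ w → v ∈ map g B
  B₂-w⊆ v vm with B₂-inflate⁻ vm
  ... | (p , r , e , c , cm , lt) = [ smaller-in-core , smaller-in-top ]′ (MP.∈-++⁻ r cm)
    where
    smaller-in-core : c ∈ r → v ∈ map g B
    smaller-in-core cr = subst (v ∈_) (B₂-map g mono u) (subst (λ z → v ∈ B₂ z) (sym e) (∈-B₂⁺ p v r c cr lt))
    smaller-in-top : c ∈ Top → v ∈ map g B
    smaller-in-top cT =
      let (j , jm , v≡gj) = MP.∈-map⁻ g (subst (v ∈_) (sym e) (MP.∈-++⁺ʳ p (here refl)))
          (lo , hi) = top-below-g⇒near-N jm cT (subst (c ≤_) v≡gj (<⇒≤ lt))
      in subst (_∈ map g B) (sym v≡gj) (MP.∈-map⁺ g (near-N⇒∈B j lo hi))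

  B₂-w⊇ : ∀ v → v ∈ map g B → v ∈ B₂ w
  B₂-w⊇ v vm = hasSmallerAfter⇒∈B₂ (hasSmallerAfter-++ʳ Top (∈B₂⇒hasSmallerAfter (map g u) (subst (v ∈_) (sym (B₂-map g mono u)) vm)))

  M-w : M-of w ≡ g M
  M-w = trans (maxList-cong (B₂ w) (map g B) B₂-w⊆ B₂-w⊇) (maxList-map g mono refl B)

  L-w : L-of w ≡ g L
  L-w = trans (cong (λ z → maxBelow z (B₂ w)) M-w) (trans (maxBelow-cong (g M) (B₂ w) (map g B) B₂-w⊆ B₂-w⊇) (maxBelow-map g mono refl M B))

  K-w : K-of w ≡ g K
  K-w = trans (cong (λ z → maxBelow z (B₂ w)) L-w) (trans (maxBelow-cong (g L) (B₂ w) (map g B) B₂-w⊆ B₂-w⊇) (maxBelow-map g mono refl L B))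

  active-w : active w ≡ map g A ++ Top
  active-w = trans (cong (λ z → if z ≡ᵇ 0 then w else after z w) M-w)
    (subst (λ b → (if b then w else after (g M) w) ≡ map g A ++ Top) (sym (≡ᵇ-false {g M} {0} (M≢0 ∘ monotone-injective g mono)))
      (trans (cong (λ z → after (g M) (z ++ Top)) (trans (cong (map g) w≡pre++M∷A) (LP.map-++ g pre (M ∷ A))))
        (trans (cong (after (g M)) (LP.++-assoc (map g pre) (g M ∷ map g A) Top))
          (after-split (map g pre) (map g A ++ Top) (λ mm → M∉pre (let (j , jm , e) = MP.∈-map⁻ g mm in subst (_∈ pre)
                (sym (monotone-injective g mono e)) jm))))))

  active-w-above : ∀ t c → K ≤ t → countᵇ (g t <ᵇ_) Top ≡ c → countᵇ (g t <ᵇ_) (map g A ++ Top) ≡ c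
  active-w-above t c K≤t top = begin
    countᵇ (g t <ᵇ_) (map g A ++ Top)                   ≡⟨ countᵇ-++ (g t <ᵇ_) (map g A) Top ⟩
    countᵇ (g t <ᵇ_) (map g A) + countᵇ (g t <ᵇ_) Top   ≡⟨ cong₂ _+_ (trans (countᵇ->-map g mono t A)
          (countᵇ-none (t <ᵇ_) A (λ v vm → <ᵇ-false (≤-trans (A≤K vm) K≤t)))) top ⟩
    c                                                   ∎
    where open ≡-Reasoning

  w-label : label w ≡ (x , k , l , m)
  w-label = label-w active-w
    (trans (LP.length-++ (map g A)) (trans (cong₂ _+_ (trans (LP.length-map g A)
          (trans (cong length (sym active≡A)) length-active)) length-Top) (m∸n+n≡m (<⇒≤ k<x))))
    (subst (λ z → countᵇ (z <ᵇ_) (map g A ++ Top) ≡ k) (sym K-w)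
          (active-w-above K k ≤-refl (trans (cong (λ z → countᵇ (z <ᵇ_) Top) g-K) (Top-above-small K (≤-reflexive K≡N∸2)))))
    (subst (λ z → countᵇ (z <ᵇ_) (map g A ++ Top) ≡ l) (sym L-w) (active-w-above L l K≤L (trans (cong (λ z → countᵇ (z <ᵇ_) Top) g-L)
          (Top-above-valueL (≤-trans (s≤s (s≤s z≤n)) 3≤N)))))
    (subst (λ z → countᵇ (z <ᵇ_) (map g A ++ Top) ≡ m) (sym M-w) (active-w-above M m (≤-trans K≤L L≤M)
          (trans (cong (λ z → countᵇ (z <ᵇ_) Top) g-M) (Top-above-valueM (≤-trans (s≤s z≤n) 3≤N)))))

-- For x = k the core ends with N, so valueM = g N is the last entry before the top block and
-- the active region of the inflation is the top block itself.
module InflateLabelShort (n k l m : ℕ) (adm : Admissible n k l m) (u : List ℕ) (u-perm : u ↭ interval 1 (n ∸ k))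
                         (u-last : lastIs (n ∸ k) u ≡ true) (1≤N : 1 ≤ n ∸ k) (m<k : m < k) where
  open InflateLabel n k l m adm u u-perm
  open Inflation n k l m adm

  u′ : List ℕ
  u′ = proj₁ (lastIs⁻ N u 1≤N u-last)

  u≡u′∷ʳN : u ≡ u′ ++ N ∷ []
  u≡u′∷ʳN = proj₂ (lastIs⁻ N u 1≤N u-last)

  N∉u′ : N ∉ u′
  N∉u′ = proj₁ (unique-split u′ (subst (Unique {A = ℕ}) u≡u′∷ʳN u-unique))

  N-1-not-after-N : ∀ p r → u ≡ p ++ N ∷ r → N ∸ 1 ∈ r → ⊥
  N-1-not-after-N p r e mr =
    let (_ , []≡r) = split-unique u′ p N∉u′ (proj₁ (unique-split p (subst (Unique {A = ℕ}) e u-unique))) (trans (sym u≡u′∷ʳN) e)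
    in subst (λ z → N ∸ 1 ∈ z → ⊥) []≡r (λ ()) mr

  w≡ : w ≡ map g u′ ++ valueM ∷ Top
  w≡ = trans (cong (λ z → map g z ++ Top) u≡u′∷ʳN)
         (trans (cong (_++ Top) (LP.map-++ g u′ (N ∷ [])))
           (trans (LP.++-assoc (map g u′) (g N ∷ []) Top) (cong (λ z → map g u′ ++ z ∷ Top) (g-N 1≤N))))

  Top-below : ∀ t → countᵇ (t <ᵇ_) Top < k → ∃ λ d → d ∈ Top × d ≤ t
  Top-below t lt = let (d , dm , f) = countᵇ<length⁻ (t <ᵇ_) Top (subst (countᵇ (t <ᵇ_) Top <_) (sym length-Top) lt) in d , dm , <ᵇ-false⁻ f

  valueM∈B₂ : valueM ∈ B₂ w
  valueM∈B₂ = let (d , dm , le) = Top-below valueM (subst (_< k) (sym (Top-above-valueM 1≤N)) m<k) in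
    subst (λ z → valueM ∈ B₂ z) (sym w≡) (∈-B₂⁺ (map g u′) valueM Top d dm (≤∧≢⇒< le (proj₂ (Top≢values dm))))

  M-w : M-of w ≡ valueM
  M-w = maxList-≡ (B₂ w) valueM valueM∈B₂ (λ v vm →
    let (j , jm , e) = B₂-inflate⊆ vm in subst₂ _≤_ (sym e) (g-N 1≤N) (monotone-≤ g mono (u-≤N jm)))

  active-w : active w ≡ Top
  active-w = trans (cong (λ z → if z ≡ᵇ 0 then w else after z w) M-w)
    (subst (λ b → (if b then w else after valueM w) ≡ Top) (sym (≡ᵇ-false {valueM} {0} (λ e → <-irrefl (sym e)
          (proj₁ (valueM-bounded 1≤N)))))
      (trans (cong (after valueM) w≡) (after-split (map g u′) Top valueM∉)))
    where
    valueM∉ : valueM ∉ map g u′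
    valueM∉ mm = let (j , jm , e) = MP.∈-map⁻ g mm in N∉u′ (subst (_∈ u′) (monotone-injective g mono (trans (sym e) (sym (g-N 1≤N)))) jm)

  B₂-below-M : ∀ {v} → v ∈ B₂ w → v < valueM → (v ≡ valueL × 2 ≤ N) ⊎ v ≤ N ∸ 2
  B₂-below-M {v} vm lt with B₂-inflate⊆ vm
  ... | (j , jm , refl) with g-cases j (u-positive jm) (u-≤N jm)
  ...   | inj₁ (lt′ , gj≡j) = inj₂ (subst (_≤ N ∸ 2) (sym gj≡j) (∸-monoˡ-≤ 2 lt′))
  ...   | inj₂ (inj₁ (e , gj≡L)) = inj₁ (gj≡L , subst (2 ≤_) e (s≤s (u-positive jm)))
  ...   | inj₂ (inj₂ (_ , gj≡M)) = ⊥-elim (<-irrefl gj≡M lt)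

  label-from : ∀ {Lw Kw} → L-of w ≡ Lw → K-of w ≡ Kw → countᵇ (Lw <ᵇ_) Top ≡ l → countᵇ (Kw <ᵇ_) Top ≡ k → label w ≡ (k , k , l , m)
  label-from eL eK cL cK = label-w active-w length-Top
    (trans (cong (λ z → countᵇ (z <ᵇ_) Top) eK) cK) (trans (cong (λ z → countᵇ (z <ᵇ_) Top) eL) cL)
    (trans (cong (λ z → countᵇ (z <ᵇ_) Top) M-w) (Top-above-valueM 1≤N))

  -- When l < k, the entry valueL = g (N - 1) also precedes a smaller top entry, so L-of w = valueL.
  module L-below-K (l<k : l < k) where
    2≤N : 2 ≤ N
    2≤N with m≤n⇒m<n∨m≡n 1≤N
    ... | inj₁ q = q
    ... | inj₂ e = ⊥-elim (<-irrefl (1+k≡n⇒ (trans (cong (_+ k) e) N+k≡n)) l<k)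

    N-1∈u′ : N ∸ 1 ∈ u′
    N-1∈u′ with MP.∈-++⁻ u′ (subst (N ∸ 1 ∈_) u≡u′∷ʳN (Permutation.bounded⇒∈ u-perm (2≤⇒1≤∸1 2≤N) (m∸n≤m N 1)))
    ... | inj₁ q = q
    ... | inj₂ (here e) = ⊥-elim (<-irrefl e (2≤⇒∸1< 2≤N))

    valueL∈B₂ : valueL ∈ B₂ w
    valueL∈B₂ =
      let (q , s , u′≡) = MP.∈-∃++ N-1∈u′
          (d , dm , le) = Top-below valueL (subst (_< k) (sym (Top-above-valueL 2≤N)) l<k)
          w≡′ : w ≡ map g q ++ valueL ∷ (map g s ++ valueM ∷ Top)
          w≡′ = trans w≡ (trans (cong (λ z → map g z ++ valueM ∷ Top) u′≡)
                  (trans (cong (_++ valueM ∷ Top) (LP.map-++ g q (N ∸ 1 ∷ s)))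
                    (trans (LP.++-assoc (map g q) (g (N ∸ 1) ∷ map g s) (valueM ∷ Top))
                      (cong (λ z → map g q ++ z ∷ (map g s ++ valueM ∷ Top)) (g-N∸1 2≤N)))))
      in subst (λ z → valueL ∈ B₂ z) (sym w≡′)
           (∈-B₂⁺ (map g q) valueL (map g s ++ valueM ∷ Top) d (MP.∈-++⁺ʳ (map g s) (there dm)) (≤∧≢⇒< le (proj₁ (Top≢values dm))))

    L-w : L-of w ≡ valueL
    L-w = trans (cong (λ z → maxBelow z (B₂ w)) M-w) (maxBelow-≡ valueM (B₂ w) valueL valueL∈B₂ (valueL<valueM 2≤N)
      (λ v vm vlt → [ (λ q → ≤-reflexive (proj₁ q)) , (λ q → ≤-trans (≤-trans q (n≤1+n _)) (valueL-large 2≤N)) ]′ (B₂-below-M vm vlt)))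

    K-w≤ : K-of w ≤ N ∸ 2
    K-w≤ = subst (λ z → maxBelow z (B₂ w) ≤ N ∸ 2) (sym L-w) (maxBelow-least valueL (B₂ w) (N ∸ 2)
      (λ v vm vlt → [ (λ q → ⊥-elim (<-irrefl (proj₁ q) vlt)) , (λ q → q) ]′ (B₂-below-M vm (<-trans vlt (valueL<valueM 2≤N)))))

    w-label : label w ≡ (k , k , l , m)
    w-label = label-from L-w refl (Top-above-valueL 2≤N) (Top-above-small (K-of w) K-w≤)

  -- When l = k, valueL = N - 1, so every top entry exceeds both L-of w and K-of w.
  module L-equals-K (l≡k : l ≡ k) where
    valueL≡N∸1 : valueL ≡ N ∸ 1
    valueL≡N∸1 = cong (λ z → n ∸ z ∸ 1) l≡k

    Top>N∸1 : ∀ d → d ∈ Top → N ∸ 1 < d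
    Top>N∸1 d dm = ≤∧≢⇒< (≤-trans (lemma N) (Top>N∸2 dm)) (λ e → proj₁ (Top≢values dm) (trans (sym e) (sym valueL≡N∸1)))
      where
      lemma : ∀ N → N ∸ 1 ≤ suc (N ∸ 2)
      lemma zero = z≤n
      lemma (suc zero) = z≤n
      lemma (suc (suc N)) = ≤-refl

    L-w≤ : L-of w ≤ N ∸ 1
    L-w≤ = subst (λ z → maxBelow z (B₂ w) ≤ N ∸ 1) (sym M-w) (maxBelow-least valueM (B₂ w) (N ∸ 1)
      (λ v vm vlt → [ (λ q → ≤-reflexive (trans (proj₁ q) valueL≡N∸1)) , (λ q → ≤-trans q (∸-monoʳ-≤ N (s≤s (z≤n {1})))) ]′ (B₂-below-M vm vlt)))

    K-w≤ : K-of w ≤ N ∸ 1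
    K-w≤ = maxBelow-least (L-of w) (B₂ w) (N ∸ 1) (λ v vm vlt → ≤-trans (<⇒≤ vlt) L-w≤)

    w-label : label w ≡ (k , k , l , m)
    w-label = label-from refl refl
      (trans (Top-above-all (L-of w) (λ d dm → ≤-<-trans L-w≤ (Top>N∸1 d dm))) (sym l≡k))
      (Top-above-all (K-of w) (λ d dm → ≤-<-trans K-w≤ (Top>N∸1 d dm)))

  w-label : label w ≡ (k , k , l , m)
  w-label with m≤n⇒m<n∨m≡n l≤k
  ... | inj₁ l<k = L-below-K.w-label l<k
  ... | inj₂ l≡k = L-equals-K.w-label l≡k

HexPermWithLabel : ℕ → ℕ → ℕ → ℕ → ℕ → List ℕ → Set
HexPermWithLabel n x k l m w = w ↭ interval 1 n × hex w ≡ true × label w ≡ (x , k , l , m)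

inflate-correct : ∀ n x k l m → Admissible n k l m → k ≤ x → (x ≡ k → m < k ⊎ (k ≡ n × l ≡ n × m ≡ n)) →
    ∀ u → Core (n ∸ k) x k u → HexPermWithLabel n x k l m (inflate n k l m u)
inflate-correct n x k l m adm k≤x x≡k⇒ u (record { is-perm = u-perm ; is-hex = u-hex ; ends-with-N = u-last ; has-label = u-label })
  with m≤n⇒m<n∨m≡n k≤x
... | inj₁ k<x = H.w-perm , H.w-hex , Long.w-label
  where
  module Long = InflateLabelLong n k l m adm u u-perm u-hex x k<x (u-label k<x)
  module H = InflateHex n k l m adm u u-perm u-hex Long.N-1-not-after-N
... | inj₂ refl with n ∸ k ≟ 0
...   | no N≢0 = H.w-perm , H.w-hex , Short.w-label
  where
  m<k : m < k
  m<k with x≡k⇒ refl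
  ... | inj₁ q = q
  ... | inj₂ (e , _) = ⊥-elim (N≢0 (trans (cong (n ∸_) e) (n∸n≡0 n)))
  module Short = InflateLabelShort n k l m adm u u-perm (u-last refl) (n≢0⇒n>0 N≢0) m<k
  module H = InflateHex n k l m adm u u-perm u-hex Short.N-1-not-after-N
...   | yes N≡0 = H.w-perm , H.w-hex , subst (λ z → label z ≡ (k , k , l , m)) (sym inflate≡Top) top-label
  where
  open Inflation n k l m adm using (Top; Top-increasing; Top-bounded; length-Top)
  k≡n : k ≡ n
  k≡n = ≤-antisym (Admissible.k≤n adm) (m∸n≡0⇒m≤n N≡0)
  u≡[] : u ≡ []
  u≡[] = PP.↭-empty-inv (subst (u ↭_) (cong (interval 1) N≡0) u-perm)
  N-1-not-after-N : ∀ p r → u ≡ p ++ (n ∸ k) ∷ r → (n ∸ k) ∸ 1 ∈ r → ⊥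
  N-1-not-after-N p r e _ with LP.++-conicalʳ p _ (trans (sym e) u≡[])
  ... | ()
  module H = InflateHex n k l m adm u u-perm u-hex N-1-not-after-N
  inflate≡Top : inflate n k l m u ≡ Top
  inflate≡Top = cong (λ z → map (relabel n k l m) z ++ Top) u≡[]
  top-label : label Top ≡ (k , k , l , m)
  top-label = trans (B₂≡[]⇒label Top (increasing⇒B₂≡[] Top Top-increasing) (λ v vm → proj₁ (proj₁ (Top-bounded vm))))
    (cong₂ _,_ length-Top (cong₂ _,_ length-Top (cong₂ _,_ (trans length-Top (trans k≡n (sym (proj₁ (Admissible.k≡n⇒ adm k≡n)))))
                                                           (trans length-Top (trans k≡n (sym (proj₂ (Admissible.k≡n⇒ adm k≡n))))))))

-- Enumerating permutations

∈-insertEverywhere⁻ : ∀ a v {s} → s ∈ insertEverywhere a v → ∃ λ p → ∃ λ q → v ≡ p ++ q × s ≡ p ++ a ∷ q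
∈-insertEverywhere⁻ a [] (here refl) = [] , [] , refl , refl
∈-insertEverywhere⁻ a (b ∷ r) (here refl) = [] , b ∷ r , refl , refl
∈-insertEverywhere⁻ a (b ∷ r) (there m) with MP.∈-map⁻ (b ∷_) m
... | (s′ , m′ , refl) = let (p , q , e₁ , e₂) = ∈-insertEverywhere⁻ a r m′ in b ∷ p , q , cong (b ∷_) e₁ , cong (b ∷_) e₂

∈-insertEverywhere⁺ : ∀ a p q → (p ++ a ∷ q) ∈ insertEverywhere a (p ++ q)
∈-insertEverywhere⁺ a [] [] = here refl
∈-insertEverywhere⁺ a [] (b ∷ q) = here refl
∈-insertEverywhere⁺ a (b ∷ p) q = there (MP.∈-map⁺ (b ∷_) (∈-insertEverywhere⁺ a p q))

∈-perms⁻ : ∀ n {s} → s ∈ perms n → s ↭ interval 1 n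
∈-perms⁻ zero (here refl) = ↭-refl
∈-perms⁻ (suc n) {s} m with MP.∈-concat⁻′ (map (insertEverywhere (suc n)) (perms n)) m
... | (xs , sm , xm) with MP.∈-map⁻ (insertEverywhere (suc n)) xm
...   | (v , vm , refl) with ∈-insertEverywhere⁻ (suc n) v sm
...     | (p , q , refl , refl) =
  ↭-trans (PP.shift (suc n) p q) (↭-trans (prep (suc n) (∈-perms⁻ n vm))
    (↭-trans (PP.++-comm (suc n ∷ []) (interval 1 n)) (↭-reflexive (sym (interval-suc 1 n)))))

∈-perms⁺ : ∀ n {s} → s ↭ interval 1 n → s ∈ perms n
∈-perms⁺ zero r = subst (_∈ perms 0) (sym (PP.↭-empty-inv r)) (here refl)
∈-perms⁺ (suc n) {s} r =
  let (p , q , s≡) = MP.∈-∃++ (PP.∈-resp-↭ (↭-sym r) (∈-interval⁺ {1} {suc n} (s≤s z≤n) ≤-refl))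
      p++q↭ : p ++ q ↭ interval 1 n
      p++q↭ = subst (p ++ q ↭_) (LP.++-identityʳ (interval 1 n))
                (PP.drop-mid p (interval 1 n) (subst₂ _↭_ s≡ (interval-suc 1 n) r))
  in MP.∈-concat⁺′ (subst (_∈ insertEverywhere (suc n) (p ++ q)) (sym s≡) (∈-insertEverywhere⁺ (suc n) p q))
       (MP.∈-map⁺ (insertEverywhere (suc n)) (∈-perms⁺ n p++q↭))

insertEverywhere-unique : ∀ a (v : List ℕ) → a ∉ v → Unique (insertEverywhere a v)
insertEverywhere-unique a [] _ = [] ∷ []
insertEverywhere-unique a (b ∷ r) a∉ =
  tabulate (λ sm e → let (s′ , _ , e′) = MP.∈-map⁻ (b ∷_) sm in a∉ (here (proj₁ (LP.∷-injective (trans e e′)))))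
  ∷ UP.map⁺ (λ e → proj₂ (LP.∷-injective e)) (insertEverywhere-unique a r (λ m → a∉ (there m)))

insertEverywhere-disjoint : ∀ a v v′ → a ∉ v → a ∉ v′ → v ≢ v′ → Disjoint (insertEverywhere a v) (insertEverywhere a v′)
insertEverywhere-disjoint a v v′ a∉v a∉v′ v≢v′ (m , m′) =
  let (p , q , e₁ , e₂) = ∈-insertEverywhere⁻ a v m ; (p′ , q′ , e₁′ , e₂′) = ∈-insertEverywhere⁻ a v′ m′
      (p≡ , q≡) = split-unique p p′ (λ z → a∉v (subst (a ∈_) (sym e₁) (MP.∈-++⁺ˡ z))) (λ z → a∉v′ (subst (a ∈_) (sym e₁′)
            (MP.∈-++⁺ˡ z))) (trans (sym e₂) e₂′)
  in v≢v′ (trans e₁ (trans (cong₂ _++_ p≡ q≡) (sym e₁′)))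

perms-unique : ∀ n → Unique (perms n)
perms-unique zero = [] ∷ []
perms-unique (suc n) =
  UP.concat⁺ (AllP.map⁺ (tabulate (λ vm → insertEverywhere-unique (suc n) _ (top∉ vm))))
    (APP.map⁺ (pairwise (perms n) top∉ (perms-unique n)))
  where
  top∉ : ∀ {v} → v ∈ perms n → suc n ∉ v
  top∉ vm z = <-irrefl refl (proj₂ (∈-interval⁻ {1} {n} (PP.∈-resp-↭ (∈-perms⁻ n vm) z)))
  pairwise : ∀ vs → (∀ {v} → v ∈ vs → suc n ∉ v) → Unique vs →
             AllPairs (λ v v′ → Disjoint (insertEverywhere (suc n) v) (insertEverywhere (suc n) v′)) vs
  pairwise [] _ [] = []
  pairwise (v ∷ vs) h (v≢ ∷ u) =
    tabulate (λ m → insertEverywhere-disjoint (suc n) v _ (h (here refl)) (h (there m)) (lookup v≢ m)) ∷ pairwise vs (h ∘ there) u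

length-bijection : ∀ {A B : Set} (f : B → A) {xs : List A} {ys : List B} → Unique xs → Unique ys →
                   (∀ {b b′} → f b ≡ f b′ → b ≡ b′) → (∀ {b} → b ∈ ys → f b ∈ xs) → (∀ {a} → a ∈ xs → ∃ λ b → b ∈ ys × a ≡ f b) →
                   length xs ≡ length ys
length-bijection f {xs} {ys} xs-unique ys-unique f-injective to from =
  trans (sym (PP.↭-length (∼bag⇒↭ (unique∧set⇒bag (UP.map⁺ f-injective ys-unique) xs-unique (mk⇔ image⊆ ⊆image)))))
        (LP.length-map f ys)
  where
  image⊆ : ∀ {a} → a ∈ map f ys → a ∈ xs
  image⊆ m = let (b , bm , e) = MP.∈-map⁻ f m in subst (_∈ xs) (sym e) (to bm)
  ⊆image : ∀ {a} → a ∈ xs → a ∈ map f ys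
  ⊆image m = let (b , bm , e) = from m in subst (_∈ map f ys) (sym e) (MP.∈-map⁺ f bm)

isPerm⇒↭ : ∀ {n w} → IsPerm n w → w ↭ interval 1 n
isPerm⇒↭ {n} p = subst (_ ↭_) (map-suc-upTo n) p

↭⇒isPerm : ∀ {n w} → w ↭ interval 1 n → IsPerm n w
↭⇒isPerm {n} p = subst (_ ↭_) (sym (map-suc-upTo n)) p

∈-filter-perms⁻ : ∀ n (p : List ℕ → Bool) {w} → w ∈ filterᵇ p (perms n) → IsPerm n w × T (p w)
∈-filter-perms⁻ n p m = let (wp , pw) = ∈-filterᵇ⁻ p (perms n) m in ↭⇒isPerm (∈-perms⁻ n wp) , ≡true⇒T pw

∈-filter-perms⁺ : ∀ n (p : List ℕ → Bool) {w} → IsPerm n w × T (p w) → w ∈ filterᵇ p (perms n)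
∈-filter-perms⁺ n p (wp , pw) = ∈-filterᵇ⁺ p (perms n) (∈-perms⁺ n (isPerm⇒↭ wp)) (T⇒≡true pw)

take-length-++ : ∀ (xs ys : List ℕ) → take (length xs) (xs ++ ys) ≡ xs
take-length-++ [] ys = refl
take-length-++ (x ∷ xs) ys = cong (x ∷_) (take-length-++ xs ys)

drop-length-++ : ∀ (xs ys : List ℕ) → drop (length xs) (xs ++ ys) ≡ ys
drop-length-++ [] ys = refl
drop-length-++ (x ∷ xs) ys = drop-length-++ xs ys

InH⁻ : ∀ {n x k l m w} → isZeroLabel x k l m ≡ false → InH n x k l m w → HexPermWithLabel n x k l m w
InH⁻ {n} {x} {k} {l} {m} {w} ≢0 (p , t) =
  let t′ = T⇒≡true (subst (λ z → T (hex w ∧ (if z then lastIs n w else labelIs x k l m w))) ≢0 t) in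
  isPerm⇒↭ p , ∧-trueˡ t′ , labelIs⁻ x k l m w (∧-trueʳ {hex w} t′)

InH⁺ : ∀ {n x k l m w} → isZeroLabel x k l m ≡ false → HexPermWithLabel n x k l m w → InH n x k l m w
InH⁺ {n} {x} {k} {l} {m} {w} ≢0 (r , h , lab) = ↭⇒isPerm r ,
  subst (λ z → T (hex w ∧ (if z then lastIs n w else labelIs x k l m w))) (sym ≢0) (≡true⇒T (trans (cong (_∧ labelIs x k l m w) h)
        (labelIs⁺ x k l m w lab)))

InH⇒Core : ∀ N x k u → InH N (x ∸ k) 0 0 0 u → Core N x k u
InH⇒Core N x k u (p , t) with x ∸ k in e
... | zero = record { is-perm = isPerm⇒↭ p ; is-hex = ∧-trueˡ (T⇒≡true t) ; ends-with-N = λ _ → ∧-trueʳ {hex u} (T⇒≡true t) ; has-label = λ k<x → ⊥-elim (m>n⇒m∸n≢0 k<x e) }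
... | suc y = record { is-perm = isPerm⇒↭ p ; is-hex = ∧-trueˡ (T⇒≡true t) ; ends-with-N = λ x≡k → ⊥-elim (1+n≢0 (trans (sym e)
      (trans (cong (_∸ k) x≡k) (n∸n≡0 k))))
                     ; has-label = λ _ → subst (λ z → label u ≡ (z , 0 , 0 , 0)) (sym e) (labelIs⁻ (suc y) 0 0 0 u (∧-trueʳ {hex u} (T⇒≡true t))) }

Core⇒InH : ∀ N x k u → k ≤ x → Core N x k u → InH N (x ∸ k) 0 0 0 u
Core⇒InH N x k u k≤x c with x ∸ k in e
... | zero = ↭⇒isPerm (Core.is-perm c) , ≡true⇒T (trans (cong (_∧ lastIs N u) (Core.is-hex c))
      (Core.ends-with-N c (≤-antisym (m∸n≡0⇒m≤n e) k≤x)))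
... | suc y = ↭⇒isPerm (Core.is-perm c) , ≡true⇒T (trans (cong (_∧ labelIs (suc y) 0 0 0 u) (Core.is-hex c))
                (labelIs⁺ (suc y) 0 0 0 u (subst (λ z → label u ≡ (z , 0 , 0 , 0)) e (Core.has-label c (m∸n≢0⇒n<m (λ e′ → 1+n≢0 (trans (sym e) e′)))))))

delStd-inflate : ∀ n k l m (adm : Admissible n k l m) u → u ↭ interval 1 (n ∸ k) → delStd k (inflate n k l m u) ≡ u
delStd-inflate n k l m adm u u-perm = begin
  standardize (take (length (inflate n k l m u) ∸ k) (map g u ++ Top))  ≡⟨ cong (λ z → standardize (take z (map g u ++ Top))) length-front ⟩
  standardize (take (length (map g u)) (map g u ++ Top))                  ≡⟨ cong standardize (take-length-++ (map g u) Top) ⟩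
  standardize (map g u)                                                   ≡⟨ standardize-map g mono u ⟩
  standardize u                                                           ≡⟨ standardize-permutation u-perm ⟩
  u                                                                       ∎
  where
  open ≡-Reasoning
  open Inflation n k l m adm using (g; mono; Top; length-Top)
  length-front : length (inflate n k l m u) ∸ k ≡ length (map g u)
  length-front = trans (cong (_∸ k) (trans (LP.length-++ (map g u)) (cong (length (map g u) +_) length-Top))) (m+n∸n≡m (length (map g u)) k)

inflate-injective : ∀ n k l m → Admissible n k l m → ∀ {u u′} → inflate n k l m u ≡ inflate n k l m u′ → u ≡ u′
inflate-injective n k l m adm {u} {u′} e = LP.map-injective (monotone-injective g mono) (LP.++-cancelʳ Top (map g u) (map g u′) e)
  where open Inflation n k l m adm using (g; mono; Top)

-- The witness w₀ is only needed for the admissibility of the label; every other w is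
-- deflated on its own.
module Bijection (n x k l m : ℕ) (≢0 : isZeroLabel x k l m ≡ false) (w₀ : List ℕ) (w₀∈H : InH n x k l m w₀) where
  N : ℕ
  N = n ∸ k

  deflation : ∀ {w} → InH n x k l m w → Deflation n x k l m w
  deflation {w} w∈H = let (w-perm , w-hex , w-label) = InH⁻ ≢0 w∈H in deflate n x k l m w w-perm w-hex w-label

  admissible : Admissible n k l m
  admissible = Deflation.admissible (deflation w₀∈H)

  k≤x : k ≤ x
  k≤x = Deflation.k≤x (deflation w₀∈H)

  inflate-∈H : ∀ u → InH N (x ∸ k) 0 0 0 u → InH n x k l m (inflate n k l m u)
  inflate-∈H u u∈H = InH⁺ ≢0 (inflate-correct n x k l m admissible k≤x (Deflation.x≡k⇒ (deflation w₀∈H)) u (InH⇒Core N x k u u∈H))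

  delStd≡core : ∀ {w} (w∈H : InH n x k l m w) → delStd k w ≡ Deflation.core (deflation w∈H)
  delStd≡core w∈H = let D = deflation w∈H in
    trans (cong (delStd k) (Deflation.w≡inflate D)) (delStd-inflate n k l m (Deflation.admissible D) _ (Core.is-perm (Deflation.core-ok D)))

  delStd-∈H : ∀ w → InH n x k l m w → InH N (x ∸ k) 0 0 0 (delStd k w)
  delStd-∈H w w∈H = let D = deflation w∈H in
    subst (InH N (x ∸ k) 0 0 0) (sym (delStd≡core w∈H)) (Core⇒InH N x k _ (Deflation.k≤x D) (Deflation.core-ok D))

  w≡inflate-delStd : ∀ {w} → InH n x k l m w → w ≡ inflate n k l m (delStd k w)
  w≡inflate-delStd w∈H = trans (Deflation.w≡inflate (deflation w∈H)) (cong (inflate n k l m) (sym (delStd≡core w∈H)))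

  delStd-injective : ∀ w w′ → InH n x k l m w → InH n x k l m w′ → delStd k w ≡ delStd k w′ → w ≡ w′
  delStd-injective w w′ w∈H w′∈H e = trans (w≡inflate-delStd w∈H) (trans (cong (inflate n k l m) e) (sym (w≡inflate-delStd w′∈H)))

  delStd-surjective : ∀ u → InH N (x ∸ k) 0 0 0 u → ∃ λ w → InH n x k l m w × delStd k w ≡ u
  delStd-surjective u u∈H = inflate n k l m u , inflate-∈H u u∈H , delStd-inflate n k l m admissible u (Core.is-perm (InH⇒Core N x k u u∈H))

  drop≡countedByK : ∀ w → InH n x k l m w → drop N w ≡ countedByK w
  drop≡countedByK w w∈H =
    trans (cong (drop N) (Deflation.w≡inflate D))
      (trans (cong (λ z → drop z (inflate n k l m u)) (sym (trans (LP.length-map g u)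
            (Permutation.length≡ (Core.is-perm (Deflation.core-ok D))))))
        (trans (drop-length-++ (map g u) Top) (sym (Deflation.countedByK≡ D))))
    where
    D : Deflation n x k l m w
    D = deflation w∈H
    u : List ℕ
    u = Deflation.core D
    open Inflation n k l m (Deflation.admissible D) using (g; Top)

  h≡h : h n x k l m ≡ h N (x ∸ k) 0 0 0
  h≡h = length-bijection (inflate n k l m)
    (UP.filter⁺ (T? ∘ inHᵇ n x k l m) (perms-unique n)) (UP.filter⁺ (T? ∘ inHᵇ N (x ∸ k) 0 0 0) (perms-unique N))
    (inflate-injective n k l m admissible)
    (λ u∈ → ∈-filter-perms⁺ n (inHᵇ n x k l m) (inflate-∈H _ (∈-filter-perms⁻ N (inHᵇ N (x ∸ k) 0 0 0) u∈)))
    (λ {w} w∈ → let w∈H = ∈-filter-perms⁻ n (inHᵇ n x k l m) w∈ in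
      delStd k w , ∈-filter-perms⁺ N (inHᵇ N (x ∸ k) 0 0 0) (delStd-∈H w w∈H) , w≡inflate-delStd w∈H)

zeroLabel⁻ : ∀ {x k l m} → isZeroLabel x k l m ≡ true → x ≡ 0 × k ≡ 0 × l ≡ 0 × m ≡ 0
zeroLabel⁻ {zero} {zero} {zero} {zero} _ = refl , refl , refl , refl

delStd-zero : ∀ {n} w → IsPerm n w → delStd 0 w ≡ w
delStd-zero w p = trans (cong standardize (LP.take-all (length w) w ≤-refl)) (standardize-permutation (isPerm⇒↭ p))

BijectionStatement : ℕ → ℕ → ℕ → ℕ → ℕ → Set
BijectionStatement n x k l m =
  ((w : List ℕ) → InH n x k l m w → InH (n ∸ k) (x ∸ k) 0 0 0 (delStd k w))
  × ((w w′ : List ℕ) → InH n x k l m w → InH n x k l m w′ → delStd k w ≡ delStd k w′ → w ≡ w′)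
  × ((u : List ℕ) → InH (n ∸ k) (x ∸ k) 0 0 0 u → ∃ (λ w → InH n x k l m w × delStd k w ≡ u))
  × (¬ (x ≡ 0 × k ≡ 0 × l ≡ 0 × m ≡ 0) → (w : List ℕ) → InH n x k l m w → drop (n ∸ k) w ≡ countedByK w)
  × (h n x k l m ≡ h (n ∸ k) (x ∸ k) 0 0 0)

nonzero-label-statement : ∀ n x k l m → isZeroLabel x k l m ≡ false → ∃ (InH n x k l m) → BijectionStatement n x k l m
nonzero-label-statement n x k l m ≢0 (w₀ , w₀∈H) =
  B.delStd-∈H , B.delStd-injective , B.delStd-surjective , (λ _ → B.drop≡countedByK) , B.h≡h
  where
  module B = Bijection n x k l m ≢0 w₀ w₀∈H

zero-label-statement : ∀ n x k l m → isZeroLabel x k l m ≡ true → BijectionStatement n x k l m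
zero-label-statement n x k l m ≡0 with zeroLabel⁻ {x} {k} {l} {m} ≡0
... | (refl , refl , refl , refl) =
  (λ w w∈H → subst (InH n 0 0 0 0) (sym (delStd-zero w (proj₁ w∈H))) w∈H) ,
  (λ w w′ w∈H w′∈H eq → trans (sym (delStd-zero w (proj₁ w∈H))) (trans eq (delStd-zero w′ (proj₁ w′∈H)))) ,
  (λ u u∈H → u , u∈H , delStd-zero u (proj₁ u∈H)) ,
  (λ ≢0 → ⊥-elim (≢0 (refl , refl , refl , refl))) ,
  refl

mainTheorem2 : (n x k l m : ℕ) → 1 ≤ n → k ≤ n →
    ∃ (λ w → InH n x k l m w) →
    ((w : List ℕ) → InH n x k l m w → InH (n ∸ k) (x ∸ k) 0 0 0 (delStd k w))
    × ((w w′ : List ℕ) → InH n x k l m w → InH n x k l m w′ →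
         delStd k w ≡ delStd k w′ → w ≡ w′)
    × ((u : List ℕ) → InH (n ∸ k) (x ∸ k) 0 0 0 u →
         ∃ (λ w → InH n x k l m w × delStd k w ≡ u))
    × (¬ (x ≡ 0 × k ≡ 0 × l ≡ 0 × m ≡ 0) →
         (w : List ℕ) → InH n x k l m w → drop (n ∸ k) w ≡ countedByK w)
    × (h n x k l m ≡ h (n ∸ k) (x ∸ k) 0 0 0)
mainTheorem2 n x k l m _ _ inhabited with true-or-false (isZeroLabel x k l m)
... | inj₁ ≡0 = zero-label-statement n x k l m ≡0
... | inj₂ ≢0 = nonzero-label-statement n x k l m ≢0 inhabited
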